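{- Let $q$ be a complex number with $|q|<1$. Then \begin{align*} \sum_{i,j\geq 0}\frac{q^{\frac{i(3i-1)}{2}+4ij+4j^2}}{(q;q)_i (q^2;q^2)_j} &=\frac{1}{(q,q^4;q^5)_\infty}, \\ \sum_{i,j\geq 0}\frac{q^{\frac{i(3i+1)}{2}+4ij+4j^2+2j}}{(q;q)_i(q^2;q^2)_j}&=\frac{1}{(q^2,q^3;q^5)_\infty}. \end{align*}
   Context: For $n\in\mathbb{Z}_{\ge0}\cup\{\infty\}$: $(a;q)_0=1$, $(a;q)_n=\prod_{k=0}^{n-1}(1-aq^k)$, $(a;q)_\infty=\prod_{k\ge0}(1-aq^k)$, and $(a_1,\dots,a_m;q)_n=(a_1;q)_n\cdots(a_m;q)_n$. -}

module Defs where

open import Data.Nat as ℕ using (ℕ; zero; suc; _≤?_; _∸_)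
open import Data.Nat.Divisibility using (_∣_; _∣?_)
open import Data.Integer as ℤ using (ℤ; 0ℤ; 1ℤ)
open import Relation.Nullary using (yes; no)

-- A formal power series: n ↦ coefficient of q^n.
FPS : Set
FPS = ℕ → ℤ

one : FPS
one zero    = 1ℤ
one (suc _) = 0ℤ

-- Σ_{k=0}^{n} f k  (inclusive upper bound)
Σ≤ : ℕ → (ℕ → ℤ) → ℤ
Σ≤ zero    f = f zero
Σ≤ (suc n) f = Σ≤ n f ℤ.+ f (suc n)

_⊛_ : FPS → FPS → FPS
(a ⊛ b) n = Σ≤ n (λ k → a k ℤ.* b (n ∸ k))

shift : ℕ → FPS → FPS
shift e a n with e ≤? n
... | yes _ = a (n ∸ e)
... | no  _ = 0ℤ

-- Geometric series 1/(1 - q^m) = Σ_{t ≥ 0} q^{m t}  (used for m ≥ 1).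
geom : ℕ → FPS
geom m n with m ∣? n
... | yes _ = 1ℤ
... | no  _ = 0ℤ

Π< : ℕ → (ℕ → FPS) → FPS
Π< zero    f = one
Π< (suc N) f = Π< N f ⊛ f N

-- 1/(a;q)_n for a = q^a, base q^b, i.e. Π_{k<n} 1/(1 - q^{a + b k}).
invPoch : ℕ → ℕ → ℕ → FPS
invPoch a b n = Π< n (λ k → geom (a ℕ.+ b ℕ.* k))

-- 1/(q^a;q^b)_∞ (a, b ≥ 1): the coefficient of q^n is stable once all
-- factors with exponent a + b k ≤ n are included; those have k < n + 1,
-- so the coefficient of q^n is that of the finite product up to k = n.
invPoch∞ : ℕ → ℕ → FPS
invPoch∞ a b n = invPoch a b (suc n) n

-- Double sum Σ_{i,j ≥ 0} q^{e i j} · F i ⊛ G j, where the exponent satisfies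
-- e i j ≥ i and e i j ≥ j, so only terms with i, j ≤ n contribute to q^n.
doubleSum : (ℕ → ℕ → ℕ) → (ℕ → FPS) → (ℕ → FPS) → FPS
doubleSum e F G n =
  Σ≤ n (λ i → Σ≤ n (λ j → shift (e i j) (F i ⊛ G j) n))

exp₁ : ℕ → ℕ → ℕ
exp₁ i j = ((i ℕ.* (3 ℕ.* i ∸ 1)) ℕ./ 2) ℕ.+ 4 ℕ.* i ℕ.* j ℕ.+ 4 ℕ.* j ℕ.* j

exp₂ : ℕ → ℕ → ℕ
exp₂ i j = ((i ℕ.* (3 ℕ.* i ℕ.+ 1)) ℕ./ 2) ℕ.+ 4 ℕ.* i ℕ.* j ℕ.+ 4 ℕ.* j ℕ.* j ℕ.+ 2 ℕ.* j

-- Write W m for the double sum Σᵢⱼ q^((i+2j)² + m(i+2j) + i(i-1)/2) / ((q;q)ᵢ (q²;q²)ⱼ), so that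
-- the two left-hand sides are W 0 and W 1. A telescoping argument gives
-- W m = W (m+1) + q^(m+1) W (m+2), hence (q^(m+1);q)∞ W m satisfies the same second-order
-- recurrence as Rogers' series R m, and both are ≡ 1 mod q^(m+1);
-- a solution of that recurrence vanishing mod q^(m+1) for every m is 0, so
-- (q^(m+1);q)∞ W m = R m. Now R 0 = θ(2,3) and (1 - q) R 1 = θ(1,4), where
-- θ(a,c) = Σ_{k∈ℤ} (-1)ᵏ q^(5k(k-1)/2 + ak), and the Jacobi triple product (derived from
-- Euler's identity) gives θ(a,c) = (q^5,q^a,q^c;q^5)∞. Dividing by
-- (q;q)∞ = (q,q²,q³,q⁴,q⁵;q^5)∞ yields the two products.
--
-- Infinite sums and products are taken of terms
-- that vanish (resp. are ≡ 1) modulo q^k at index k, and identities between them are proved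
-- modulo every power q^K.

module Submission where

open import Defs
open import Data.Nat using (ℕ; zero; suc; _+_; _*_; _∸_; _/_; _≤_; _<_; z≤n; s≤s; _≤?_; _<ᵇ_)
import Data.Nat as ℕ
import Data.Nat.Properties as ℕP
open import Data.Nat.Divisibility using (_∣_; _∣?_; ∣m+n∣m⇒∣n; ∣m∸n∣n⇒∣m; ∣-refl; _∣0; >⇒∤)
open import Data.Nat.DivMod using (m*n/n≡m)
open import Data.Nat.Tactic.RingSolver using (solve-∀)
open import Data.Integer as ℤ using (ℤ; 0ℤ; 1ℤ; -_) renaming (_+_ to _+ℤ_; _*_ to _*ℤ_)
import Data.Integer.Properties as ℤP
open import Data.List using (List; []; _∷_; _++_)
open import Data.Product using (_×_; _,_)
open import Data.Bool using (Bool; true; false; if_then_else_)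
open import Data.Maybe using (Maybe; just; nothing)
open import Data.Sum using (inj₁; inj₂)
open import Data.Empty using (⊥-elim)
open import Function using (_∘_)
open import Relation.Nullary using (Dec; yes; no; ¬_)
open import Relation.Binary.PropositionalEquality using (_≡_; refl; sym; trans; cong; cong₂; subst; module ≡-Reasoning)
open import Relation.Binary.Bundles using (Setoid)
import Relation.Binary.Reasoning.Setoid
open import Algebra.Bundles using (CommutativeRing; AbelianGroup)
open import Algebra.Structures using (IsCommutativeRing)
open import Algebra.Properties.CommutativeSemigroup ℤP.+-commutativeSemigroup using (interchange)
import Algebra.Solver.Ring.AlmostCommutativeRing as ACR

-- Formal power series

infix 4 _≈_
record _≈_ (a b : FPS) : Set where
  constructor coeffwise
  field coeff : ∀ n → a n ≡ b n
open _≈_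

infixl 6 _⊕_ _⊖_
infixl 7 _⊗_ _·_
infix 8 ⊝_

_⊕_ : FPS → FPS → FPS
(a ⊕ b) n = a n +ℤ b n

⊝_ : FPS → FPS
(⊝ a) n = - a n

_⊖_ : FPS → FPS → FPS
a ⊖ b = a ⊕ ⊝ b

_⊗_ : FPS → FPS → FPS
_⊗_ = _⊛_

_·_ : ℤ → FPS → FPS
(k · a) n = k *ℤ a n

𝟘 : FPS
𝟘 _ = 0ℤ

cst : ℤ → FPS
cst k zero    = k
cst k (suc _) = 0ℤ

Σ≤-cong : ∀ n {f g : ℕ → ℤ} → (∀ k → k ≤ n → f k ≡ g k) → Σ≤ n f ≡ Σ≤ n g
Σ≤-cong zero    f≡g = f≡g 0 z≤n
Σ≤-cong (suc n) f≡g =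
  cong₂ _+ℤ_ (Σ≤-cong n (λ k k≤n → f≡g k (ℕP.m≤n⇒m≤1+n k≤n))) (f≡g (suc n) ℕP.≤-refl)

Σ≤-distrib-+ : ∀ n (f g : ℕ → ℤ) → Σ≤ n (λ k → f k +ℤ g k) ≡ Σ≤ n f +ℤ Σ≤ n g
Σ≤-distrib-+ zero    f g = refl
Σ≤-distrib-+ (suc n) f g rewrite Σ≤-distrib-+ n f g =
  interchange (Σ≤ n f) (Σ≤ n g) (f (suc n)) (g (suc n))

Σ≤-*ˡ : ∀ n c (f : ℕ → ℤ) → Σ≤ n (λ k → c *ℤ f k) ≡ c *ℤ Σ≤ n f
Σ≤-*ˡ zero    c f = refl
Σ≤-*ˡ (suc n) c f rewrite Σ≤-*ˡ n c f = sym (ℤP.*-distribˡ-+ c (Σ≤ n f) (f (suc n)))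

Σ≤-neg : ∀ n (f : ℕ → ℤ) → Σ≤ n (λ k → - f k) ≡ - Σ≤ n f
Σ≤-neg zero    f = refl
Σ≤-neg (suc n) f rewrite Σ≤-neg n f = sym (ℤP.neg-distrib-+ (Σ≤ n f) (f (suc n)))

Σ≤-zero : ∀ n {f : ℕ → ℤ} → (∀ k → k ≤ n → f k ≡ 0ℤ) → Σ≤ n f ≡ 0ℤ
Σ≤-zero zero    f≡0 = f≡0 0 z≤n
Σ≤-zero (suc n) f≡0 =
  cong₂ _+ℤ_ (Σ≤-zero n (λ k k≤n → f≡0 k (ℕP.m≤n⇒m≤1+n k≤n))) (f≡0 (suc n) ℕP.≤-refl)

Σ≤-suc : ∀ n (f : ℕ → ℤ) → Σ≤ (suc n) f ≡ f 0 +ℤ Σ≤ n (f ∘ suc)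
Σ≤-suc zero    f = refl
Σ≤-suc (suc n) f rewrite Σ≤-suc n f = ℤP.+-assoc (f 0) (Σ≤ n (f ∘ suc)) (f (suc (suc n)))

Σ≤-reverse : ∀ n (f : ℕ → ℤ) → Σ≤ n f ≡ Σ≤ n (λ k → f (n ∸ k))
Σ≤-reverse zero    f = refl
Σ≤-reverse (suc n) f = begin
  Σ≤ n f +ℤ f (suc n)                  ≡⟨ cong (_+ℤ f (suc n)) (Σ≤-reverse n f) ⟩
  Σ≤ n (λ k → f (n ∸ k)) +ℤ f (suc n)  ≡⟨ ℤP.+-comm _ (f (suc n)) ⟩
  f (suc n) +ℤ Σ≤ n (λ k → f (n ∸ k))  ≡⟨ Σ≤-suc n (λ k → f (suc n ∸ k)) ⟨
  Σ≤ (suc n) (λ k → f (suc n ∸ k))     ∎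
  where open ≡-Reasoning

⊛-suc : ∀ (a b : FPS) n → (a ⊛ b) (suc n) ≡ a 0 *ℤ b (suc n) +ℤ ((a ∘ suc) ⊛ b) n
⊛-suc a b n = Σ≤-suc n (λ k → a k *ℤ b (suc n ∸ k))

⊛-comm : ∀ (a b : FPS) n → (a ⊛ b) n ≡ (b ⊛ a) n
⊛-comm a b n = trans (Σ≤-reverse n _) (Σ≤-cong n λ k k≤n →
  trans (cong (λ i → a (n ∸ k) *ℤ b i) (ℕP.m∸[m∸n]≡n k≤n)) (ℤP.*-comm (a (n ∸ k)) (b k)))

⊗-congʳ : ∀ b {a a′} → a ≈ a′ → a ⊗ b ≈ a′ ⊗ b
⊗-congʳ b a≈a′ = coeffwise λ n → Σ≤-cong n λ k _ → cong (_*ℤ _) (coeff a≈a′ k)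

⊗-congˡ : ∀ a {b b′} → b ≈ b′ → a ⊗ b ≈ a ⊗ b′
⊗-congˡ a b≈b′ = coeffwise λ n → Σ≤-cong n λ k _ → cong (a k *ℤ_) (coeff b≈b′ (n ∸ k))

⊛-distribʳ : ∀ (a b c : FPS) n → ((a ⊕ b) ⊛ c) n ≡ (a ⊛ c) n +ℤ (b ⊛ c) n
⊛-distribʳ a b c n =
  trans (Σ≤-cong n λ k _ → ℤP.*-distribʳ-+ (c (n ∸ k)) (a k) (b k)) (Σ≤-distrib-+ n _ _)

⊛-·ˡ : ∀ x (a c : FPS) n → ((x · a) ⊛ c) n ≡ x *ℤ (a ⊛ c) n
⊛-·ˡ x a c n = trans (Σ≤-cong n λ k _ → ℤP.*-assoc x (a k) (c (n ∸ k))) (Σ≤-*ˡ n x _)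

⊛-negˡ : ∀ (a c : FPS) n → ((⊝ a) ⊛ c) n ≡ - (a ⊛ c) n
⊛-negˡ a c n = trans (Σ≤-cong n λ k _ → sym (ℤP.neg-distribˡ-* (a k) (c (n ∸ k)))) (Σ≤-neg n _)

⊛-zeroˡ : ∀ (c : FPS) n → (𝟘 ⊛ c) n ≡ 0ℤ
⊛-zeroˡ c n = Σ≤-zero n λ _ _ → refl

⊛-assoc : ∀ n (a b c : FPS) → ((a ⊛ b) ⊛ c) n ≡ (a ⊛ (b ⊛ c)) n
⊛-assoc zero    a b c = ℤP.*-assoc (a 0) (b 0) (c 0)
⊛-assoc (suc n) a b c = begin
  ((a ⊛ b) ⊛ c) (suc n)
    ≡⟨ ⊛-suc (a ⊛ b) c n ⟩
  a₀b₀ *ℤ c (suc n) +ℤ (((a ⊛ b) ∘ suc) ⊛ c) n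
    ≡⟨ cong (a₀b₀ *ℤ c (suc n) +ℤ_) (coeff (⊗-congʳ c (coeffwise (⊛-suc a b))) n) ⟩
  a₀b₀ *ℤ c (suc n) +ℤ (((a 0 · (b ∘ suc)) ⊕ ((a ∘ suc) ⊛ b)) ⊛ c) n
    ≡⟨ cong (a₀b₀ *ℤ c (suc n) +ℤ_) (⊛-distribʳ (a 0 · (b ∘ suc)) ((a ∘ suc) ⊛ b) c n) ⟩
  a₀b₀ *ℤ c (suc n) +ℤ (((a 0 · (b ∘ suc)) ⊛ c) n +ℤ (((a ∘ suc) ⊛ b) ⊛ c) n)
    ≡⟨ cong₂ (λ x y → a₀b₀ *ℤ c (suc n) +ℤ (x +ℤ y)) (⊛-·ˡ (a 0) (b ∘ suc) c n) (⊛-assoc n (a ∘ suc) b c) ⟩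
  a₀b₀ *ℤ c (suc n) +ℤ (a 0 *ℤ ((b ∘ suc) ⊛ c) n +ℤ ((a ∘ suc) ⊛ (b ⊛ c)) n)
    ≡⟨ ℤP.+-assoc (a₀b₀ *ℤ c (suc n)) _ _ ⟨
  a₀b₀ *ℤ c (suc n) +ℤ a 0 *ℤ ((b ∘ suc) ⊛ c) n +ℤ ((a ∘ suc) ⊛ (b ⊛ c)) n
    ≡⟨ cong (_+ℤ ((a ∘ suc) ⊛ (b ⊛ c)) n) factor-a₀ ⟩
  a 0 *ℤ (b ⊛ c) (suc n) +ℤ ((a ∘ suc) ⊛ (b ⊛ c)) n
    ≡⟨ ⊛-suc a (b ⊛ c) n ⟨
  (a ⊛ (b ⊛ c)) (suc n) ∎
  where
  open ≡-Reasoning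
  a₀b₀ = a 0 *ℤ b 0
  factor-a₀ : a₀b₀ *ℤ c (suc n) +ℤ a 0 *ℤ ((b ∘ suc) ⊛ c) n ≡ a 0 *ℤ (b ⊛ c) (suc n)
  factor-a₀ = begin
    a₀b₀ *ℤ c (suc n) +ℤ a 0 *ℤ ((b ∘ suc) ⊛ c) n
      ≡⟨ cong (_+ℤ a 0 *ℤ ((b ∘ suc) ⊛ c) n) (ℤP.*-assoc (a 0) (b 0) (c (suc n))) ⟩
    a 0 *ℤ (b 0 *ℤ c (suc n)) +ℤ a 0 *ℤ ((b ∘ suc) ⊛ c) n
      ≡⟨ ℤP.*-distribˡ-+ (a 0) _ _ ⟨
    a 0 *ℤ (b 0 *ℤ c (suc n) +ℤ ((b ∘ suc) ⊛ c) n)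
      ≡⟨ cong (a 0 *ℤ_) (⊛-suc b c n) ⟨
    a 0 *ℤ (b ⊛ c) (suc n) ∎

⊛-identityˡ : ∀ (a : FPS) n → (one ⊛ a) n ≡ a n
⊛-identityˡ a zero    = ℤP.*-identityˡ (a 0)
⊛-identityˡ a (suc n) = begin
  (one ⊛ a) (suc n)                         ≡⟨ ⊛-suc one a n ⟩
  1ℤ *ℤ a (suc n) +ℤ ((one ∘ suc) ⊛ a) n    ≡⟨ cong₂ _+ℤ_ (ℤP.*-identityˡ (a (suc n))) (⊛-zeroˡ a n) ⟩
  a (suc n) +ℤ 0ℤ                           ≡⟨ ℤP.+-identityʳ (a (suc n)) ⟩
  a (suc n)                                 ∎
  where open ≡-Reasoning

FPS-isCommutativeRing : IsCommutativeRing _≈_ _⊕_ _⊗_ ⊝_ 𝟘 one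
FPS-isCommutativeRing = record
  { isRing = record
    { +-isAbelianGroup = record
      { isGroup = record
        { isMonoid = record
          { isSemigroup = record
            { isMagma = record
              { isEquivalence = record
                { refl  = coeffwise λ _ → refl
                ; sym   = λ a≈b → coeffwise λ n → sym (coeff a≈b n)
                ; trans = λ a≈b b≈c → coeffwise λ n → trans (coeff a≈b n) (coeff b≈c n) }
              ; ∙-cong = λ a≈a′ b≈b′ → coeffwise λ n → cong₂ _+ℤ_ (coeff a≈a′ n) (coeff b≈b′ n) }
            ; assoc = λ a b c → coeffwise λ n → ℤP.+-assoc (a n) (b n) (c n) }
          ; identity = (λ a → coeffwise λ n → ℤP.+-identityˡ (a n))
                     , (λ a → coeffwise λ n → ℤP.+-identityʳ (a n)) }
        ; inverse = (λ a → coeffwise λ n → ℤP.+-inverseˡ (a n))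
                  , (λ a → coeffwise λ n → ℤP.+-inverseʳ (a n))
        ; ⁻¹-cong = λ a≈a′ → coeffwise λ n → cong -_ (coeff a≈a′ n) }
      ; comm = λ a b → coeffwise λ n → ℤP.+-comm (a n) (b n) }
    ; *-cong = λ {a} {a′} {b} a≈a′ b≈b′ →
        coeffwise λ n → trans (coeff (⊗-congʳ b a≈a′) n) (coeff (⊗-congˡ a′ b≈b′) n)
    ; *-assoc = λ a b c → coeffwise λ n → ⊛-assoc n a b c
    ; *-identity = (λ a → coeffwise (⊛-identityˡ a))
                 , (λ a → coeffwise λ n → trans (⊛-comm a one n) (⊛-identityˡ a n))
    ; distrib = (λ a b c → coeffwise λ n → trans (⊛-comm a (b ⊕ c) n)
                  (trans (⊛-distribʳ b c a n) (cong₂ _+ℤ_ (⊛-comm b a n) (⊛-comm c a n))))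
              , (λ a b c → coeffwise (⊛-distribʳ b c a)) }
  ; *-comm = λ a b → coeffwise (⊛-comm a b) }

FPS-ring : CommutativeRing _ _
FPS-ring = record { isCommutativeRing = FPS-isCommutativeRing }

open CommutativeRing FPS-ring
  using (setoid; +-cong; +-congˡ; +-congʳ; -‿cong; *-cong; *-assoc; *-comm;
         +-identityˡ; +-identityʳ; *-identityˡ; *-identityʳ; zeroˡ; zeroʳ; -‿inverseʳ; distribˡ; distribʳ; +-assoc)
  renaming (refl to ≈-refl; sym to ≈-sym; trans to ≈-trans; reflexive to ≈-reflexive)

module ≈-Reasoning = Relation.Binary.Reasoning.Setoid setoid

open import Algebra.Properties.Group (AbelianGroup.group (CommutativeRing.+-abelianGroup FPS-ring))
  using () renaming (x∙y⁻¹≈ε⇒x≈y to ⊖≈𝟘⇒≈)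

⊗-cancelˡ : ∀ p i {x y} → i ⊗ p ≈ one → p ⊗ x ≈ p ⊗ y → x ≈ y
⊗-cancelˡ p i {x} {y} i⊗p≈one p⊗x≈p⊗y = begin
  x              ≈⟨ ≈-trans (⊗-congʳ x i⊗p≈one) (*-identityˡ x) ⟨
  i ⊗ p ⊗ x      ≈⟨ *-assoc i p x ⟩
  i ⊗ (p ⊗ x)    ≈⟨ ⊗-congˡ i p⊗x≈p⊗y ⟩
  i ⊗ (p ⊗ y)    ≈⟨ *-assoc i p y ⟨
  i ⊗ p ⊗ y      ≈⟨ ≈-trans (⊗-congʳ y i⊗p≈one) (*-identityˡ y) ⟩
  y              ∎
  where open ≈-Reasoning

-- Coefficients of the ring solver are integers. The embedding sends 0ℤ and 1ℤ to 𝟘 and one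
-- themselves, so that con 0ℤ and con 1ℤ denote them definitionally in solved identities.
embed : ℤ → FPS
embed (ℤ.+ 0) = 𝟘
embed (ℤ.+ 1) = one
embed k       = cst k

embed≈cst : ∀ k → embed k ≈ cst k
embed≈cst (ℤ.+ 0)         = coeffwise λ { zero → refl ; (suc _) → refl }
embed≈cst (ℤ.+ 1)         = coeffwise λ { zero → refl ; (suc _) → refl }
embed≈cst (ℤ.+ suc (suc _)) = ≈-refl
embed≈cst ℤ.-[1+ _ ]      = ≈-refl

cst-⊛ : ∀ k l → cst k ⊛ cst l ≈ cst (k *ℤ l)
cst-⊛ k l = coeffwise λ { zero → refl ; (suc n) → begin
    (cst k ⊛ cst l) (suc n)     ≡⟨ ⊛-suc (cst k) (cst l) n ⟩
    k *ℤ 0ℤ +ℤ (𝟘 ⊛ cst l) n    ≡⟨ cong₂ _+ℤ_ (ℤP.*-zeroʳ k) (⊛-zeroˡ (cst l) n) ⟩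
    0ℤ                          ∎ }
  where open ≡-Reasoning

ℤ⟶FPS : ACR._-Raw-AlmostCommutative⟶_ (CommutativeRing.rawRing ℤP.+-*-commutativeRing)
                                       (ACR.fromCommutativeRing FPS-ring)
ℤ⟶FPS = record
  { ⟦_⟧    = embed
  ; +-homo = λ k l → via-cst (k +ℤ l) (+-cong (embed≈cst k) (embed≈cst l))
                        (coeffwise λ { zero → refl ; (suc _) → refl })
  ; *-homo = λ k l → via-cst (k *ℤ l) (*-cong (embed≈cst k) (embed≈cst l)) (cst-⊛ k l)
  ; -‿homo = λ k → via-cst (- k) (-‿cong (embed≈cst k)) (coeffwise λ { zero → refl ; (suc _) → refl })
  ; 0-homo = ≈-refl
  ; 1-homo = ≈-refl }
  where
  via-cst : ∀ k {a b} → a ≈ b → b ≈ cst k → embed k ≈ a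
  via-cst k a≈b b≈k = ≈-trans (embed≈cst k) (≈-sym (≈-trans a≈b b≈k))

embed-≟ : ∀ k l → Maybe (embed k ≈ embed l)
embed-≟ k l with k ℤ.≟ l
... | yes refl = just ≈-refl
... | no  _    = nothing

open import Algebra.Solver.Ring (CommutativeRing.rawRing ℤP.+-*-commutativeRing)
  (ACR.fromCommutativeRing FPS-ring) ℤ⟶FPS embed-≟
  using (solve; _:+_; _:*_; _:-_; :-_; con; _:=_)

-- Monomials and geometric series

shift-< : ∀ e (a : FPS) n → n < e → shift e a n ≡ 0ℤ
shift-< e a n n<e with e ≤? n
... | yes e≤n = ⊥-elim (ℕP.<⇒≱ n<e e≤n)
... | no  _   = refl

shift-≥ : ∀ e (a : FPS) n → e ≤ n → shift e a n ≡ a (n ∸ e)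
shift-≥ e a n e≤n with e ≤? n
... | yes _   = refl
... | no  e≰n = ⊥-elim (e≰n e≤n)

shift-suc : ∀ e (a : FPS) n → shift (suc e) a (suc n) ≡ shift e a n
shift-suc e a n = by-cases (e ≤? n)
  where
  by-cases : Dec (e ≤ n) → shift (suc e) a (suc n) ≡ shift e a n
  by-cases (yes e≤n) = trans (shift-≥ (suc e) a (suc n) (s≤s e≤n)) (sym (shift-≥ e a n e≤n))
  by-cases (no  e≰n) = trans (shift-< (suc e) a (suc n) (s≤s (ℕP.≰⇒> e≰n))) (sym (shift-< e a n (ℕP.≰⇒> e≰n)))

shift-zero : ∀ (a : FPS) → shift 0 a ≈ a
shift-zero a = coeffwise λ n → shift-≥ 0 a n z≤n

infix 10 q^_ 1-q^_

q^_ : ℕ → FPS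
q^ e = shift e one

1-q^_ : ℕ → FPS
1-q^ e = one ⊖ q^ e

shift-one≈q^⊗ : ∀ (a : FPS) → shift 1 a ≈ q^ 1 ⊗ a
shift-one≈q^⊗ a = coeffwise λ where
    zero    → trans (shift-< 1 a 0 (s≤s z≤n)) (sym (cong (_*ℤ a 0) (shift-< 1 one 0 (s≤s z≤n))))
    (suc n) → begin
      shift 1 a (suc n)                            ≡⟨ trans (shift-suc 0 a n) (coeff (shift-zero a) n) ⟩
      a n                                          ≡⟨ ⊛-identityˡ a n ⟨
      (one ⊛ a) n                                  ≡⟨ coeff (⊗-congʳ a (coeffwise q¹-suc)) n ⟨
      ((q^ 1 ∘ suc) ⊛ a) n                         ≡⟨ ℤP.+-identityˡ _ ⟨
      0ℤ +ℤ ((q^ 1 ∘ suc) ⊛ a) n                   ≡⟨ cong (λ c → c *ℤ a (suc n) +ℤ ((q^ 1 ∘ suc) ⊛ a) n)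
                                                           (shift-< 1 one 0 (s≤s z≤n)) ⟨
      (q^ 1) 0 *ℤ a (suc n) +ℤ ((q^ 1 ∘ suc) ⊛ a) n  ≡⟨ ⊛-suc (q^ 1) a n ⟨
      (q^ 1 ⊗ a) (suc n)                           ∎
  where
  open ≡-Reasoning
  q¹-suc : ∀ n → (q^ 1) (suc n) ≡ one n
  q¹-suc n = trans (shift-suc 0 one n) (coeff (shift-zero one) n)

shift-suc≈ : ∀ e (a : FPS) → shift (suc e) a ≈ shift 1 (shift e a)
shift-suc≈ e a = coeffwise λ where
  zero    → trans (shift-< (suc e) a 0 (s≤s z≤n)) (sym (shift-< 1 (shift e a) 0 (s≤s z≤n)))
  (suc n) → trans (shift-suc e a n) (sym (trans (shift-suc 0 (shift e a) n) (coeff (shift-zero (shift e a)) n)))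

q^-zero : q^ 0 ≈ one
q^-zero = shift-zero one

q^-suc : ∀ e → q^ (suc e) ≈ q^ 1 ⊗ q^ e
q^-suc e = ≈-trans (shift-suc≈ e one) (shift-one≈q^⊗ (q^ e))

shift≈q^⊗ : ∀ e (a : FPS) → shift e a ≈ q^ e ⊗ a
shift≈q^⊗ zero    a = ≈-trans (shift-zero a) (≈-sym (≈-trans (⊗-congʳ a q^-zero) (*-identityˡ a)))
shift≈q^⊗ (suc e) a = begin
  shift (suc e) a          ≈⟨ shift-suc≈ e a ⟩
  shift 1 (shift e a)      ≈⟨ shift-one≈q^⊗ (shift e a) ⟩
  q^ 1 ⊗ shift e a         ≈⟨ ⊗-congˡ (q^ 1) (shift≈q^⊗ e a) ⟩
  q^ 1 ⊗ (q^ e ⊗ a)        ≈⟨ *-assoc (q^ 1) (q^ e) a ⟨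
  q^ 1 ⊗ q^ e ⊗ a          ≈⟨ ⊗-congʳ a (q^-suc e) ⟨
  q^ (suc e) ⊗ a           ∎
  where open ≈-Reasoning

shift-cong : ∀ e {a b} → a ≈ b → shift e a ≈ shift e b
shift-cong e {a} {b} a≈b = coeffwise coeff-shift
  where
  coeff-shift : ∀ n → shift e a n ≡ shift e b n
  coeff-shift n with e ≤? n
  ... | yes _ = coeff a≈b (n ∸ e)
  ... | no  _ = refl

shift-+ : ∀ e f (a : FPS) → shift (e + f) a ≈ shift e (shift f a)
shift-+ zero    f a = ≈-sym (shift-zero (shift f a))
shift-+ (suc e) f a = begin
  shift (suc (e + f)) a         ≈⟨ shift-suc≈ (e + f) a ⟩
  shift 1 (shift (e + f) a)     ≈⟨ shift-cong 1 (shift-+ e f a) ⟩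
  shift 1 (shift e (shift f a)) ≈⟨ shift-suc≈ e (shift f a) ⟨
  shift (suc e) (shift f a)     ∎
  where open ≈-Reasoning

q^-+ : ∀ e f → q^ (e + f) ≈ q^ e ⊗ q^ f
q^-+ e f = ≈-trans (shift-+ e f one) (shift≈q^⊗ e (q^ f))

q^-≡ : ∀ {e f} → e ≡ f → q^ e ≈ q^ f
q^-≡ refl = ≈-refl

q^-split : ∀ {e} f g → e ≡ f + g → q^ e ≈ q^ f ⊗ q^ g
q^-split f g refl = q^-+ f g

1-q^-≡ : ∀ {e f} → e ≡ f → 1-q^ e ≈ 1-q^ f
1-q^-≡ refl = ≈-refl

1-q^-zero : 1-q^ 0 ≈ 𝟘
1-q^-zero = ≈-trans (+-congˡ {one} (-‿cong q^-zero)) (-‿inverseʳ one)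

geom-∣ : ∀ m n → m ∣ n → geom m n ≡ 1ℤ
geom-∣ m n m∣n with m ∣? n
... | yes _   = refl
... | no  m∤n = ⊥-elim (m∤n m∣n)

geom-∤ : ∀ m n → ¬ m ∣ n → geom m n ≡ 0ℤ
geom-∤ m n m∤n with m ∣? n
... | yes m∣n = ⊥-elim (m∤n m∣n)
... | no  _   = refl

geom-inverse : ∀ e → 1-q^ (suc e) ⊗ geom (suc e) ≈ one
geom-inverse e = coeffwise λ n → begin
  ((one ⊖ q^ m) ⊛ g) n                ≡⟨ ⊛-distribʳ one (⊝ q^ m) g n ⟩
  (one ⊛ g) n +ℤ ((⊝ q^ m) ⊛ g) n     ≡⟨ cong₂ _+ℤ_ (⊛-identityˡ g n) (⊛-negˡ (q^ m) g n) ⟩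
  g n +ℤ - (q^ m ⊗ g) n               ≡⟨ cong (λ c → g n +ℤ - c) (coeff (shift≈q^⊗ m g) n) ⟨
  g n +ℤ - shift m g n                ≡⟨ telescoped n (m ≤? n) ⟩
  one n                               ∎
  where
  open ≡-Reasoning
  m = suc e
  g = geom m
  -- Only the coefficients n ≡ 0 (mod m) of the geometric series are 1, so g − q^m g = 1.
  telescoped : ∀ n → Dec (m ≤ n) → g n +ℤ - shift m g n ≡ one n
  telescoped (suc n) (no m≰n) =
    cong₂ (λ x y → x +ℤ - y) (geom-∤ m (suc n) (>⇒∤ (ℕP.≰⇒> m≰n))) (shift-< m g (suc n) (ℕP.≰⇒> m≰n))
  telescoped zero    (no _)   =
    cong₂ (λ x y → x +ℤ - y) (geom-∣ m 0 (m ∣0)) (shift-< m g 0 (s≤s z≤n))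
  telescoped n       (yes m≤n) = begin
    g n +ℤ - shift m g n      ≡⟨ cong (λ c → g n +ℤ - c) (shift-≥ m g n m≤n) ⟩
    g n +ℤ - g (n ∸ m)        ≡⟨ cong (_+ℤ - g (n ∸ m)) (geom-same m≤n) ⟩
    g (n ∸ m) +ℤ - g (n ∸ m)  ≡⟨ ℤP.+-inverseʳ (g (n ∸ m)) ⟩
    0ℤ                        ≡⟨ one-suc n (ℕP.<-≤-trans (s≤s z≤n) m≤n) ⟨
    one n                     ∎
    where
    one-suc : ∀ n → 0 < n → one n ≡ 0ℤ
    one-suc (suc _) _ = refl
    geom-same : m ≤ n → g n ≡ g (n ∸ m)
    geom-same m≤n with m ∣? (n ∸ m)
    ... | yes m∣n∸m = geom-∣ m n (∣m∸n∣n⇒∣m m m≤n m∣n∸m ∣-refl)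
    ... | no  m∤n∸m = geom-∤ m n λ m∣n →
      m∤n∸m (∣m+n∣m⇒∣n (subst (m ∣_) (sym (ℕP.m+[n∸m]≡n m≤n)) m∣n) ∣-refl)

-- Agreement modulo q^K, infinite sums

infix 4 _≈[_]_
record _≈[_]_ (a : FPS) (K : ℕ) (b : FPS) : Set where
  constructor coeffwise<
  field coeff< : ∀ n → n < K → a n ≡ b n
open _≈[_]_

module _ {K : ℕ} where

  ≈[]-refl : ∀ {a} → a ≈[ K ] a
  ≈[]-refl = coeffwise< λ _ _ → refl

  ≈[]-sym : ∀ {a b} → a ≈[ K ] b → b ≈[ K ] a
  ≈[]-sym a≈b = coeffwise< λ n n<K → sym (coeff< a≈b n n<K)

  ≈[]-trans : ∀ {a b c} → a ≈[ K ] b → b ≈[ K ] c → a ≈[ K ] c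
  ≈[]-trans a≈b b≈c = coeffwise< λ n n<K → trans (coeff< a≈b n n<K) (coeff< b≈c n n<K)

  ≈⇒≈[] : ∀ {a b} → a ≈ b → a ≈[ K ] b
  ≈⇒≈[] a≈b = coeffwise< λ n _ → coeff a≈b n

  ⊕-cong[] : ∀ {a a′ b b′} → a ≈[ K ] a′ → b ≈[ K ] b′ → a ⊕ b ≈[ K ] a′ ⊕ b′
  ⊕-cong[] a≈a′ b≈b′ = coeffwise< λ n n<K → cong₂ _+ℤ_ (coeff< a≈a′ n n<K) (coeff< b≈b′ n n<K)

  ⊝-cong[] : ∀ {a a′} → a ≈[ K ] a′ → ⊝ a ≈[ K ] ⊝ a′
  ⊝-cong[] a≈a′ = coeffwise< λ n n<K → cong -_ (coeff< a≈a′ n n<K)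

  ⊗-cong[] : ∀ {a a′ b b′} → a ≈[ K ] a′ → b ≈[ K ] b′ → a ⊗ b ≈[ K ] a′ ⊗ b′
  ⊗-cong[] a≈a′ b≈b′ = coeffwise< λ n n<K → Σ≤-cong n λ k k≤n →
    cong₂ _*ℤ_ (coeff< a≈a′ k (ℕP.≤-<-trans k≤n n<K)) (coeff< b≈b′ (n ∸ k) (ℕP.≤-<-trans (ℕP.m∸n≤m n k) n<K))

  ⊗-zeroʳ[] : ∀ c {a} → a ≈[ K ] 𝟘 → c ⊗ a ≈[ K ] 𝟘
  ⊗-zeroʳ[] c a≈𝟘 = ≈[]-trans (⊗-cong[] (≈[]-refl {a = c}) a≈𝟘) (≈⇒≈[] (zeroʳ c))

  ⊗-zeroˡ[] : ∀ c {a} → a ≈[ K ] 𝟘 → a ⊗ c ≈[ K ] 𝟘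
  ⊗-zeroˡ[] c a≈𝟘 = ≈[]-trans (⊗-cong[] a≈𝟘 (≈[]-refl {a = c})) (≈⇒≈[] (zeroˡ c))

≈[]-setoid : ℕ → Setoid _ _
≈[]-setoid K = record
  { Carrier = FPS ; _≈_ = _≈[ K ]_
  ; isEquivalence = record { refl = ≈[]-refl ; sym = ≈[]-sym ; trans = ≈[]-trans } }

module ≈[]-Reasoning (K : ℕ) = Relation.Binary.Reasoning.Setoid (≈[]-setoid K)

≈[]-weaken : ∀ {K K′ a b} → K′ ≤ K → a ≈[ K ] b → a ≈[ K′ ] b
≈[]-weaken K′≤K a≈b = coeffwise< λ n n<K′ → coeff< a≈b n (ℕP.<-≤-trans n<K′ K′≤K)

≈[]⇒≈ : ∀ {a b} → (∀ K → a ≈[ K ] b) → a ≈ b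
≈[]⇒≈ a≈b = coeffwise λ n → coeff< (a≈b (suc n)) n ℕP.≤-refl

q^⊗≈[]𝟘 : ∀ e (a : FPS) → q^ e ⊗ a ≈[ e ] 𝟘
q^⊗≈[]𝟘 e a = coeffwise< λ n n<e → trans (sym (coeff (shift≈q^⊗ e a) n)) (shift-< e a n n<e)

⊗q^≈[]𝟘 : ∀ e (a : FPS) → a ⊗ q^ e ≈[ e ] 𝟘
⊗q^≈[]𝟘 e a = ≈[]-trans (≈⇒≈[] (*-comm a (q^ e))) (q^⊗≈[]𝟘 e a)

q^⊗-cong[] : ∀ e K {a b} → a ≈[ K ] b → q^ e ⊗ a ≈[ e + K ] q^ e ⊗ b
q^⊗-cong[] e K {a} {b} a≈b = coeffwise< coeff-q^⊗
  where
  coeff-q^⊗ : ∀ n → n < e + K → (q^ e ⊗ a) n ≡ (q^ e ⊗ b) n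
  coeff-q^⊗ n n<e+K with e ≤? n
  ... | no  e≰n = trans (coeff< (q^⊗≈[]𝟘 e a) n (ℕP.≰⇒> e≰n)) (sym (coeff< (q^⊗≈[]𝟘 e b) n (ℕP.≰⇒> e≰n)))
  ... | yes e≤n = begin
    (q^ e ⊗ a) n   ≡⟨ coeff (shift≈q^⊗ e a) n ⟨
    shift e a n    ≡⟨ shift-≥ e a n e≤n ⟩
    a (n ∸ e)      ≡⟨ coeff< a≈b (n ∸ e) n∸e<K ⟩
    b (n ∸ e)      ≡⟨ shift-≥ e b n e≤n ⟨
    shift e b n    ≡⟨ coeff (shift≈q^⊗ e b) n ⟩
    (q^ e ⊗ b) n   ∎
    where
    open ≡-Reasoning
    n∸e<K : n ∸ e < K
    n∸e<K = ℕP.+-cancelˡ-< e (n ∸ e) K (subst (_< e + K) (sym (ℕP.m+[n∸m]≡n e≤n)) n<e+K)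

q^⊗≈[+]𝟘 : ∀ n {e} (y : FPS) → y ≈[ e ] 𝟘 → q^ n ⊗ y ≈[ n + e ] 𝟘
q^⊗≈[+]𝟘 n y y≈𝟘 = ≈[]-trans (q^⊗-cong[] n _ y≈𝟘) (≈⇒≈[] (zeroʳ (q^ n)))

q^⊗-cancel[] : ∀ e K {a b} → q^ e ⊗ a ≈[ e + K ] q^ e ⊗ b → a ≈[ K ] b
q^⊗-cancel[] e K {a} {b} q^a≈q^b = coeffwise< λ n n<K → begin
  a n                    ≡⟨ cong a (ℕP.m+n∸m≡n e n) ⟨
  a (e + n ∸ e)          ≡⟨ shift-≥ e a (e + n) (ℕP.m≤m+n e n) ⟨
  shift e a (e + n)      ≡⟨ coeff (shift≈q^⊗ e a) (e + n) ⟩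
  (q^ e ⊗ a) (e + n)     ≡⟨ coeff< q^a≈q^b (e + n) (ℕP.+-monoʳ-< e n<K) ⟩
  (q^ e ⊗ b) (e + n)     ≡⟨ coeff (shift≈q^⊗ e b) (e + n) ⟨
  shift e b (e + n)      ≡⟨ shift-≥ e b (e + n) (ℕP.m≤m+n e n) ⟩
  b (e + n ∸ e)          ≡⟨ cong b (ℕP.m+n∸m≡n e n) ⟩
  b n                    ∎
  where open ≡-Reasoning

1-q^≈[]one : ∀ e → 1-q^ e ≈[ e ] one
1-q^≈[]one e = ≈[]-trans (⊕-cong[] (≈[]-refl {a = one}) (⊝-cong[] q^≈[]𝟘)) (≈⇒≈[] (+-identityʳ one))
  where
  q^≈[]𝟘 : q^ e ≈[ e ] 𝟘
  q^≈[]𝟘 = ≈[]-trans (≈⇒≈[] (≈-sym (*-identityʳ (q^ e)))) (q^⊗≈[]𝟘 e one)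

geom≈[]one : ∀ e → geom (suc e) ≈[ suc e ] one
geom≈[]one e = coeffwise< λ where
  zero    _    → geom-∣ (suc e) 0 (suc e ∣0)
  (suc n) n<e  → geom-∤ (suc e) (suc n) (>⇒∤ n<e)

Σ< : ℕ → (ℕ → FPS) → FPS
Σ< zero    T = 𝟘
Σ< (suc N) T = Σ< N T ⊕ T N

-- Σ∞ T is the sum of the series T k when T k has no terms below q^k; then
-- the coefficient of q^n only receives contributions from T 0, …, T n.
Σ∞ : (ℕ → FPS) → FPS
Σ∞ T n = Σ≤ n (λ k → T k n)

Summable : (ℕ → FPS) → Set
Summable T = ∀ k → T k ≈[ k ] 𝟘

Σ∞≈[]Σ< : ∀ {T} → Summable T → ∀ K → Σ∞ T ≈[ K ] Σ< K T
Σ∞≈[]Σ< {T} T-summable K = coeffwise< λ n n<K →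
  trans (Σ≤≡Σ< n n) (sym (Σ<-tail-zero (suc n) K n n<K λ k n<k _ → coeff< (T-summable k) n n<k))
  where
  Σ≤≡Σ< : ∀ j x → Σ≤ j (λ k → T k x) ≡ Σ< (suc j) T x
  Σ≤≡Σ< zero    x = sym (ℤP.+-identityˡ (T 0 x))
  Σ≤≡Σ< (suc j) x = cong (_+ℤ T (suc j) x) (Σ≤≡Σ< j x)
  Σ<-tail-zero : ∀ N M x → N ≤ M → (∀ k → N ≤ k → k < M → T k x ≡ 0ℤ) → Σ< M T x ≡ Σ< N T x
  Σ<-tail-zero N zero    x z≤n _ = refl
  Σ<-tail-zero N (suc M) x N≤1+M tail≡0 with ℕP.m≤n⇒m<n∨m≡n N≤1+M
  ... | inj₂ refl       = refl
  ... | inj₁ (s≤s N≤M) = trans (cong (Σ< M T x +ℤ_) (tail≡0 M N≤M ℕP.≤-refl))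
                          (trans (ℤP.+-identityʳ _)
                                 (Σ<-tail-zero N M x N≤M λ k N≤k k<M → tail≡0 k N≤k (ℕP.m≤n⇒m≤1+n k<M)))

Σ∞-cong : ∀ {T U} → (∀ k → T k ≈ U k) → Σ∞ T ≈ Σ∞ U
Σ∞-cong T≈U = coeffwise λ n → Σ≤-cong n λ k _ → coeff (T≈U k) n

Σ∞-cong[] : ∀ {K T U} → (∀ k → T k ≈[ K ] U k) → Σ∞ T ≈[ K ] Σ∞ U
Σ∞-cong[] T≈U = coeffwise< λ n n<K → Σ≤-cong n λ k _ → coeff< (T≈U k) n n<K

Σ∞-⊕ : ∀ T U → Σ∞ (λ k → T k ⊕ U k) ≈ Σ∞ T ⊕ Σ∞ U
Σ∞-⊕ T U = coeffwise λ n → Σ≤-distrib-+ n (λ k → T k n) (λ k → U k n)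

Σ∞-⊝ : ∀ T → Σ∞ (λ k → ⊝ T k) ≈ ⊝ Σ∞ T
Σ∞-⊝ T = coeffwise λ n → Σ≤-neg n (λ k → T k n)

Σ∞-⊖ : ∀ T U → Σ∞ (λ k → T k ⊖ U k) ≈ Σ∞ T ⊖ Σ∞ U
Σ∞-⊖ T U = ≈-trans (Σ∞-⊕ T (λ k → ⊝ U k)) (+-cong (≈-refl {Σ∞ T}) (Σ∞-⊝ U))

Σ<-⊗ : ∀ N c T → Σ< N (λ k → c ⊗ T k) ≈ c ⊗ Σ< N T
Σ<-⊗ zero    c T = ≈-sym (zeroʳ c)
Σ<-⊗ (suc N) c T = ≈-trans (+-cong (Σ<-⊗ N c T) (≈-refl {c ⊗ T N})) (≈-sym (distribˡ c (Σ< N T) (T N)))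

Σ∞-⊗ : ∀ c {T} → Summable T → Σ∞ (λ k → c ⊗ T k) ≈ c ⊗ Σ∞ T
Σ∞-⊗ c {T} T-summable = ≈[]⇒≈ λ K →
  ≈[]-trans (Σ∞≈[]Σ< (λ k → ⊗-zeroʳ[] c (T-summable k)) K)
  (≈[]-trans (≈⇒≈[] (Σ<-⊗ K c T)) (⊗-cong[] (≈[]-refl {a = c}) (≈[]-sym (Σ∞≈[]Σ< T-summable K))))

Σ∞-telescope : ∀ σ {T} → Summable σ → (∀ k → T k ≈ σ k ⊖ σ (suc k)) → Σ∞ T ≈ σ 0
Σ∞-telescope σ {T} σ-summable T≈Δσ = ≈[]⇒≈ λ K →
  ≈[]-trans (Σ∞≈[]Σ< T-summable K)
  (≈[]-trans (≈⇒≈[] (Σ<-telescope K))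
  (≈[]-trans (⊕-cong[] (≈[]-refl {a = σ 0}) (⊝-cong[] (σ-summable K))) (≈⇒≈[] (+-identityʳ (σ 0)))))
  where
  T-summable : Summable T
  T-summable k = ≈[]-trans (≈⇒≈[] (T≈Δσ k))
    (≈[]-trans (⊕-cong[] (σ-summable k) (⊝-cong[] (≈[]-weaken (ℕP.n≤1+n k) (σ-summable (suc k)))))
               (≈⇒≈[] (+-identityʳ 𝟘)))
  Σ<-telescope : ∀ N → Σ< N T ≈ σ 0 ⊖ σ N
  Σ<-telescope zero    = ≈-sym (-‿inverseʳ (σ 0))
  Σ<-telescope (suc N) = ≈-trans (+-cong (Σ<-telescope N) (T≈Δσ N)) (cancel (σ 0) (σ N) (σ (suc N)))
    where
    cancel : ∀ a b c → a ⊖ b ⊕ (b ⊖ c) ≈ a ⊖ c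
    cancel = solve 3 (λ a b c → a :- b :+ (b :- c) := a :- c) ≈-refl

Σ∞-head[] : ∀ {K} T → (∀ k → T (suc k) ≈[ K ] 𝟘) → Σ∞ T ≈[ K ] T 0
Σ∞-head[] T tail≈𝟘 = coeffwise< λ where
  zero    _   → refl
  (suc n) n<K → trans (Σ≤-suc n (λ k → T k (suc n)))
                (trans (cong (T 0 (suc n) +ℤ_) (Σ≤-zero n λ k _ → coeff< (tail≈𝟘 k) (suc n) n<K))
                       (ℤP.+-identityʳ _))

Σ∞-zero[] : ∀ {K} T → (∀ k → T k ≈[ K ] 𝟘) → Σ∞ T ≈[ K ] 𝟘
Σ∞-zero[] T T≈𝟘 = coeffwise< λ n n<K → Σ≤-zero n λ k _ → coeff< (T≈𝟘 k) n n<K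

Σ∞-suc : ∀ T → Summable T → Σ∞ T ≈ T 0 ⊕ Σ∞ (T ∘ suc)
Σ∞-suc T T-summable = coeffwise λ where
  zero    → sym (trans (cong (T 0 0 +ℤ_) (coeff< (T-summable 1) 0 (s≤s z≤n))) (ℤP.+-identityʳ _))
  (suc n) → trans (Σ≤-suc n (λ k → T k (suc n)))
    (cong (T 0 (suc n) +ℤ_) (sym (trans (cong (Σ≤ n (λ k → T (suc k) (suc n)) +ℤ_)
                                              (coeff< (T-summable (suc (suc n))) (suc n) ℕP.≤-refl))
                                        (ℤP.+-identityʳ _))))

-- A sequence satisfying D m = A m D (m+1) + B m D (m+2) and D m ≡ 0 (mod q^(m+1)) vanishes:
-- unfolding the recurrence t times shows D m ≡ 0 (mod q^(m+1+t)).
recurrence-unique : (D A B : ℕ → FPS) → (∀ m → D m ≈ A m ⊗ D (suc m) ⊕ B m ⊗ D (suc (suc m)))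
                  → (∀ m → D m ≈[ suc m ] 𝟘) → ∀ m → D m ≈ 𝟘
recurrence-unique D A B recurrence initial m =
  ≈[]⇒≈ λ K → ≈[]-weaken (ℕP.≤-trans (ℕP.m≤n+m K m) (ℕP.n≤1+n _)) (vanishes K m)
  where
  vanishes : ∀ t m → D m ≈[ suc m + t ] 𝟘
  vanishes zero    m = subst (λ K → D m ≈[ K ] 𝟘) (sym (ℕP.+-identityʳ (suc m))) (initial m)
  vanishes (suc t) m = ≈[]-trans (≈⇒≈[] (recurrence m))
    (≈[]-trans (⊕-cong[] (⊗-zeroʳ[] (A m) next) (⊗-zeroʳ[] (B m) (≈[]-weaken le (vanishes t (suc (suc m))))))
               (≈⇒≈[] (+-identityʳ 𝟘)))
    where
    next : D (suc m) ≈[ suc m + suc t ] 𝟘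
    next = subst (λ K → D (suc m) ≈[ K ] 𝟘) (sym (ℕP.+-suc (suc m) t)) (vanishes t (suc m))
    le : suc m + suc t ≤ suc (suc (suc m)) + t
    le = ℕP.≤-trans (ℕP.≤-reflexive (ℕP.+-suc (suc m) t)) (ℕP.n≤1+n _)

Σ∞-linear : ∀ T U V b → Summable V → Σ∞ (λ n → T n ⊖ (U n ⊕ b ⊗ V n)) ≈ Σ∞ T ⊖ (Σ∞ U ⊕ b ⊗ Σ∞ V)
Σ∞-linear T U V b V-summable = begin
  Σ∞ (λ n → T n ⊖ (U n ⊕ b ⊗ V n))      ≈⟨ Σ∞-⊖ T (λ n → U n ⊕ b ⊗ V n) ⟩
  Σ∞ T ⊖ Σ∞ (λ n → U n ⊕ b ⊗ V n)       ≈⟨ +-cong (≈-refl {Σ∞ T}) (-‿cong (Σ∞-⊕ U (λ n → b ⊗ V n))) ⟩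
  Σ∞ T ⊖ (Σ∞ U ⊕ Σ∞ (λ n → b ⊗ V n))    ≈⟨ +-cong (≈-refl {Σ∞ T}) (-‿cong (+-cong (≈-refl {Σ∞ U}) (Σ∞-⊗ b V-summable))) ⟩
  Σ∞ T ⊖ (Σ∞ U ⊕ b ⊗ Σ∞ V)              ∎
  where open ≈-Reasoning

Σ∞-telescoping₂ : ∀ {T U V} σ a b → Summable U → Summable V → Summable σ → σ 0 ≈ 𝟘 →
                  (∀ n → T n ⊖ (a ⊗ U n ⊕ b ⊗ V n) ≈ σ n ⊖ σ (suc n)) → Σ∞ T ≈ a ⊗ Σ∞ U ⊕ b ⊗ Σ∞ V
Σ∞-telescoping₂ {T} {U} {V} σ a b U-summable V-summable σ-summable σ₀≈𝟘 T≈Δσ = ⊖≈𝟘⇒≈ _ _ (begin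
  Σ∞ T ⊖ (a ⊗ Σ∞ U ⊕ b ⊗ Σ∞ V)
    ≈⟨ +-cong (≈-refl {Σ∞ T}) (-‿cong (+-cong (Σ∞-⊗ a U-summable) (≈-refl {b ⊗ Σ∞ V}))) ⟨
  Σ∞ T ⊖ (Σ∞ (λ n → a ⊗ U n) ⊕ b ⊗ Σ∞ V)
    ≈⟨ Σ∞-linear T (λ n → a ⊗ U n) V b V-summable ⟨
  Σ∞ (λ n → T n ⊖ (a ⊗ U n ⊕ b ⊗ V n))
    ≈⟨ Σ∞-telescope σ σ-summable T≈Δσ ⟩
  σ 0
    ≈⟨ σ₀≈𝟘 ⟩
  𝟘 ∎)
  where open ≈-Reasoning

Σ∞-telescoping₁ : ∀ {T U} σ a → Summable U → Summable σ → σ 0 ≈ 𝟘 →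
                  (∀ n → T n ⊖ a ⊗ U n ≈ σ n ⊖ σ (suc n)) → Σ∞ T ≈ a ⊗ Σ∞ U
Σ∞-telescoping₁ {T} {U} σ a U-summable σ-summable σ₀≈𝟘 T≈Δσ =
  ≈-trans (Σ∞-telescoping₂ σ a 𝟘 U-summable (λ _ → ≈[]-refl) σ-summable σ₀≈𝟘 λ n →
            ≈-trans (+-cong (≈-refl {T n}) (-‿cong (drop-𝟘 (a ⊗ U n)))) (T≈Δσ n))
          (drop-𝟘 (a ⊗ Σ∞ U))
  where
  drop-𝟘 : ∀ x → x ⊕ 𝟘 ⊗ 𝟘 ≈ x
  drop-𝟘 x = ≈-trans (+-cong (≈-refl {x}) (zeroˡ 𝟘)) (+-identityʳ x)

Σ∞-𝟘 : ∀ {T} → (∀ k → T k ≈ 𝟘) → Σ∞ T ≈ 𝟘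
Σ∞-𝟘 T≈𝟘 = coeffwise λ n → Σ≤-zero n λ k _ → coeff (T≈𝟘 k) n

-- Infinite products and q-Pochhammer symbols

Π<-cong : ∀ N {f g : ℕ → FPS} → (∀ k → f k ≈ g k) → Π< N f ≈ Π< N g
Π<-cong zero    f≈g = ≈-refl
Π<-cong (suc N) f≈g = *-cong (Π<-cong N f≈g) (f≈g N)

Π<-cong[] : ∀ {K} N {f g : ℕ → FPS} → (∀ k → f k ≈[ K ] g k) → Π< N f ≈[ K ] Π< N g
Π<-cong[] zero    f≈g = ≈[]-refl
Π<-cong[] (suc N) f≈g = ⊗-cong[] (Π<-cong[] N f≈g) (f≈g N)

Π<-⊗ : ∀ N (f g : ℕ → FPS) → Π< N f ⊗ Π< N g ≈ Π< N (λ k → f k ⊗ g k)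
Π<-⊗ zero    f g = *-identityˡ one
Π<-⊗ (suc N) f g = ≈-trans (regroup (Π< N f) (f N) (Π< N g) (g N)) (⊗-congʳ (f N ⊗ g N) (Π<-⊗ N f g))
  where
  regroup : ∀ a b c d → a ⊗ b ⊗ (c ⊗ d) ≈ a ⊗ c ⊗ (b ⊗ d)
  regroup = solve 4 (λ a b c d → a :* b :* (c :* d) := a :* c :* (b :* d)) ≈-refl

Π<-one : ∀ N → Π< N (λ _ → one) ≈ one
Π<-one zero    = ≈-refl
Π<-one (suc N) = ≈-trans (*-identityʳ _) (Π<-one N)

Π<-suc : ∀ N (f : ℕ → FPS) → Π< (suc N) f ≈ f 0 ⊗ Π< N (f ∘ suc)
Π<-suc zero    f = ≈-trans (*-identityˡ (f 0)) (≈-sym (*-identityʳ (f 0)))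
Π<-suc (suc N) f = ≈-trans (⊗-congʳ (f (suc N)) (Π<-suc N f)) (*-assoc (f 0) (Π< N (f ∘ suc)) (f (suc N)))

Π<≈[]one : ∀ {K} N (f : ℕ → FPS) → (∀ k → f k ≈[ K ] one) → Π< N f ≈[ K ] one
Π<≈[]one zero    f f≈one = ≈[]-refl
Π<≈[]one (suc N) f f≈one = ≈[]-trans (⊗-cong[] (Π<≈[]one N f f≈one) (f≈one N)) (≈⇒≈[] (*-identityˡ one))

Π<-+≈[] : ∀ (f : ℕ → FPS) j {L} → (∀ k → j ≤ k → f k ≈[ L ] one) → ∀ d → Π< (j + d) f ≈[ L ] Π< j f
Π<-+≈[] f j {L} f≈one zero    = subst (λ N → Π< N f ≈[ L ] Π< j f) (sym (ℕP.+-identityʳ j)) ≈[]-refl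
Π<-+≈[] f j {L} f≈one (suc d) = subst (λ N → Π< N f ≈[ L ] Π< j f) (sym (ℕP.+-suc j d))
  (≈[]-trans (⊗-cong[] (≈[]-refl {a = Π< (j + d) f}) (f≈one (j + d) (ℕP.m≤m+n j d)))
  (≈[]-trans (≈⇒≈[] (*-identityʳ _)) (Π<-+≈[] f j f≈one d)))

-- Π∞ f is the infinite product of factors f k ≡ 1 (mod q^(k+1)); the coefficient of
-- q^n is already that of the first n+1 factors.
Π∞ : (ℕ → FPS) → FPS
Π∞ f n = Π< (suc n) f n

ConvergentFactors : (ℕ → FPS) → Set
ConvergentFactors f = ∀ k → f k ≈[ suc k ] one

Π∞≈[]Π<-from : ∀ f → ConvergentFactors f → ∀ j {L} → (∀ k → j ≤ k → f k ≈[ L ] one) → Π∞ f ≈[ L ] Π< j f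
Π∞≈[]Π<-from f f-conv j {L} f≈one = coeffwise< λ n n<L → begin
  Π< (suc n) f n         ≡⟨ coeff< (Π<-+≈[] f (suc n) (λ k n<k → ≈[]-weaken (ℕP.m≤n⇒m≤1+n n<k) (f-conv k)) j) n ℕP.≤-refl ⟨
  Π< (suc n + j) f n     ≡⟨ cong (λ N → Π< N f n) (ℕP.+-comm (suc n) j) ⟩
  Π< (j + suc n) f n     ≡⟨ coeff< (Π<-+≈[] f j f≈one (suc n)) n n<L ⟩
  Π< j f n               ∎
  where open ≡-Reasoning

Π∞≈[]Π< : ∀ f → ConvergentFactors f → ∀ K → Π∞ f ≈[ K ] Π< K f
Π∞≈[]Π< f f-conv K = Π∞≈[]Π<-from f f-conv K λ k K≤k → ≈[]-weaken (ℕP.m≤n⇒m≤1+n K≤k) (f-conv k)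

Π∞≈[]one : ∀ {K} (f : ℕ → FPS) → (∀ k → f k ≈[ K ] one) → Π∞ f ≈[ K ] one
Π∞≈[]one f f≈one = coeffwise< λ n n<K → coeff< (Π<≈[]one (suc n) f f≈one) n n<K

Π∞-suc : ∀ f → ConvergentFactors f → Π∞ f ≈ f 0 ⊗ Π∞ (f ∘ suc)
Π∞-suc f f-conv = ≈[]⇒≈ λ K →
  ≈[]-trans (≈[]-weaken (ℕP.n≤1+n K) (Π∞≈[]Π< f f-conv (suc K)))
  (≈[]-trans (≈⇒≈[] (Π<-suc K f))
  (⊗-cong[] (≈[]-refl {a = f 0}) (≈[]-sym (Π∞≈[]Π< (f ∘ suc) (λ k → ≈[]-weaken (ℕP.n≤1+n (suc k)) (f-conv (suc k))) K))))

Π∞-cong : ∀ {f g : ℕ → FPS} → (∀ k → f k ≈ g k) → Π∞ f ≈ Π∞ g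
Π∞-cong f≈g = coeffwise λ n → coeff (Π<-cong (suc n) f≈g) n

poch : ℕ → ℕ → ℕ → FPS
poch a b n = Π< n (λ k → 1-q^ (a + b * k))

poch∞ : ℕ → ℕ → FPS
poch∞ a b = Π∞ (λ k → 1-q^ (a + b * k))

k<1+a+[1+b]k : ∀ a b k → suc k ≤ suc a + suc b * k
k<1+a+[1+b]k a b k = s≤s (ℕP.≤-trans (ℕP.m≤n*m k (suc b)) (ℕP.m≤n+m _ a))

poch-factors-converge : ∀ a b → ConvergentFactors (λ k → 1-q^ (suc a + suc b * k))
poch-factors-converge a b k = ≈[]-weaken (k<1+a+[1+b]k a b k) (1-q^≈[]one _)

invPoch-factors-converge : ∀ a b → ConvergentFactors (λ k → geom (suc a + suc b * k))
invPoch-factors-converge a b k = ≈[]-weaken (k<1+a+[1+b]k a b k) (geom≈[]one _)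

poch-inverse : ∀ a b N → poch (suc a) b N ⊗ invPoch (suc a) b N ≈ one
poch-inverse a b N = ≈-trans (Π<-⊗ N _ _) (≈-trans (Π<-cong N λ k → geom-inverse (a + b * k)) (Π<-one N))

poch∞≈[]poch : ∀ a b K → poch∞ (suc a) (suc b) ≈[ K ] poch (suc a) (suc b) K
poch∞≈[]poch a b = Π∞≈[]Π< _ (poch-factors-converge a b)

poch∞-inverse : ∀ a b → poch∞ (suc a) (suc b) ⊗ invPoch∞ (suc a) (suc b) ≈ one
poch∞-inverse a b = ≈[]⇒≈ λ K →
  ≈[]-trans (⊗-cong[] (poch∞≈[]poch a b K) (Π∞≈[]Π< _ (invPoch-factors-converge a b) K))
            (≈⇒≈[] (poch-inverse a (suc b) K))

poch∞≈[]one : ∀ a b → poch∞ a b ≈[ a ] one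
poch∞≈[]one a b = Π∞≈[]one _ λ k → ≈[]-weaken (ℕP.m≤m+n a (b * k)) (1-q^≈[]one (a + b * k))

poch∞-suc : ∀ a b → poch∞ (suc a) (suc b) ≈ 1-q^ (suc a) ⊗ poch∞ (suc a + suc b) (suc b)
poch∞-suc a b = ≈-trans (Π∞-suc _ (poch-factors-converge a b))
  (*-cong (1-q^-≡ (cong suc (trans (cong (a +_) (ℕP.*-zeroʳ b)) (ℕP.+-identityʳ a))))
          (Π∞-cong λ k → 1-q^-≡ (exp-shift a b k)))
  where
  exp-shift : ∀ a b k → suc a + suc b * suc k ≡ suc a + suc b + suc b * k
  exp-shift = solve-∀

poch∞-shift : ∀ m → poch∞ (suc m) 1 ≈ 1-q^ (suc m) ⊗ poch∞ (suc (suc m)) 1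
poch∞-shift m = ≈-trans (poch∞-suc m 0) (⊗-congˡ (1-q^ (suc m)) (≈-reflexive (cong (λ a → poch∞ a 1) (ℕP.+-comm (suc m) 1))))

poch-shift : ∀ a n → poch a 1 n ⊗ 1-q^ (a + n) ≈ 1-q^ a ⊗ poch (suc a) 1 n
poch-shift a zero    = ≈-trans (*-identityˡ _) (≈-trans (1-q^-≡ (ℕP.+-identityʳ a)) (≈-sym (*-identityʳ _)))
poch-shift a (suc n) = begin
  poch a 1 n ⊗ 1-q^ (a + 1 * n) ⊗ 1-q^ (a + suc n)
    ≈⟨ *-cong (⊗-congˡ (poch a 1 n) (1-q^-≡ (cong (a +_) (ℕP.*-identityˡ n)))) (1-q^-≡ (ℕP.+-suc a n)) ⟩
  poch a 1 n ⊗ 1-q^ (a + n) ⊗ 1-q^ (suc a + n)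
    ≈⟨ ⊗-congʳ (1-q^ (suc a + n)) (poch-shift a n) ⟩
  1-q^ a ⊗ poch (suc a) 1 n ⊗ 1-q^ (suc a + n)
    ≈⟨ *-assoc (1-q^ a) (poch (suc a) 1 n) (1-q^ (suc a + n)) ⟩
  1-q^ a ⊗ (poch (suc a) 1 n ⊗ 1-q^ (suc a + n))
    ≈⟨ ⊗-congˡ (1-q^ a) (⊗-congˡ (poch (suc a) 1 n) (1-q^-≡ (cong (suc a +_) (sym (ℕP.*-identityˡ n))))) ⟩
  1-q^ a ⊗ poch (suc a) 1 (suc n) ∎
  where open ≈-Reasoning

invPoch-suc : ∀ a b j → 1-q^ (suc a + b * j) ⊗ invPoch (suc a) b (suc j) ≈ invPoch (suc a) b j
invPoch-suc a b j = begin
  L ⊗ (I ⊗ geom (suc a + b * j))   ≈⟨ swap L I (geom (suc a + b * j)) ⟩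
  I ⊗ (L ⊗ geom (suc a + b * j))   ≈⟨ ⊗-congˡ I (geom-inverse (a + b * j)) ⟩
  I ⊗ one                          ≈⟨ *-identityʳ I ⟩
  I                                ∎
  where
  open ≈-Reasoning
  L = 1-q^ (suc a + b * j)
  I = invPoch (suc a) b j
  swap : ∀ x y z → x ⊗ (y ⊗ z) ≈ y ⊗ (x ⊗ z)
  swap = solve 3 (λ x y z → x :* (y :* z) := y :* (x :* z)) ≈-refl

poch-+ : ∀ a M k → poch a 1 (M + k) ≈ poch a 1 M ⊗ Π< k (λ r → 1-q^ (a + 1 * (M + r)))
poch-+ a M zero    = ≈-trans (≈-reflexive (cong (poch a 1) (ℕP.+-identityʳ M))) (≈-sym (*-identityʳ (poch a 1 M)))
poch-+ a M (suc k) = begin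
  poch a 1 (M + suc k)                              ≡⟨ cong (poch a 1) (ℕP.+-suc M k) ⟩
  poch a 1 (M + k) ⊗ 1-q^ (a + 1 * (M + k))         ≈⟨ ⊗-congʳ (1-q^ (a + 1 * (M + k))) (poch-+ a M k) ⟩
  poch a 1 M ⊗ Π< k f ⊗ f k                         ≈⟨ *-assoc (poch a 1 M) (Π< k f) (f k) ⟩
  poch a 1 M ⊗ Π< (suc k) f                         ∎
  where
  open ≈-Reasoning
  f = λ r → 1-q^ (a + 1 * (M + r))

poch-dissect : ∀ a k N → poch a 1 (N * k) ≈ Π< k (λ r → poch (a + r) k N)
poch-dissect a k zero    = ≈-sym (Π<-one k)
poch-dissect a k (suc N) = begin
  poch a 1 (k + N * k)                                        ≡⟨ cong (poch a 1) (ℕP.+-comm k (N * k)) ⟩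
  poch a 1 (N * k + k)                                        ≈⟨ poch-+ a (N * k) k ⟩
  poch a 1 (N * k) ⊗ Π< k f                                   ≈⟨ ⊗-congʳ (Π< k f) (poch-dissect a k N) ⟩
  Π< k (λ r → poch (a + r) k N) ⊗ Π< k f                      ≈⟨ Π<-⊗ k (λ r → poch (a + r) k N) f ⟩
  Π< k (λ r → poch (a + r) k N ⊗ 1-q^ (a + 1 * (N * k + r)))  ≈⟨ Π<-cong k (λ r → ⊗-congˡ (poch (a + r) k N) (1-q^-≡ (exp-shift a k N r))) ⟩
  Π< k (λ r → poch (a + r) k (suc N))                         ∎
  where
  open ≈-Reasoning
  f = λ r → 1-q^ (a + 1 * (N * k + r))
  exp-shift : ∀ a k N r → a + 1 * (N * k + r) ≡ a + r + k * N
  exp-shift = solve-∀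

poch∞-dissect : ∀ a k → poch∞ (suc a) 1 ≈ Π< (suc k) (λ r → poch∞ (suc a + r) (suc k))
poch∞-dissect a k = ≈[]⇒≈ agree
  where
  agree : ∀ K → poch∞ (suc a) 1 ≈[ K ] Π< (suc k) (λ r → poch∞ (suc a + r) (suc k))
  agree K = begin
    poch∞ (suc a) 1                                  ≈⟨ ≈[]-weaken (ℕP.m≤m*n K (suc k)) (poch∞≈[]poch a 0 (K * suc k)) ⟩
    poch (suc a) 1 (K * suc k)                       ≈⟨ ≈⇒≈[] (poch-dissect (suc a) (suc k) K) ⟩
    Π< (suc k) (λ r → poch (suc a + r) (suc k) K)    ≈⟨ Π<-cong[] (suc k) (λ r → poch∞≈[]poch (a + r) k K) ⟨
    Π< (suc k) (λ r → poch∞ (suc a + r) (suc k))     ∎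
    where open ≈[]-Reasoning K

-- Identities between polynomials in monomials q^(a + b x + c y + d z), where x y z are
-- natural-number parameters, are decided by normalising both sides to sorted lists of
-- (coefficient, exponent vector) pairs.
record Monomial : Set where
  constructor mono
  field a b c d : ℕ

exponentAt : ℕ → ℕ → ℕ → Monomial → ℕ
exponentAt x y z (mono a b c d) = a + b * x + c * y + d * z

infixl 6 _⊞_ _⊟_
infixl 7 _⊠_
infix 8 ⊟_

data Expr : Set where
  κ : ℤ → Expr
  χ : Monomial → Expr
  _⊞_ _⊠_ _⊟_ : Expr → Expr → Expr
  ⊟_ : Expr → Expr

⟦_⟧ : Expr → ℕ → ℕ → ℕ → FPS
⟦ κ k ⟧   x y z = embed k
⟦ χ m ⟧   x y z = q^ exponentAt x y z m
⟦ e ⊞ f ⟧ x y z = ⟦ e ⟧ x y z ⊕ ⟦ f ⟧ x y z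
⟦ e ⊠ f ⟧ x y z = ⟦ e ⟧ x y z ⊗ ⟦ f ⟧ x y z
⟦ e ⊟ f ⟧ x y z = ⟦ e ⟧ x y z ⊖ ⟦ f ⟧ x y z
⟦ ⊟ e ⟧   x y z = ⊝ ⟦ e ⟧ x y z

𝕀 : Expr
𝕀 = κ 1ℤ

private
  Term = ℤ × Monomial
  Poly = List Term

  _+ᴹ_ : Monomial → Monomial → Monomial
  mono a b c d +ᴹ mono a′ b′ c′ d′ = mono (a + a′) (b + b′) (c + c′) (d + d′)

  _≟ᴹ_ : (m m′ : Monomial) → Dec (m ≡ m′)
  mono a b c d ≟ᴹ mono a′ b′ c′ d′ with a ℕ.≟ a′ | b ℕ.≟ b′ | c ℕ.≟ c′ | d ℕ.≟ d′
  ... | yes refl | yes refl | yes refl | yes refl = yes refl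
  ... | no a≢a′ | _ | _ | _                       = no λ { refl → a≢a′ refl }
  ... | yes _ | no b≢b′ | _ | _                   = no λ { refl → b≢b′ refl }
  ... | yes _ | yes _ | no c≢c′ | _               = no λ { refl → c≢c′ refl }
  ... | yes _ | yes _ | yes _ | no d≢d′           = no λ { refl → d≢d′ refl }

  _<ᴹ_ : Monomial → Monomial → Bool
  mono a b c d <ᴹ mono a′ b′ c′ d′ =
    if a <ᵇ a′ then true else if a′ <ᵇ a then false else
    if b <ᵇ b′ then true else if b′ <ᵇ b then false else
    if c <ᵇ c′ then true else if c′ <ᵇ c then false else d <ᵇ d′

  negate : Poly → Poly
  negate []             = []
  negate ((k , m) ∷ ts) = (- k , m) ∷ negate ts

  scale : Term → Poly → Poly
  scale t       []             = []
  scale (k , m) ((l , n) ∷ ts) = (k *ℤ l , m +ᴹ n) ∷ scale (k , m) ts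

  multiply : Poly → Poly → Poly
  multiply []       ts = []
  multiply (t ∷ ss) ts = scale t ts ++ multiply ss ts

  expand : Expr → Poly
  expand (κ k)   = (k , mono 0 0 0 0) ∷ []
  expand (χ m)   = (1ℤ , m) ∷ []
  expand (e ⊞ f) = expand e ++ expand f
  expand (e ⊠ f) = multiply (expand e) (expand f)
  expand (e ⊟ f) = expand e ++ negate (expand f)
  expand (⊟ e)   = negate (expand e)

  insert : Term → Poly → Poly
  insert t [] = t ∷ []
  insert (k , m) ((l , n) ∷ ts) with m ≟ᴹ n
  ... | yes _ = (k +ℤ l , n) ∷ ts
  ... | no  _ = if m <ᴹ n then (k , m) ∷ (l , n) ∷ ts else (l , n) ∷ insert (k , m) ts

  sort : Poly → Poly
  sort []       = []
  sort (t ∷ ts) = insert t (sort ts)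

  dropZeros : Poly → Poly
  dropZeros [] = []
  dropZeros ((k , m) ∷ ts) with k ℤ.≟ 0ℤ
  ... | yes _ = dropZeros ts
  ... | no  _ = (k , m) ∷ dropZeros ts

normalise : Expr → Poly
normalise e = dropZeros (sort (expand e))

module _ (x y z : ℕ) where
  private
    ⟦_⟧ᵗ : Term → FPS
    ⟦ k , m ⟧ᵗ = k · q^ exponentAt x y z m

    ⟦_⟧ᵖ : Poly → FPS
    ⟦ [] ⟧ᵖ     = 𝟘
    ⟦ t ∷ ts ⟧ᵖ = ⟦ t ⟧ᵗ ⊕ ⟦ ts ⟧ᵖ

    ·-cong : ∀ k {a b} → a ≈ b → k · a ≈ k · b
    ·-cong k a≈b = coeffwise λ n → cong (k *ℤ_) (coeff a≈b n)

    ·-⊗-· : ∀ k l a b → (k *ℤ l) · (a ⊗ b) ≈ (k · a) ⊗ (l · b)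
    ·-⊗-· k l a b = coeffwise λ n → begin
      k *ℤ l *ℤ (a ⊛ b) n          ≡⟨ ℤP.*-assoc k l _ ⟩
      k *ℤ (l *ℤ (a ⊛ b) n)        ≡⟨ cong (k *ℤ_) (trans (cong (l *ℤ_) (⊛-comm a b n))
                                        (trans (sym (⊛-·ˡ l b a n)) (⊛-comm (l · b) a n))) ⟩
      k *ℤ (a ⊛ (l · b)) n         ≡⟨ ⊛-·ˡ k a (l · b) n ⟨
      ((k · a) ⊛ (l · b)) n        ∎
      where open ≡-Reasoning

    exponentAt-+ : ∀ m n → exponentAt x y z (m +ᴹ n) ≡ exponentAt x y z m + exponentAt x y z n
    exponentAt-+ (mono a b c d) (mono a′ b′ c′ d′) = exponentAt-+′ x y z a b c d a′ b′ c′ d′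
      where
      exponentAt-+′ : ∀ x y z a b c d a′ b′ c′ d′ →
        a + a′ + (b + b′) * x + (c + c′) * y + (d + d′) * z ≡ (a + b * x + c * y + d * z) + (a′ + b′ * x + c′ * y + d′ * z)
      exponentAt-+′ = solve-∀

    ++-sound : ∀ ss ts → ⟦ ss ++ ts ⟧ᵖ ≈ ⟦ ss ⟧ᵖ ⊕ ⟦ ts ⟧ᵖ
    ++-sound []       ts = ≈-sym (+-identityˡ ⟦ ts ⟧ᵖ)
    ++-sound (s ∷ ss) ts = ≈-trans (+-cong (≈-refl {⟦ s ⟧ᵗ}) (++-sound ss ts)) (≈-sym (+-assoc ⟦ s ⟧ᵗ ⟦ ss ⟧ᵖ ⟦ ts ⟧ᵖ))

    negate-sound : ∀ ts → ⟦ negate ts ⟧ᵖ ≈ ⊝ ⟦ ts ⟧ᵖ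
    negate-sound []             = ≈-sym (coeffwise λ _ → refl)
    negate-sound ((k , m) ∷ ts) = coeffwise λ n → let qᵐₙ = (q^ exponentAt x y z m) n in
      trans (cong₂ _+ℤ_ (sym (ℤP.neg-distribˡ-* k qᵐₙ)) (coeff (negate-sound ts) n))
            (sym (ℤP.neg-distrib-+ (k *ℤ qᵐₙ) (⟦ ts ⟧ᵖ n)))

    scale-sound : ∀ t ts → ⟦ scale t ts ⟧ᵖ ≈ ⟦ t ⟧ᵗ ⊗ ⟦ ts ⟧ᵖ
    scale-sound t       []             = ≈-sym (zeroʳ ⟦ t ⟧ᵗ)
    scale-sound (k , m) ((l , n) ∷ ts) = ≈-trans (+-cong term-sound (scale-sound (k , m) ts))
                                                  (≈-sym (distribˡ ⟦ k , m ⟧ᵗ ⟦ l , n ⟧ᵗ ⟦ ts ⟧ᵖ))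
      where
      term-sound : ⟦ k *ℤ l , m +ᴹ n ⟧ᵗ ≈ ⟦ k , m ⟧ᵗ ⊗ ⟦ l , n ⟧ᵗ
      term-sound = ≈-trans (·-cong (k *ℤ l) (≈-trans (q^-≡ (exponentAt-+ m n)) (q^-+ eₘ eₙ))) (·-⊗-· k l (q^ eₘ) (q^ eₙ))
        where
        eₘ = exponentAt x y z m
        eₙ = exponentAt x y z n

    multiply-sound : ∀ ss ts → ⟦ multiply ss ts ⟧ᵖ ≈ ⟦ ss ⟧ᵖ ⊗ ⟦ ts ⟧ᵖ
    multiply-sound []       ts = ≈-sym (zeroˡ ⟦ ts ⟧ᵖ)
    multiply-sound (s ∷ ss) ts = ≈-trans (++-sound (scale s ts) (multiply ss ts))
      (≈-trans (+-cong (scale-sound s ts) (multiply-sound ss ts)) (≈-sym (distribʳ ⟦ ts ⟧ᵖ ⟦ s ⟧ᵗ ⟦ ss ⟧ᵖ)))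

    expand-sound : ∀ e → ⟦ expand e ⟧ᵖ ≈ ⟦ e ⟧ x y z
    expand-sound (κ k)   = ≈-trans (+-identityʳ _) (≈-trans (·-cong k (q^-≡ zero-exponentAt))
                                    (≈-trans (·-cong k q^-zero) (≈-trans k·one≈cst (≈-sym (embed≈cst k)))))
      where
      zero-exponentAt : exponentAt x y z (mono 0 0 0 0) ≡ 0
      zero-exponentAt = solve-zero x y z
        where
        solve-zero : ∀ x y z → 0 + 0 * x + 0 * y + 0 * z ≡ 0
        solve-zero = solve-∀
      k·one≈cst : k · one ≈ cst k
      k·one≈cst = coeffwise λ { zero → ℤP.*-identityʳ k ; (suc _) → ℤP.*-zeroʳ k }
    expand-sound (χ m)   = ≈-trans (+-identityʳ _) (coeffwise λ n → ℤP.*-identityˡ _)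
    expand-sound (e ⊞ f) = ≈-trans (++-sound (expand e) (expand f)) (+-cong (expand-sound e) (expand-sound f))
    expand-sound (e ⊠ f) = ≈-trans (multiply-sound (expand e) (expand f)) (*-cong (expand-sound e) (expand-sound f))
    expand-sound (e ⊟ f) = ≈-trans (++-sound (expand e) (negate (expand f)))
                                   (+-cong (expand-sound e) (≈-trans (negate-sound (expand f)) (-‿cong (expand-sound f))))
    expand-sound (⊟ e)   = ≈-trans (negate-sound (expand e)) (-‿cong (expand-sound e))

    insert-sound : ∀ t ts → ⟦ insert t ts ⟧ᵖ ≈ ⟦ t ⟧ᵗ ⊕ ⟦ ts ⟧ᵖ
    insert-sound t [] = ≈-refl
    insert-sound (k , m) ((l , n) ∷ ts) with m ≟ᴹ n
    ... | yes refl = coeffwise λ i → let qᵐᵢ = (q^ exponentAt x y z m) i in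
      trans (cong (_+ℤ ⟦ ts ⟧ᵖ i) (ℤP.*-distribʳ-+ qᵐᵢ k l)) (ℤP.+-assoc (k *ℤ qᵐᵢ) (l *ℤ qᵐᵢ) (⟦ ts ⟧ᵖ i))
    ... | no  _ with m <ᴹ n
    ...   | true  = ≈-refl
    ...   | false = ≈-trans (+-cong (≈-refl {⟦ l , n ⟧ᵗ}) (insert-sound (k , m) ts)) (swap ⟦ l , n ⟧ᵗ ⟦ k , m ⟧ᵗ ⟦ ts ⟧ᵖ)
      where
      swap : ∀ a b c → a ⊕ (b ⊕ c) ≈ b ⊕ (a ⊕ c)
      swap = solve 3 (λ a b c → a :+ (b :+ c) := b :+ (a :+ c)) ≈-refl

    sort-sound : ∀ ts → ⟦ sort ts ⟧ᵖ ≈ ⟦ ts ⟧ᵖ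
    sort-sound []       = ≈-refl
    sort-sound (t ∷ ts) = ≈-trans (insert-sound t (sort ts)) (+-cong (≈-refl {⟦ t ⟧ᵗ}) (sort-sound ts))

    dropZeros-sound : ∀ ts → ⟦ dropZeros ts ⟧ᵖ ≈ ⟦ ts ⟧ᵖ
    dropZeros-sound [] = ≈-refl
    dropZeros-sound ((k , m) ∷ ts) with k ℤ.≟ 0ℤ
    ... | yes refl = ≈-trans (dropZeros-sound ts)
                       (coeffwise λ n → sym (trans (cong (_+ℤ ⟦ ts ⟧ᵖ n) (ℤP.*-zeroˡ ((q^ exponentAt x y z m) n))) (ℤP.+-identityˡ _)))
    ... | no  _    = +-cong (≈-refl {⟦ k , m ⟧ᵗ}) (dropZeros-sound ts)

  normalise-sound : ∀ e → ⟦ normalise e ⟧ᵖ ≈ ⟦ e ⟧ x y z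
  normalise-sound e = ≈-trans (dropZeros-sound (sort (expand e))) (≈-trans (sort-sound (expand e)) (expand-sound e))

  monomial-identity : ∀ e f → normalise e ≡ normalise f → ⟦ e ⟧ x y z ≈ ⟦ f ⟧ x y z
  monomial-identity e f e≡f =
    ≈-trans (≈-sym (normalise-sound e)) (≈-trans (≈-reflexive (cong ⟦_⟧ᵖ e≡f)) (normalise-sound f))

renameMonomials : (Monomial → Monomial) → Expr → Expr
renameMonomials f (κ k)   = κ k
renameMonomials f (χ m)   = χ (f m)
renameMonomials f (e ⊞ g) = renameMonomials f e ⊞ renameMonomials f g
renameMonomials f (e ⊠ g) = renameMonomials f e ⊠ renameMonomials f g
renameMonomials f (e ⊟ g) = renameMonomials f e ⊟ renameMonomials f g
renameMonomials f (⊟ e)   = ⊟ renameMonomials f e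

renameMonomials-sound : ∀ f {x y z x′ y′ z′} → (∀ m → exponentAt x y z (f m) ≡ exponentAt x′ y′ z′ m) →
                        ∀ e → ⟦ renameMonomials f e ⟧ x y z ≈ ⟦ e ⟧ x′ y′ z′
renameMonomials-sound f f-ok (κ k)   = ≈-refl
renameMonomials-sound f f-ok (χ m)   = q^-≡ (f-ok m)
renameMonomials-sound f f-ok (e ⊞ g) = +-cong (renameMonomials-sound f f-ok e) (renameMonomials-sound f f-ok g)
renameMonomials-sound f f-ok (e ⊠ g) = *-cong (renameMonomials-sound f f-ok e) (renameMonomials-sound f f-ok g)
renameMonomials-sound f f-ok (e ⊟ g) = +-cong (renameMonomials-sound f f-ok e) (-‿cong (renameMonomials-sound f f-ok g))
renameMonomials-sound f f-ok (⊟ e)   = -‿cong (renameMonomials-sound f f-ok e)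

x↦x+1 y↦y+1 : Expr → Expr
x↦x+1 = renameMonomials λ { (mono a b c d) → mono (a + b) b c d }
y↦y+1 = renameMonomials λ { (mono a b c d) → mono (a + c) b c d }

x↦x+1-sound : ∀ e x y z → ⟦ x↦x+1 e ⟧ x y z ≈ ⟦ e ⟧ (suc x) y z
x↦x+1-sound e x y z = renameMonomials-sound _ (λ { (mono a b c d) → shifted a b c d x y z }) e
  where
  shifted : ∀ a b c d x y z → a + b + b * x + c * y + d * z ≡ a + b * suc x + c * y + d * z
  shifted = solve-∀

y↦y+1-sound : ∀ e x y z → ⟦ y↦y+1 e ⟧ x y z ≈ ⟦ e ⟧ x (suc y) z
y↦y+1-sound e x y z = renameMonomials-sound _ (λ { (mono a b c d) → shifted a b c d x y z }) e
  where
  shifted : ∀ a b c d x y z → a + c + b * x + c * y + d * z ≡ a + b * x + c * suc y + d * z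
  shifted = solve-∀

x↦0 : Expr → Expr
x↦0 = renameMonomials λ { (mono a b c d) → mono a 0 c d }

x↦0-sound : ∀ e x y z → ⟦ x↦0 e ⟧ x y z ≈ ⟦ e ⟧ 0 y z
x↦0-sound e x y z = renameMonomials-sound _ (λ { (mono a b c d) → zeroed a b c d x y z }) e
  where
  zeroed : ∀ a b c d x y z → a + 0 * x + c * y + d * z ≡ a + b * 0 + c * y + d * z
  zeroed = solve-∀

-- Rogers' series

tri : ℕ → ℕ
tri zero    = 0
tri (suc n) = tri n + n

sign : ℕ → FPS
sign zero    = one
sign (suc n) = ⊝ sign n

sign-suc-suc : ∀ n j → sign (suc n + suc j) ≈ sign (n + j)
sign-suc-suc n j = ≈-trans (-‿cong (≈-reflexive (cong sign (ℕP.+-suc n j))))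
                           (coeffwise λ k → ℤP.neg-involutive (sign (n + j) k))

-- R m = Σₙ (-1)ⁿ q^(2mn + 5 tri n + 2n) (q^(m+1);q)ₙ/(q;q)ₙ (1 - q^(3+3m+6n)).
rogersExp : ℕ → ℕ → ℕ
rogersExp m n = 2 * m * n + 5 * tri n + 2 * n

rogersCoeff : ℕ → ℕ → FPS
rogersCoeff m n = sign n ⊗ q^ rogersExp m n ⊗ poch (suc m) 1 n ⊗ invPoch 1 1 n

Eρ : Expr
Eρ = 𝕀 ⊟ χ (mono 3 3 6 0)

ρ : ℕ → ℕ → FPS
ρ m n = rogersCoeff m n ⊗ ⟦ Eρ ⟧ m n 0

R : ℕ → FPS
R m = Σ∞ (ρ m)

rogersExp-m+1 : ∀ m n → rogersExp (suc m) n ≡ rogersExp m n + 2 * n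
rogersExp-m+1 m n = lemma m n (tri n)
  where
  lemma : ∀ m n t → 2 * suc m * n + 5 * t + 2 * n ≡ 2 * m * n + 5 * t + 2 * n + 2 * n
  lemma = solve-∀

rogersExp-n+1 : ∀ m n → rogersExp m (suc n) ≡ rogersExp m n + (2 + 2 * m + 5 * n)
rogersExp-n+1 m n = lemma m n (tri n)
  where
  lemma : ∀ m n t → 2 * m * suc n + 5 * (t + n) + 2 * suc n ≡ 2 * m * n + 5 * t + 2 * n + (2 + 2 * m + 5 * n)
  lemma = solve-∀

Eₘ₊₁ Eₙ₊₁ : Expr
Eₘ₊₁ = χ (mono 0 0 2 0) ⊠ (𝕀 ⊟ χ (mono 1 1 1 0))
Eₙ₊₁ = ⊟ (χ (mono 2 2 5 0) ⊠ (𝕀 ⊟ χ (mono 1 1 1 0)))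

rogersCoeff-m+1 : ∀ m n → 1-q^ (suc m) ⊗ rogersCoeff (suc m) n ≈ rogersCoeff m n ⊗ ⟦ Eₘ₊₁ ⟧ m n 0
rogersCoeff-m+1 m n = begin
  1-q^ (suc m) ⊗ (s ⊗ q^ rogersExp (suc m) n ⊗ P′ ⊗ I)
    ≈⟨ ⊗-congˡ (1-q^ (suc m)) (⊗-congʳ I (⊗-congʳ P′ (⊗-congˡ s (q^-split (rogersExp m n) (2 * n) (rogersExp-m+1 m n))))) ⟩
  1-q^ (suc m) ⊗ (s ⊗ (q^ rogersExp m n ⊗ q^ (2 * n)) ⊗ P′ ⊗ I)
    ≈⟨ regroup (1-q^ (suc m)) s (q^ rogersExp m n) (q^ (2 * n)) P′ I ⟩
  s ⊗ q^ rogersExp m n ⊗ I ⊗ q^ (2 * n) ⊗ (1-q^ (suc m) ⊗ P′)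
    ≈⟨ ⊗-congˡ (s ⊗ q^ rogersExp m n ⊗ I ⊗ q^ (2 * n)) (poch-shift (suc m) n) ⟨
  s ⊗ q^ rogersExp m n ⊗ I ⊗ q^ (2 * n) ⊗ (P ⊗ 1-q^ (suc m + n))
    ≈⟨ regroup′ s (q^ rogersExp m n) I (q^ (2 * n)) P (1-q^ (suc m + n)) ⟩
  rogersCoeff m n ⊗ (q^ (2 * n) ⊗ 1-q^ (suc m + n))
    ≈⟨ ⊗-congˡ (rogersCoeff m n) (*-cong (q^-≡ (sym (ℕP.+-identityʳ (2 * n)))) (1-q^-≡ (exponent₁₁₁ m n))) ⟩
  rogersCoeff m n ⊗ ⟦ Eₘ₊₁ ⟧ m n 0 ∎
  where
  open ≈-Reasoning
  s = sign n
  P = poch (suc m) 1 n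
  P′ = poch (suc (suc m)) 1 n
  I = invPoch 1 1 n
  regroup : ∀ l s x y p i → l ⊗ (s ⊗ (x ⊗ y) ⊗ p ⊗ i) ≈ s ⊗ x ⊗ i ⊗ y ⊗ (l ⊗ p)
  regroup = solve 6 (λ l s x y p i → l :* (s :* (x :* y) :* p :* i) := s :* x :* i :* y :* (l :* p)) ≈-refl
  regroup′ : ∀ s x i y p l → s ⊗ x ⊗ i ⊗ y ⊗ (p ⊗ l) ≈ s ⊗ x ⊗ p ⊗ i ⊗ (y ⊗ l)
  regroup′ = solve 6 (λ s x i y p l → s :* x :* i :* y :* (p :* l) := s :* x :* p :* i :* (y :* l)) ≈-refl
  exponent₁₁₁ : ∀ m n → suc m + n ≡ 1 + 1 * m + 1 * n + 0 * 0
  exponent₁₁₁ = solve-∀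

rogersCoeff-n+1 : ∀ m n → rogersCoeff m (suc n) ⊗ 1-q^ (suc n) ≈ rogersCoeff m n ⊗ ⟦ Eₙ₊₁ ⟧ m n 0
rogersCoeff-n+1 m n = begin
  ⊝ s ⊗ q^ rogersExp m (suc n) ⊗ (P ⊗ 1-q^ (suc m + 1 * n)) ⊗ I′ ⊗ 1-q^ (suc n)
    ≈⟨ *-cong (⊗-congʳ I′ (⊗-congʳ (P ⊗ 1-q^ (suc m + 1 * n)) (⊗-congˡ (⊝ s) (q^-split (rogersExp m n) δ (rogersExp-n+1 m n)))))
              (1-q^-≡ (cong suc (sym (ℕP.*-identityˡ n)))) ⟩
  ⊝ s ⊗ (q^ rogersExp m n ⊗ q^ δ) ⊗ (P ⊗ 1-q^ (suc m + 1 * n)) ⊗ I′ ⊗ 1-q^ (1 + 1 * n)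
    ≈⟨ regroup s (q^ rogersExp m n) (q^ δ) P (1-q^ (suc m + 1 * n)) I′ (1-q^ (1 + 1 * n)) ⟩
  s ⊗ q^ rogersExp m n ⊗ P ⊗ (1-q^ (1 + 1 * n) ⊗ I′) ⊗ ⊝ (q^ δ ⊗ 1-q^ (suc m + 1 * n))
    ≈⟨ ⊗-congʳ (⊝ (q^ δ ⊗ 1-q^ (suc m + 1 * n))) (⊗-congˡ (s ⊗ q^ rogersExp m n ⊗ P) (invPoch-suc 0 1 n)) ⟩
  rogersCoeff m n ⊗ ⊝ (q^ δ ⊗ 1-q^ (suc m + 1 * n))
    ≈⟨ ⊗-congˡ (rogersCoeff m n) (-‿cong (*-cong (q^-≡ (sym (ℕP.+-identityʳ δ))) (1-q^-≡ (exponent₁₁₁ m n)))) ⟩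
  rogersCoeff m n ⊗ ⟦ Eₙ₊₁ ⟧ m n 0 ∎
  where
  open ≈-Reasoning
  s = sign n
  δ = 2 + 2 * m + 5 * n
  P = poch (suc m) 1 n
  I′ = invPoch 1 1 (suc n)
  regroup : ∀ s x y p l i l′ → ⊝ s ⊗ (x ⊗ y) ⊗ (p ⊗ l) ⊗ i ⊗ l′ ≈ s ⊗ x ⊗ p ⊗ (l′ ⊗ i) ⊗ ⊝ (y ⊗ l)
  regroup = solve 7 (λ s x y p l i l′ → :- s :* (x :* y) :* (p :* l) :* i :* l′ := s :* x :* p :* (l′ :* i) :* :- (y :* l)) ≈-refl
  exponent₁₁₁ : ∀ m n → suc m + 1 * n ≡ 1 + 1 * m + 1 * n + 0 * 0
  exponent₁₁₁ = solve-∀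

Pe Eσ : Expr
Pe = 𝕀 ⊞ χ (mono 0 0 1 0) ⊞ χ (mono 1 1 3 0) ⊞ χ (mono 3 2 5 0) ⊟ χ (mono 4 3 6 0)
Eσ = (𝕀 ⊟ χ (mono 0 0 1 0)) ⊠ Pe

Eρₘ₊₁ Eρₘ₊₂ Eσₙ₊₁ : Expr
Eρₘ₊₁ = Eₘ₊₁ ⊠ x↦x+1 Eρ
Eρₘ₊₂ = χ (mono 1 1 0 0) ⊠ Eₘ₊₁ ⊠ x↦x+1 Eₘ₊₁ ⊠ x↦x+1 (x↦x+1 Eρ)
Eσₙ₊₁ = Eₙ₊₁ ⊠ y↦y+1 Pe

σ : ℕ → ℕ → FPS
σ m n = rogersCoeff m n ⊗ ⟦ Eσ ⟧ m n 0

ρ-m+1 : ∀ m n → 1-q^ (suc m) ⊗ ρ (suc m) n ≈ rogersCoeff m n ⊗ ⟦ Eρₘ₊₁ ⟧ m n 0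
ρ-m+1 m n = begin
  1-q^ (suc m) ⊗ (rogersCoeff (suc m) n ⊗ ⟦ Eρ ⟧ (suc m) n 0)
    ≈⟨ *-assoc (1-q^ (suc m)) (rogersCoeff (suc m) n) (⟦ Eρ ⟧ (suc m) n 0) ⟨
  1-q^ (suc m) ⊗ rogersCoeff (suc m) n ⊗ ⟦ Eρ ⟧ (suc m) n 0
    ≈⟨ *-cong (rogersCoeff-m+1 m n) (≈-sym (x↦x+1-sound Eρ m n 0)) ⟩
  rogersCoeff m n ⊗ ⟦ Eₘ₊₁ ⟧ m n 0 ⊗ ⟦ x↦x+1 Eρ ⟧ m n 0
    ≈⟨ *-assoc (rogersCoeff m n) (⟦ Eₘ₊₁ ⟧ m n 0) (⟦ x↦x+1 Eρ ⟧ m n 0) ⟩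
  rogersCoeff m n ⊗ ⟦ Eρₘ₊₁ ⟧ m n 0 ∎
  where open ≈-Reasoning

ρ-m+2 : ∀ m n → q^ (suc m) ⊗ 1-q^ (suc m) ⊗ 1-q^ (suc (suc m)) ⊗ ρ (suc (suc m)) n
              ≈ rogersCoeff m n ⊗ ⟦ Eρₘ₊₂ ⟧ m n 0
ρ-m+2 m n = begin
  Q ⊗ L₁ ⊗ L₂ ⊗ (C₂ ⊗ E₂)     ≈⟨ regroup Q L₁ L₂ C₂ E₂ ⟩
  Q ⊗ (L₁ ⊗ (L₂ ⊗ C₂ ⊗ E₂))   ≈⟨ ⊗-congˡ Q (⊗-congˡ L₁ (⊗-congʳ E₂ (rogersCoeff-m+1 (suc m) n))) ⟩
  Q ⊗ (L₁ ⊗ (C₁ ⊗ F₁ ⊗ E₂))   ≈⟨ regroup′ Q L₁ C₁ F₁ E₂ ⟩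
  Q ⊗ (L₁ ⊗ C₁ ⊗ F₁ ⊗ E₂)     ≈⟨ ⊗-congˡ Q (⊗-congʳ E₂ (⊗-congʳ F₁ (rogersCoeff-m+1 m n))) ⟩
  Q ⊗ (C ⊗ F ⊗ F₁ ⊗ E₂)       ≈⟨ regroup″ Q C F F₁ E₂ ⟩
  C ⊗ (Q ⊗ F ⊗ F₁ ⊗ E₂)       ≈⟨ ⊗-congˡ C (*-cong (*-cong (⊗-congʳ F (q^-≡ (exponent₁₁₀ m n))) (≈-sym (x↦x+1-sound Eₘ₊₁ m n 0)))
                                   (≈-sym (≈-trans (x↦x+1-sound (x↦x+1 Eρ) m n 0) (x↦x+1-sound Eρ (suc m) n 0)))) ⟩
  C ⊗ ⟦ Eρₘ₊₂ ⟧ m n 0 ∎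
  where
  open ≈-Reasoning
  Q = q^ (suc m)
  L₁ = 1-q^ (suc m)
  L₂ = 1-q^ (suc (suc m))
  C = rogersCoeff m n
  C₁ = rogersCoeff (suc m) n
  C₂ = rogersCoeff (suc (suc m)) n
  F = ⟦ Eₘ₊₁ ⟧ m n 0
  F₁ = ⟦ Eₘ₊₁ ⟧ (suc m) n 0
  E₂ = ⟦ Eρ ⟧ (suc (suc m)) n 0
  regroup : ∀ q l₁ l₂ c e → q ⊗ l₁ ⊗ l₂ ⊗ (c ⊗ e) ≈ q ⊗ (l₁ ⊗ (l₂ ⊗ c ⊗ e))
  regroup = solve 5 (λ q l₁ l₂ c e → q :* l₁ :* l₂ :* (c :* e) := q :* (l₁ :* (l₂ :* c :* e))) ≈-refl
  regroup′ : ∀ q l c f e → q ⊗ (l ⊗ (c ⊗ f ⊗ e)) ≈ q ⊗ (l ⊗ c ⊗ f ⊗ e)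
  regroup′ = solve 5 (λ q l c f e → q :* (l :* (c :* f :* e)) := q :* (l :* c :* f :* e)) ≈-refl
  regroup″ : ∀ q c f f₁ e → q ⊗ (c ⊗ f ⊗ f₁ ⊗ e) ≈ c ⊗ (q ⊗ f ⊗ f₁ ⊗ e)
  regroup″ = solve 5 (λ q c f f₁ e → q :* (c :* f :* f₁ :* e) := c :* (q :* f :* f₁ :* e)) ≈-refl
  exponent₁₁₀ : ∀ m n → suc m ≡ 1 + 1 * m + 0 * n + 0 * 0
  exponent₁₁₀ = solve-∀

σ-n+1 : ∀ m n → σ m (suc n) ≈ rogersCoeff m n ⊗ ⟦ Eσₙ₊₁ ⟧ m n 0
σ-n+1 m n = begin
  rogersCoeff m (suc n) ⊗ (1-q^ (0 + 0 * m + 1 * suc n + 0 * 0) ⊗ ⟦ Pe ⟧ m (suc n) 0)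
    ≈⟨ ⊗-congˡ (rogersCoeff m (suc n)) (*-cong (1-q^-≡ (exponent₀₀₁ m n)) (y↦y+1-sound Pe m n 0)) ⟨
  rogersCoeff m (suc n) ⊗ (1-q^ (suc n) ⊗ ⟦ y↦y+1 Pe ⟧ m n 0)
    ≈⟨ *-assoc (rogersCoeff m (suc n)) (1-q^ (suc n)) (⟦ y↦y+1 Pe ⟧ m n 0) ⟨
  rogersCoeff m (suc n) ⊗ 1-q^ (suc n) ⊗ ⟦ y↦y+1 Pe ⟧ m n 0
    ≈⟨ ⊗-congʳ (⟦ y↦y+1 Pe ⟧ m n 0) (rogersCoeff-n+1 m n) ⟩
  rogersCoeff m n ⊗ ⟦ Eₙ₊₁ ⟧ m n 0 ⊗ ⟦ y↦y+1 Pe ⟧ m n 0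
    ≈⟨ *-assoc (rogersCoeff m n) (⟦ Eₙ₊₁ ⟧ m n 0) (⟦ y↦y+1 Pe ⟧ m n 0) ⟩
  rogersCoeff m n ⊗ ⟦ Eσₙ₊₁ ⟧ m n 0 ∎
  where
  open ≈-Reasoning
  exponent₀₀₁ : ∀ m n → suc n ≡ 0 + 0 * m + 1 * suc n + 0 * 0
  exponent₀₀₁ = solve-∀

rogers-bracket : ∀ m n → ⟦ Eρ ⊟ (Eρₘ₊₁ ⊞ Eρₘ₊₂) ⟧ m n 0 ≈ ⟦ Eσ ⊟ Eσₙ₊₁ ⟧ m n 0
rogers-bracket m n = monomial-identity m n 0 (Eρ ⊟ (Eρₘ₊₁ ⊞ Eρₘ₊₂)) (Eσ ⊟ Eσₙ₊₁) refl

rogers-term : ∀ m n → ρ m n ⊖ (1-q^ (suc m) ⊗ ρ (suc m) n ⊕ q^ (suc m) ⊗ 1-q^ (suc m) ⊗ 1-q^ (suc (suc m)) ⊗ ρ (suc (suc m)) n)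
                    ≈ σ m n ⊖ σ m (suc n)
rogers-term m n = begin
  ρ m n ⊖ (1-q^ (suc m) ⊗ ρ (suc m) n ⊕ q^ (suc m) ⊗ 1-q^ (suc m) ⊗ 1-q^ (suc (suc m)) ⊗ ρ (suc (suc m)) n)
    ≈⟨ +-cong (≈-refl {ρ m n}) (-‿cong (+-cong (ρ-m+1 m n) (ρ-m+2 m n))) ⟩
  C ⊗ ⟦ Eρ ⟧ m n 0 ⊖ (C ⊗ ⟦ Eρₘ₊₁ ⟧ m n 0 ⊕ C ⊗ ⟦ Eρₘ₊₂ ⟧ m n 0)
    ≈⟨ factor C (⟦ Eρ ⟧ m n 0) (⟦ Eρₘ₊₁ ⟧ m n 0) (⟦ Eρₘ₊₂ ⟧ m n 0) ⟩
  C ⊗ ⟦ Eρ ⊟ (Eρₘ₊₁ ⊞ Eρₘ₊₂) ⟧ m n 0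
    ≈⟨ ⊗-congˡ C (rogers-bracket m n) ⟩
  C ⊗ ⟦ Eσ ⊟ Eσₙ₊₁ ⟧ m n 0
    ≈⟨ distrib-⊖ C (⟦ Eσ ⟧ m n 0) (⟦ Eσₙ₊₁ ⟧ m n 0) ⟩
  σ m n ⊖ C ⊗ ⟦ Eσₙ₊₁ ⟧ m n 0
    ≈⟨ +-cong (≈-refl {σ m n}) (-‿cong (σ-n+1 m n)) ⟨
  σ m n ⊖ σ m (suc n) ∎
  where
  open ≈-Reasoning
  C = rogersCoeff m n
  factor : ∀ c a b d → c ⊗ a ⊖ (c ⊗ b ⊕ c ⊗ d) ≈ c ⊗ (a ⊖ (b ⊕ d))
  factor = solve 4 (λ c a b d → c :* a :- (c :* b :+ c :* d) := c :* (a :- (b :+ d))) ≈-refl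
  distrib-⊖ : ∀ c a b → c ⊗ (a ⊖ b) ≈ c ⊗ a ⊖ c ⊗ b
  distrib-⊖ = solve 3 (λ c a b → c :* (a :- b) := c :* a :- c :* b) ≈-refl

rogersCoeff≈[]𝟘 : ∀ m n → rogersCoeff m n ≈[ rogersExp m n ] 𝟘
rogersCoeff≈[]𝟘 m n = ⊗-zeroˡ[] (invPoch 1 1 n) (⊗-zeroˡ[] (poch (suc m) 1 n) (⊗q^≈[]𝟘 (rogersExp m n) (sign n)))

n≤rogersExp : ∀ m n → n ≤ rogersExp m n
n≤rogersExp m n = ℕP.≤-trans (ℕP.m≤m+n n (n + 0)) (ℕP.m≤n+m (2 * n) (2 * m * n + 5 * tri n))

ρ-summable : ∀ m → Summable (ρ m)
ρ-summable m n = ≈[]-weaken (n≤rogersExp m n) (⊗-zeroˡ[] (⟦ Eρ ⟧ m n 0) (rogersCoeff≈[]𝟘 m n))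

σ-summable : ∀ m → Summable (σ m)
σ-summable m n = ≈[]-weaken (n≤rogersExp m n) (⊗-zeroˡ[] (⟦ Eσ ⟧ m n 0) (rogersCoeff≈[]𝟘 m n))

σ-zero : ∀ m → σ m 0 ≈ 𝟘
σ-zero m = ≈-trans (⊗-congˡ (rogersCoeff m 0) (⊗-congʳ (⟦ Pe ⟧ m 0 0) 1-q^-zero))
                   (≈-trans (⊗-congˡ (rogersCoeff m 0) (zeroˡ (⟦ Pe ⟧ m 0 0))) (zeroʳ (rogersCoeff m 0)))

R-recurrence : ∀ m → R m ≈ 1-q^ (suc m) ⊗ R (suc m) ⊕ q^ (suc m) ⊗ 1-q^ (suc m) ⊗ 1-q^ (suc (suc m)) ⊗ R (suc (suc m))
R-recurrence m = Σ∞-telescoping₂ (σ m) (1-q^ (suc m)) (q^ (suc m) ⊗ 1-q^ (suc m) ⊗ 1-q^ (suc (suc m)))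
  (ρ-summable (suc m)) (ρ-summable (suc (suc m))) (σ-summable m) (σ-zero m) (rogers-term m)

R≈[]one : ∀ m → R m ≈[ suc m ] one
R≈[]one m = ≈[]-trans
  (Σ∞-head[] (ρ m) λ n → ≈[]-weaken (m<rogersExp m n) (⊗-zeroˡ[] (⟦ Eρ ⟧ m (suc n) 0) (rogersCoeff≈[]𝟘 m (suc n))))
  (≈[]-trans (⊗-cong[] (≈⇒≈[] rogersCoeff₀≈one) (≈[]-weaken (m<3+3m m) (1-q^≈[]one (3 + 3 * m + 6 * 0 + 0 * 0))))
             (≈⇒≈[] (*-identityˡ one)))
  where
  m<rogersExp : ∀ m n → suc m ≤ rogersExp m (suc n)
  m<rogersExp m n = subst (suc m ≤_) (sym (lemma m n (tri n))) (ℕP.m≤m+n (suc m) _)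
    where
    lemma : ∀ m n t → 2 * m * suc n + 5 * (t + n) + 2 * suc n ≡ suc m + (m + 2 * m * n + 5 * (t + n) + 2 * n + 1)
    lemma = solve-∀
  m<3+3m : ∀ m → suc m ≤ 3 + 3 * m + 6 * 0 + 0 * 0
  m<3+3m m = subst (suc m ≤_) (lemma m) (ℕP.m≤m+n (suc m) (2 + 2 * m))
    where
    lemma : ∀ m → suc m + (2 + 2 * m) ≡ 3 + 3 * m + 6 * 0 + 0 * 0
    lemma = solve-∀
  rogersCoeff₀≈one : rogersCoeff m 0 ≈ one
  rogersCoeff₀≈one = ≈-trans (*-identityʳ _) (≈-trans (*-identityʳ _)
                       (≈-trans (*-identityˡ _) (≈-trans (q^-≡ (rogersExp₀ m)) q^-zero)))
    where
    rogersExp₀ : ∀ m → 2 * m * 0 + 5 * 0 + 2 * 0 ≡ 0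
    rogersExp₀ = solve-∀

-- The double sum

doubleExp : ℕ → ℕ → ℕ → ℕ
doubleExp m i j = (i + 2 * j) * (i + 2 * j) + m * (i + 2 * j) + tri i

u : ℕ → ℕ → ℕ → FPS
u m i j = q^ doubleExp m i j ⊗ invPoch 1 1 i ⊗ invPoch 2 2 j

W : ℕ → FPS
W m = Σ∞ λ i → Σ∞ λ j → u m i j

u-split : ∀ {e} m i j M → e ≡ doubleExp m i j + exponentAt m i j M →
          q^ e ⊗ invPoch 1 1 i ⊗ invPoch 2 2 j ≈ u m i j ⊗ ⟦ χ M ⟧ m i j
u-split m i j M e≡ = ≈-trans (⊗-congʳ (invPoch 2 2 j) (⊗-congʳ (invPoch 1 1 i) (q^-split (doubleExp m i j) (exponentAt m i j M) e≡)))
                             (regroup (q^ doubleExp m i j) (q^ exponentAt m i j M) (invPoch 1 1 i) (invPoch 2 2 j))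
  where
  regroup : ∀ x y a b → x ⊗ y ⊗ a ⊗ b ≈ x ⊗ a ⊗ b ⊗ y
  regroup = solve 4 (λ x y a b → x :* y :* a :* b := x :* a :* b :* y) ≈-refl

u-m+1 : ∀ m i j → u (suc m) i j ≈ u m i j ⊗ ⟦ χ (mono 0 0 1 2) ⟧ m i j
u-m+1 m i j = u-split m i j (mono 0 0 1 2) (lemma m i j (tri i))
  where
  lemma : ∀ m i j t → (i + 2 * j) * (i + 2 * j) + suc m * (i + 2 * j) + t
                    ≡ (i + 2 * j) * (i + 2 * j) + m * (i + 2 * j) + t + (0 + 0 * m + 1 * i + 2 * j)
  lemma = solve-∀

u-m+2 : ∀ m i j → q^ (suc m) ⊗ u (suc (suc m)) i j ≈ u m i j ⊗ ⟦ χ (mono 1 1 2 4) ⟧ m i j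
u-m+2 m i j = ≈-trans (regroup (q^ suc m) (q^ doubleExp (suc (suc m)) i j) (invPoch 1 1 i) (invPoch 2 2 j))
                      (≈-trans (⊗-congʳ (invPoch 2 2 j) (⊗-congʳ (invPoch 1 1 i) (≈-sym (q^-+ (suc m) (doubleExp (suc (suc m)) i j)))))
                               (u-split m i j (mono 1 1 2 4) (lemma m i j (tri i))))
  where
  regroup : ∀ x y a b → x ⊗ (y ⊗ a ⊗ b) ≈ x ⊗ y ⊗ a ⊗ b
  regroup = solve 4 (λ x y a b → x :* (y :* a :* b) := x :* y :* a :* b) ≈-refl
  lemma : ∀ m i j t → suc m + ((i + 2 * j) * (i + 2 * j) + suc (suc m) * (i + 2 * j) + t)
                    ≡ (i + 2 * j) * (i + 2 * j) + m * (i + 2 * j) + t + (1 + 1 * m + 2 * i + 4 * j)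
  lemma = solve-∀

u-i+1 : ∀ m i j → u m (suc i) j ⊗ ⟦ 𝕀 ⊟ χ (mono 0 0 1 0) ⟧ m (suc i) j ≈ u m i j ⊗ ⟦ χ (mono 1 1 3 4) ⟧ m i j
u-i+1 m i j = begin
  q^ doubleExp m (suc i) j ⊗ I′ ⊗ invPoch 2 2 j ⊗ 1-q^ (0 + 0 * m + 1 * suc i + 0 * j)
    ≈⟨ ⊗-congˡ (q^ doubleExp m (suc i) j ⊗ I′ ⊗ invPoch 2 2 j) (1-q^-≡ (exponentAt₀₀₁₀ m i j)) ⟨
  q^ doubleExp m (suc i) j ⊗ I′ ⊗ invPoch 2 2 j ⊗ 1-q^ (1 + 1 * i)
    ≈⟨ regroup (q^ doubleExp m (suc i) j) I′ (invPoch 2 2 j) (1-q^ (1 + 1 * i)) ⟩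
  q^ doubleExp m (suc i) j ⊗ (1-q^ (1 + 1 * i) ⊗ I′) ⊗ invPoch 2 2 j
    ≈⟨ ⊗-congʳ (invPoch 2 2 j) (⊗-congˡ (q^ doubleExp m (suc i) j) (invPoch-suc 0 1 i)) ⟩
  q^ doubleExp m (suc i) j ⊗ invPoch 1 1 i ⊗ invPoch 2 2 j
    ≈⟨ u-split m i j (mono 1 1 3 4) (lemma m i j (tri i)) ⟩
  u m i j ⊗ ⟦ χ (mono 1 1 3 4) ⟧ m i j ∎
  where
  open ≈-Reasoning
  I′ = invPoch 1 1 (suc i)
  regroup : ∀ x a b l → x ⊗ a ⊗ b ⊗ l ≈ x ⊗ (l ⊗ a) ⊗ b
  regroup = solve 4 (λ x a b l → x :* a :* b :* l := x :* (l :* a) :* b) ≈-refl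
  exponentAt₀₀₁₀ : ∀ m i j → 1 + 1 * i ≡ 0 + 0 * m + 1 * suc i + 0 * j
  exponentAt₀₀₁₀ = solve-∀
  lemma : ∀ m i j t → (suc i + 2 * j) * (suc i + 2 * j) + m * (suc i + 2 * j) + (t + i)
                    ≡ (i + 2 * j) * (i + 2 * j) + m * (i + 2 * j) + t + (1 + 1 * m + 3 * i + 4 * j)
  lemma = solve-∀

u-j+1 : ∀ m i j → u m i (suc j) ⊗ ⟦ 𝕀 ⊟ χ (mono 0 0 0 2) ⟧ m i (suc j) ≈ u m i j ⊗ ⟦ χ (mono 4 2 4 8) ⟧ m i j
u-j+1 m i j = begin
  q^ doubleExp m i (suc j) ⊗ invPoch 1 1 i ⊗ J′ ⊗ 1-q^ (0 + 0 * m + 0 * i + 2 * suc j)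
    ≈⟨ ⊗-congˡ (q^ doubleExp m i (suc j) ⊗ invPoch 1 1 i ⊗ J′) (1-q^-≡ (exponentAt₀₀₀₂ m i j)) ⟨
  q^ doubleExp m i (suc j) ⊗ invPoch 1 1 i ⊗ J′ ⊗ 1-q^ (2 + 2 * j)
    ≈⟨ regroup (q^ doubleExp m i (suc j) ⊗ invPoch 1 1 i) J′ (1-q^ (2 + 2 * j)) ⟩
  q^ doubleExp m i (suc j) ⊗ invPoch 1 1 i ⊗ (1-q^ (2 + 2 * j) ⊗ J′)
    ≈⟨ ⊗-congˡ (q^ doubleExp m i (suc j) ⊗ invPoch 1 1 i) (invPoch-suc 1 2 j) ⟩
  q^ doubleExp m i (suc j) ⊗ invPoch 1 1 i ⊗ invPoch 2 2 j
    ≈⟨ u-split m i j (mono 4 2 4 8) (lemma m i j (tri i)) ⟩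
  u m i j ⊗ ⟦ χ (mono 4 2 4 8) ⟧ m i j ∎
  where
  open ≈-Reasoning
  J′ = invPoch 2 2 (suc j)
  regroup : ∀ x b l → x ⊗ b ⊗ l ≈ x ⊗ (l ⊗ b)
  regroup = solve 3 (λ x b l → x :* b :* l := x :* (l :* b)) ≈-refl
  exponentAt₀₀₀₂ : ∀ m i j → 2 + 2 * j ≡ 0 + 0 * m + 0 * i + 2 * suc j
  exponentAt₀₀₀₂ = solve-∀
  lemma : ∀ m i j t → (i + 2 * suc j) * (i + 2 * suc j) + m * (i + 2 * suc j) + t
                    ≡ (i + 2 * j) * (i + 2 * j) + m * (i + 2 * j) + t + (4 + 2 * m + 4 * i + 8 * j)
  lemma = solve-∀

-- W m - W (m+1) - q^(m+1) W (m+2) is a sum of differences γ i − γ (i+1) and β j − β (j+1).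
Eγ Eβ : Expr
Eγ = (𝕀 ⊟ χ (mono 0 0 1 0)) ⊠ (𝕀 ⊟ χ (mono 1 1 2 4))
Eβ = (𝕀 ⊟ χ (mono 0 0 0 2)) ⊠ χ (mono 0 0 1 0)

γ β : ℕ → ℕ → ℕ → FPS
γ m i j = u m i j ⊗ ⟦ Eγ ⟧ m i j
β m i j = u m i j ⊗ ⟦ Eβ ⟧ m i j

Eγᵢ₊₁ Eβⱼ₊₁ : Expr
Eγᵢ₊₁ = χ (mono 1 1 3 4) ⊠ y↦y+1 (𝕀 ⊟ χ (mono 1 1 2 4))
Eβⱼ₊₁ = χ (mono 4 2 4 8) ⊠ χ (mono 0 0 1 0)

γ-i+1 : ∀ m i j → γ m (suc i) j ≈ u m i j ⊗ ⟦ Eγᵢ₊₁ ⟧ m i j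
γ-i+1 m i j = ≈-trans (≈-sym (*-assoc (u m (suc i) j) (⟦ 𝕀 ⊟ χ (mono 0 0 1 0) ⟧ m (suc i) j) (⟦ 𝕀 ⊟ χ (mono 1 1 2 4) ⟧ m (suc i) j)))
  (≈-trans (*-cong (u-i+1 m i j) (≈-sym (y↦y+1-sound (𝕀 ⊟ χ (mono 1 1 2 4)) m i j)))
           (*-assoc (u m i j) (⟦ χ (mono 1 1 3 4) ⟧ m i j) (⟦ y↦y+1 (𝕀 ⊟ χ (mono 1 1 2 4)) ⟧ m i j)))

β-j+1 : ∀ m i j → β m i (suc j) ≈ u m i j ⊗ ⟦ Eβⱼ₊₁ ⟧ m i j
β-j+1 m i j = ≈-trans (≈-sym (*-assoc (u m i (suc j)) (⟦ 𝕀 ⊟ χ (mono 0 0 0 2) ⟧ m i (suc j)) (⟦ χ (mono 0 0 1 0) ⟧ m i j)))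
  (≈-trans (⊗-congʳ (⟦ χ (mono 0 0 1 0) ⟧ m i j) (u-j+1 m i j))
           (*-assoc (u m i j) (⟦ χ (mono 4 2 4 8) ⟧ m i j) (⟦ χ (mono 0 0 1 0) ⟧ m i j)))

double-bracket : ∀ m i j → ⟦ 𝕀 ⊟ (χ (mono 0 0 1 2) ⊞ χ (mono 1 1 2 4)) ⟧ m i j
                         ≈ ⟦ (Eγ ⊟ Eγᵢ₊₁) ⊞ (Eβ ⊟ Eβⱼ₊₁) ⟧ m i j
double-bracket m i j = monomial-identity m i j (𝕀 ⊟ (χ (mono 0 0 1 2) ⊞ χ (mono 1 1 2 4))) ((Eγ ⊟ Eγᵢ₊₁) ⊞ (Eβ ⊟ Eβⱼ₊₁)) refl

double-term : ∀ m i j → u m i j ⊖ (u (suc m) i j ⊕ q^ (suc m) ⊗ u (suc (suc m)) i j)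
                      ≈ (γ m i j ⊖ γ m (suc i) j) ⊕ (β m i j ⊖ β m i (suc j))
double-term m i j = begin
  U ⊖ (u (suc m) i j ⊕ q^ (suc m) ⊗ u (suc (suc m)) i j)
    ≈⟨ +-cong (≈-refl {U}) (-‿cong (+-cong (u-m+1 m i j) (u-m+2 m i j))) ⟩
  U ⊖ (U ⊗ ⟦ χ (mono 0 0 1 2) ⟧ m i j ⊕ U ⊗ ⟦ χ (mono 1 1 2 4) ⟧ m i j)
    ≈⟨ factor U (⟦ χ (mono 0 0 1 2) ⟧ m i j) (⟦ χ (mono 1 1 2 4) ⟧ m i j) ⟩
  U ⊗ ⟦ 𝕀 ⊟ (χ (mono 0 0 1 2) ⊞ χ (mono 1 1 2 4)) ⟧ m i j
    ≈⟨ ⊗-congˡ U (double-bracket m i j) ⟩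
  U ⊗ ⟦ (Eγ ⊟ Eγᵢ₊₁) ⊞ (Eβ ⊟ Eβⱼ₊₁) ⟧ m i j
    ≈⟨ distribute U (⟦ Eγ ⟧ m i j) (⟦ Eγᵢ₊₁ ⟧ m i j) (⟦ Eβ ⟧ m i j) (⟦ Eβⱼ₊₁ ⟧ m i j) ⟩
  (γ m i j ⊖ U ⊗ ⟦ Eγᵢ₊₁ ⟧ m i j) ⊕ (β m i j ⊖ U ⊗ ⟦ Eβⱼ₊₁ ⟧ m i j)
    ≈⟨ +-cong (+-cong (≈-refl {γ m i j}) (-‿cong (γ-i+1 m i j))) (+-cong (≈-refl {β m i j}) (-‿cong (β-j+1 m i j))) ⟨
  (γ m i j ⊖ γ m (suc i) j) ⊕ (β m i j ⊖ β m i (suc j)) ∎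
  where
  open ≈-Reasoning
  U = u m i j
  factor : ∀ u a b → u ⊖ (u ⊗ a ⊕ u ⊗ b) ≈ u ⊗ (one ⊖ (a ⊕ b))
  factor = solve 3 (λ u a b → u :- (u :* a :+ u :* b) := u :* (con 1ℤ :- (a :+ b))) ≈-refl
  distribute : ∀ u a b c d → u ⊗ ((a ⊖ b) ⊕ (c ⊖ d)) ≈ (u ⊗ a ⊖ u ⊗ b) ⊕ (u ⊗ c ⊖ u ⊗ d)
  distribute = solve 5 (λ u a b c d → u :* ((a :- b) :+ (c :- d)) := (u :* a :- u :* b) :+ (u :* c :- u :* d)) ≈-refl

i+2j≤doubleExp : ∀ m i j → i + 2 * j ≤ doubleExp m i j
i+2j≤doubleExp m i j = ℕP.≤-trans (n≤n*n (i + 2 * j)) (ℕP.≤-trans (ℕP.m≤m+n _ _) (ℕP.m≤m+n _ _))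
  where
  n≤n*n : ∀ n → n ≤ n * n
  n≤n*n zero    = z≤n
  n≤n*n (suc n) = ℕP.m≤m*n (suc n) (suc n)

u≈[]𝟘 : ∀ m i j → u m i j ≈[ doubleExp m i j ] 𝟘
u≈[]𝟘 m i j = ⊗-zeroˡ[] (invPoch 2 2 j) (q^⊗≈[]𝟘 (doubleExp m i j) (invPoch 1 1 i))

u≈[i]𝟘 : ∀ m i j → u m i j ≈[ i ] 𝟘
u≈[i]𝟘 m i j = ≈[]-weaken (ℕP.≤-trans (ℕP.m≤m+n i (2 * j)) (i+2j≤doubleExp m i j)) (u≈[]𝟘 m i j)

u-summable : ∀ m i → Summable (u m i)
u-summable m i j = ≈[]-weaken (ℕP.≤-trans (ℕP.≤-trans (ℕP.m≤m+n j (j + 0)) (ℕP.m≤n+m (2 * j) i)) (i+2j≤doubleExp m i j))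
                              (u≈[]𝟘 m i j)

W-recurrence : ∀ m → W m ≈ W (suc m) ⊕ q^ (suc m) ⊗ W (suc (suc m))
W-recurrence m = ⊖≈𝟘⇒≈ _ _ (begin
  W m ⊖ (W (suc m) ⊕ Q ⊗ W (suc (suc m)))
    ≈⟨ Σ∞-linear (λ i → Σ∞ (u m i)) (λ i → Σ∞ (u (suc m) i)) (λ i → Σ∞ (u (suc (suc m)) i)) Q
                 (λ i → Σ∞-zero[] _ (u≈[i]𝟘 (suc (suc m)) i)) ⟨
  Σ∞ (λ i → Σ∞ (u m i) ⊖ (Σ∞ (u (suc m) i) ⊕ Q ⊗ Σ∞ (u (suc (suc m)) i)))
    ≈⟨ Σ∞-cong (λ i → Σ∞-linear (u m i) (u (suc m) i) (u (suc (suc m)) i) Q (u-summable (suc (suc m)) i)) ⟨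
  Σ∞ (λ i → Σ∞ (λ j → u m i j ⊖ (u (suc m) i j ⊕ Q ⊗ u (suc (suc m)) i j)))
    ≈⟨ Σ∞-cong (λ i → Σ∞-cong (double-term m i)) ⟩
  Σ∞ (λ i → Σ∞ (λ j → (γ m i j ⊖ γ m (suc i) j) ⊕ (β m i j ⊖ β m i (suc j))))
    ≈⟨ Σ∞-cong inner-telescope ⟩
  Σ∞ (λ i → G i ⊖ G (suc i))
    ≈⟨ Σ∞-telescope G G-summable (λ _ → ≈-refl) ⟩
  G 0
    ≈⟨ Σ∞-𝟘 (λ j → ≈-trans (⊗-congˡ (u m 0 j) (⊗-congʳ (⟦ 𝕀 ⊟ χ (mono 1 1 2 4) ⟧ m 0 j) 1-q^-zero))
                            (≈-trans (⊗-congˡ (u m 0 j) (zeroˡ (⟦ 𝕀 ⊟ χ (mono 1 1 2 4) ⟧ m 0 j))) (zeroʳ (u m 0 j)))) ⟩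
  𝟘 ∎)
  where
  open ≈-Reasoning
  Q = q^ (suc m)
  G : ℕ → FPS
  G i = Σ∞ (γ m i)
  G-summable : Summable G
  G-summable i = Σ∞-zero[] _ λ j → ⊗-zeroˡ[] (⟦ Eγ ⟧ m i j) (u≈[i]𝟘 m i j)
  inner-telescope : ∀ i → Σ∞ (λ j → (γ m i j ⊖ γ m (suc i) j) ⊕ (β m i j ⊖ β m i (suc j))) ≈ G i ⊖ G (suc i)
  inner-telescope i = begin
    Σ∞ (λ j → (γ m i j ⊖ γ m (suc i) j) ⊕ (β m i j ⊖ β m i (suc j)))
      ≈⟨ Σ∞-⊕ (λ j → γ m i j ⊖ γ m (suc i) j) (λ j → β m i j ⊖ β m i (suc j)) ⟩
    Σ∞ (λ j → γ m i j ⊖ γ m (suc i) j) ⊕ Σ∞ (λ j → β m i j ⊖ β m i (suc j))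
      ≈⟨ +-cong (Σ∞-⊖ (γ m i) (γ m (suc i))) (Σ∞-telescope (β m i) β-summable (λ _ → ≈-refl)) ⟩
    G i ⊖ G (suc i) ⊕ β m i 0
      ≈⟨ +-cong (≈-refl {G i ⊖ G (suc i)}) β₀≈𝟘 ⟩
    G i ⊖ G (suc i) ⊕ 𝟘
      ≈⟨ +-identityʳ (G i ⊖ G (suc i)) ⟩
    G i ⊖ G (suc i) ∎
    where
    β-summable : Summable (β m i)
    β-summable j = ⊗-zeroˡ[] (⟦ Eβ ⟧ m i j) (u-summable m i j)
    β₀≈𝟘 : β m i 0 ≈ 𝟘
    β₀≈𝟘 = ≈-trans (⊗-congˡ (u m i 0) (⊗-congʳ (⟦ χ (mono 0 0 1 0) ⟧ m i 0) 1-q^-zero))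
                   (≈-trans (⊗-congˡ (u m i 0) (zeroˡ (⟦ χ (mono 0 0 1 0) ⟧ m i 0))) (zeroʳ (u m i 0)))

W≈[]one : ∀ m → W m ≈[ suc m ] one
W≈[]one m =
  ≈[]-trans (Σ∞-head[] _ λ i → Σ∞-zero[] _ λ j → ≈[]-weaken (m<doubleExp (suc i) j (i + 2 * j) refl) (u≈[]𝟘 m (suc i) j))
  (≈[]-trans (Σ∞-head[] _ λ j → ≈[]-weaken (m<doubleExp 0 (suc j) (j + suc (j + 0)) refl) (u≈[]𝟘 m 0 (suc j)))
             (≈⇒≈[] u₀₀≈one))
  where
  m<doubleExp : ∀ i j k → i + 2 * j ≡ suc k → suc m ≤ doubleExp m i j
  m<doubleExp i j k i+2j≡ rewrite i+2j≡ =
    ℕP.≤-trans (ℕP.+-mono-≤ (s≤s z≤n) (ℕP.m≤m*n m (suc k))) (ℕP.m≤m+n _ (tri i))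
  u₀₀≈one : u m 0 0 ≈ one
  u₀₀≈one = ≈-trans (*-identityʳ _) (≈-trans (*-identityʳ _)
              (≈-trans (q^-≡ (trans (ℕP.+-identityʳ (m * 0)) (ℕP.*-zeroʳ m))) q^-zero))

-- Both (q^(m+1);q)∞ W m and R m solve the recurrence of R with the same initial behaviour.
poch∞⊗W≈R : ∀ m → poch∞ (suc m) 1 ⊗ W m ≈ R m
poch∞⊗W≈R m = ⊖≈𝟘⇒≈ _ _ (recurrence-unique D A B D-recurrence D≈[]𝟘 m)
  where
  P : ℕ → FPS
  P m = poch∞ (suc m) 1
  A B D : ℕ → FPS
  A m = 1-q^ (suc m)
  B m = q^ (suc m) ⊗ 1-q^ (suc m) ⊗ 1-q^ (suc (suc m))
  D m = P m ⊗ W m ⊖ R m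
  D-recurrence : ∀ m → D m ≈ A m ⊗ D (suc m) ⊕ B m ⊗ D (suc (suc m))
  D-recurrence m = begin
    P m ⊗ W m ⊖ R m
      ≈⟨ +-cong (*-cong (≈-trans (poch∞-shift m) (⊗-congˡ (A m) (poch∞-shift (suc m)))) (W-recurrence m)) (-‿cong (R-recurrence m)) ⟩
    A m ⊗ (A (suc m) ⊗ P (suc (suc m))) ⊗ (W (suc m) ⊕ q^ (suc m) ⊗ W (suc (suc m)))
      ⊖ (A m ⊗ R (suc m) ⊕ q^ (suc m) ⊗ A m ⊗ A (suc m) ⊗ R (suc (suc m)))
      ≈⟨ regroup (A m) (A (suc m)) (P (suc (suc m))) (W (suc m)) (W (suc (suc m))) (q^ (suc m)) (R (suc m)) (R (suc (suc m))) ⟩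
    A m ⊗ (A (suc m) ⊗ P (suc (suc m)) ⊗ W (suc m) ⊖ R (suc m)) ⊕ B m ⊗ D (suc (suc m))
      ≈⟨ +-cong (⊗-congˡ (A m) (+-cong (⊗-congʳ (W (suc m)) (poch∞-shift (suc m))) (≈-refl {⊝ R (suc m)}))) (≈-refl {B m ⊗ D (suc (suc m))}) ⟨
    A m ⊗ D (suc m) ⊕ B m ⊗ D (suc (suc m)) ∎
    where
    open ≈-Reasoning
    regroup : ∀ a l p w₁ w₂ x r₁ r₂ → a ⊗ (l ⊗ p) ⊗ (w₁ ⊕ x ⊗ w₂) ⊖ (a ⊗ r₁ ⊕ x ⊗ a ⊗ l ⊗ r₂)
                                     ≈ a ⊗ (l ⊗ p ⊗ w₁ ⊖ r₁) ⊕ x ⊗ a ⊗ l ⊗ (p ⊗ w₂ ⊖ r₂)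
    regroup = solve 8 (λ a l p w₁ w₂ x r₁ r₂ → a :* (l :* p) :* (w₁ :+ x :* w₂) :- (a :* r₁ :+ x :* a :* l :* r₂)
                                               := a :* (l :* p :* w₁ :- r₁) :+ x :* a :* l :* (p :* w₂ :- r₂)) ≈-refl
  D≈[]𝟘 : ∀ m → D m ≈[ suc m ] 𝟘
  D≈[]𝟘 m = ≈[]-trans (⊕-cong[] (⊗-cong[] (poch∞≈[]one (suc m) 1) (W≈[]one m)) (⊝-cong[] (R≈[]one m)))
                      (≈⇒≈[] (≈-trans (+-congʳ (*-identityˡ one)) (-‿inverseʳ one)))

-- Euler's identity

eulerExp : ℕ → ℕ → ℕ → ℕ
eulerExp b c j = b * tri j + c * j

eulerTerm : ℕ → ℕ → ℕ → FPS
eulerTerm b c j = sign j ⊗ q^ eulerExp b c j ⊗ invPoch b b j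

eulerSum : ℕ → ℕ → FPS
eulerSum b c = Σ∞ (eulerTerm b c)

eulerTerm≈[]𝟘 : ∀ b c j → eulerTerm b c j ≈[ eulerExp b c j ] 𝟘
eulerTerm≈[]𝟘 b c j = ⊗-zeroˡ[] (invPoch b b j) (⊗q^≈[]𝟘 (eulerExp b c j) (sign j))

eulerTerm-summable : ∀ b c → Summable (eulerTerm b (suc c))
eulerTerm-summable b c j =
  ≈[]-weaken (ℕP.≤-trans (ℕP.m≤n*m j (suc c)) (ℕP.m≤n+m (suc c * j) (b * tri j))) (eulerTerm≈[]𝟘 b (suc c) j)

eulerΔ : ℕ → ℕ → ℕ → FPS
eulerΔ b c j = eulerTerm b c j ⊗ 1-q^ (b * j)

eulerTerm-telescopes : ∀ b c j → eulerTerm (suc b) c j ⊖ 1-q^ c ⊗ eulerTerm (suc b) (c + suc b) j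
                               ≈ eulerΔ (suc b) c j ⊖ eulerΔ (suc b) c (suc j)
eulerTerm-telescopes b′ c j = begin
  s ⊗ q^ E ⊗ I ⊖ 1-q^ c ⊗ (s ⊗ q^ eulerExp b (c + b) j ⊗ I)
    ≈⟨ +-cong (≈-refl {s ⊗ q^ E ⊗ I}) (-‿cong (⊗-congˡ (1-q^ c) (⊗-congʳ I (⊗-congˡ s (q^-split E (b * j) (exp-c+b b c j (tri j))))))) ⟩
  s ⊗ q^ E ⊗ I ⊖ 1-q^ c ⊗ (s ⊗ (q^ E ⊗ q^ (b * j)) ⊗ I)
    ≈⟨ regroup s (q^ E) I (q^ (b * j)) (q^ c) ⟩
  s ⊗ q^ E ⊗ I ⊗ 1-q^ (b * j) ⊖ ⊝ (s ⊗ Q ⊗ I)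
    ≈⟨ +-cong (≈-refl {eulerΔ b c j}) (-‿cong next) ⟨
  eulerΔ b c j ⊖ eulerΔ b c (suc j) ∎
  where
  open ≈-Reasoning
  b = suc b′
  s = sign j
  E = eulerExp b c j
  I = invPoch b b j
  Q = q^ E ⊗ q^ (b * j) ⊗ q^ c
  exp-c+b : ∀ b c j t → b * t + (c + b) * j ≡ b * t + c * j + b * j
  exp-c+b = solve-∀
  exp-j+1 : ∀ b c j t → b * (t + j) + c * suc j ≡ b * t + c * j + b * j + c
  exp-j+1 = solve-∀
  regroup : ∀ s x i y z → s ⊗ x ⊗ i ⊖ (one ⊖ z) ⊗ (s ⊗ (x ⊗ y) ⊗ i) ≈ s ⊗ x ⊗ i ⊗ (one ⊖ y) ⊖ ⊝ (s ⊗ (x ⊗ y ⊗ z) ⊗ i)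
  regroup = solve 5 (λ s x i y z → s :* x :* i :- (con 1ℤ :- z) :* (s :* (x :* y) :* i)
                                   := s :* x :* i :* (con 1ℤ :- y) :- :- (s :* (x :* y :* z) :* i)) ≈-refl
  next : eulerΔ b c (suc j) ≈ ⊝ (s ⊗ Q ⊗ I)
  next = begin
    ⊝ s ⊗ q^ eulerExp b c (suc j) ⊗ invPoch b b (suc j) ⊗ 1-q^ (b * suc j)
      ≈⟨ *-cong (⊗-congʳ (invPoch b b (suc j)) (⊗-congˡ (⊝ s)
                  (≈-trans (q^-split (E + b * j) c (exp-j+1 b c j (tri j))) (⊗-congʳ (q^ c) (q^-+ E (b * j))))))
                (1-q^-≡ (ℕP.*-suc b j)) ⟩
    ⊝ s ⊗ Q ⊗ invPoch b b (suc j) ⊗ 1-q^ (b + b * j)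
      ≈⟨ *-assoc (⊝ s ⊗ Q) (invPoch b b (suc j)) (1-q^ (b + b * j)) ⟩
    ⊝ s ⊗ Q ⊗ (invPoch b b (suc j) ⊗ 1-q^ (b + b * j))
      ≈⟨ ⊗-congˡ (⊝ s ⊗ Q) (≈-trans (*-comm (invPoch b b (suc j)) (1-q^ (b + b * j))) (invPoch-suc b′ b j)) ⟩
    ⊝ s ⊗ Q ⊗ I
      ≈⟨ negate-out s Q I ⟩
    ⊝ (s ⊗ Q ⊗ I) ∎
    where
    negate-out : ∀ s x i → ⊝ s ⊗ x ⊗ i ≈ ⊝ (s ⊗ x ⊗ i)
    negate-out = solve 3 (λ s x i → :- s :* x :* i := :- (s :* x :* i)) ≈-refl

eulerSum-recurrence : ∀ b c → eulerSum (suc b) (suc c) ≈ 1-q^ (suc c) ⊗ eulerSum (suc b) (suc c + suc b)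
eulerSum-recurrence b c =
  Σ∞-telescoping₁ (eulerΔ (suc b) (suc c)) (1-q^ (suc c)) (eulerTerm-summable (suc b) (c + suc b))
                  (λ j → ⊗-zeroˡ[] (1-q^ (suc b * j)) (eulerTerm-summable (suc b) c j)) Δ₀≈𝟘 (eulerTerm-telescopes b (suc c))
  where
  Δ₀≈𝟘 : eulerΔ (suc b) (suc c) 0 ≈ 𝟘
  Δ₀≈𝟘 = ≈-trans (⊗-congˡ (eulerTerm (suc b) (suc c) 0) (≈-trans (1-q^-≡ (ℕP.*-zeroʳ b)) 1-q^-zero))
                 (zeroʳ (eulerTerm (suc b) (suc c) 0))

eulerSum≈[]one : ∀ b c → eulerSum (suc b) (suc c) ≈[ suc c ] one
eulerSum≈[]one b c = ≈[]-trans (Σ∞-head[] (eulerTerm (suc b) (suc c)) λ j →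
                                 ≈[]-weaken (c<exp j (tri (suc j))) (eulerTerm≈[]𝟘 (suc b) (suc c) (suc j)))
                               (≈⇒≈[] term₀≈one)
  where
  c<exp : ∀ j t → suc c ≤ suc b * t + suc c * suc j
  c<exp j t = ℕP.≤-trans (ℕP.m≤m*n (suc c) (suc j)) (ℕP.m≤n+m (suc c * suc j) (suc b * t))
  term₀≈one : eulerTerm (suc b) (suc c) 0 ≈ one
  term₀≈one = ≈-trans (*-identityʳ _) (≈-trans (*-identityˡ _)
                (≈-trans (q^-≡ (exp₀ b c)) q^-zero))
    where
    exp₀ : ∀ b c → suc b * 0 + suc c * 0 ≡ 0
    exp₀ = solve-∀

euler : ∀ b c → eulerSum (suc b) (suc c) ≈ poch∞ (suc c) (suc b)
euler b c = subst (λ c′ → eulerSum (suc b) (suc c′) ≈ poch∞ (suc c′) (suc b)) c+b*0≡c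
                  (⊖≈𝟘⇒≈ _ _ (recurrence-unique D A (λ _ → 𝟘) D-recurrence D≈[]𝟘 0))
  where
  c+b*0≡c : c + suc b * 0 ≡ c
  c+b*0≡c = trans (cong (c +_) (ℕP.*-zeroʳ (suc b))) (ℕP.+-identityʳ c)
  cₖ : ℕ → ℕ
  cₖ k = c + suc b * k
  A D : ℕ → FPS
  A k = 1-q^ suc (cₖ k)
  D k = eulerSum (suc b) (suc (cₖ k)) ⊖ poch∞ (suc (cₖ k)) (suc b)
  cₖ₊₁ : ∀ b c k → suc (c + suc b * k) + suc b ≡ suc (c + suc b * suc k)
  cₖ₊₁ = solve-∀
  D-recurrence : ∀ k → D k ≈ A k ⊗ D (suc k) ⊕ 𝟘 ⊗ D (suc (suc k))
  D-recurrence k = begin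
    eulerSum (suc b) (suc (cₖ k)) ⊖ poch∞ (suc (cₖ k)) (suc b)
      ≈⟨ +-cong (eulerSum-recurrence b (cₖ k)) (-‿cong (poch∞-suc (cₖ k) b)) ⟩
    A k ⊗ eulerSum (suc b) (suc (cₖ k) + suc b) ⊖ A k ⊗ poch∞ (suc (cₖ k) + suc b) (suc b)
      ≈⟨ ≈-reflexive (cong (λ c′ → A k ⊗ eulerSum (suc b) c′ ⊖ A k ⊗ poch∞ c′ (suc b)) (cₖ₊₁ b c k)) ⟩
    A k ⊗ eulerSum (suc b) (suc (cₖ (suc k))) ⊖ A k ⊗ poch∞ (suc (cₖ (suc k))) (suc b)
      ≈⟨ factor (A k) (eulerSum (suc b) (suc (cₖ (suc k)))) (poch∞ (suc (cₖ (suc k))) (suc b)) (D (suc (suc k))) ⟩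
    A k ⊗ D (suc k) ⊕ 𝟘 ⊗ D (suc (suc k)) ∎
    where
    open ≈-Reasoning
    factor : ∀ a e p d → a ⊗ e ⊖ a ⊗ p ≈ a ⊗ (e ⊖ p) ⊕ 𝟘 ⊗ d
    factor = solve 4 (λ a e p d → a :* e :- a :* p := a :* (e :- p) :+ con 0ℤ :* d) ≈-refl
  D≈[]𝟘 : ∀ k → D k ≈[ suc k ] 𝟘
  D≈[]𝟘 k = ≈[]-trans (⊕-cong[] (≈[]-weaken k<cₖ (eulerSum≈[]one b (cₖ k))) (⊝-cong[] (≈[]-weaken k<cₖ (poch∞≈[]one (suc (cₖ k)) (suc b)))))
                      (≈⇒≈[] (-‿inverseʳ one))
    where
    k<cₖ : suc k ≤ suc (cₖ k)
    k<cₖ = s≤s (ℕP.≤-trans (ℕP.m≤n*m k (suc b)) (ℕP.m≤n+m (suc b * k) c))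

-- Jacobi's triple product

-- θ(a, c) = Σ_{k ∈ ℤ} (-1)ᵏ q^((a+c) k(k-1)/2 + a k), folding k = -(t+1) onto t ≥ 0.
thetaTerm : ℕ → ℕ → ℕ → FPS
thetaTerm a c t = sign t ⊗ (q^ ((a + c) * tri t + a * t) ⊖ q^ ((a + c) * tri (suc t) + c * suc t))

theta : ℕ → ℕ → FPS
theta a c = Σ∞ (thetaTerm a c)

-- shiftedSum n, the theta series shifted by n and weighted by 1/(q^b;q^b)ⱼ, equals
-- q^n (q^a;q^b)ₙ (q^c;q^b)∞: Euler's identity for n = 0, then a recurrence in n.
-- Multiplied by (q^b;q^b)∞ it agrees with q^n θ(a, c) modulo q^(2n); let n grow.
module JacobiTripleProduct (a′ c′ : ℕ) where
  a c b′ b : ℕ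
  a = suc a′
  c = suc c′
  b′ = a′ + suc c′
  b = suc b′

  -- thetaExp n j is the exponent of θ at index k = j - n.
  thetaExp : ℕ → ℕ → ℕ
  thetaExp zero    j       = b * tri j + c * j
  thetaExp (suc n) zero    = b * tri (suc n) + a * suc n
  thetaExp (suc n) (suc j) = thetaExp n j

  thetaExp-n0 : ∀ n → thetaExp n 0 ≡ b * tri n + a * n
  thetaExp-n0 zero    = cong (b * 0 +_) (trans (ℕP.*-zeroʳ c) (sym (ℕP.*-zeroʳ a)))
  thetaExp-n0 (suc n) = refl

  thetaExp-step : ∀ n j → thetaExp (suc n) j + b * j ≡ thetaExp n j + (a + b * n)
  thetaExp-step n zero = trans (lemma a′ c′ n (tri n)) (cong (_+ (a + b * n)) (sym (thetaExp-n0 n)))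
    where
    lemma : ∀ a′ c′ n t → (suc a′ + suc c′) * (t + n) + suc a′ * suc n + (suc a′ + suc c′) * 0
                        ≡ (suc a′ + suc c′) * t + suc a′ * n + (suc a′ + (suc a′ + suc c′) * n)
    lemma = solve-∀
  thetaExp-step zero (suc j) = lemma a′ c′ j (tri j)
    where
    lemma : ∀ a′ c′ j t → (suc a′ + suc c′) * t + suc c′ * j + (suc a′ + suc c′) * suc j
                        ≡ (suc a′ + suc c′) * (t + j) + suc c′ * suc j + (suc a′ + (suc a′ + suc c′) * 0)
    lemma = solve-∀
  thetaExp-step (suc n) (suc j) = begin
    thetaExp (suc n) j + b * suc j        ≡⟨ cong (thetaExp (suc n) j +_) (ℕP.*-suc b j) ⟩
    thetaExp (suc n) j + (b + b * j)      ≡⟨ lemma (thetaExp (suc n) j) b (b * j) ⟩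
    thetaExp (suc n) j + b * j + b        ≡⟨ cong (_+ b) (thetaExp-step n j) ⟩
    thetaExp n j + (a + b * n) + b        ≡⟨ lemma′ (thetaExp n j) a b (b * n) ⟩
    thetaExp n j + (a + (b + b * n))      ≡⟨ cong (λ e → thetaExp n j + (a + e)) (ℕP.*-suc b n) ⟨
    thetaExp n j + (a + b * suc n)        ∎
    where
    open ≡-Reasoning
    lemma : ∀ x y z → x + (y + z) ≡ x + z + y
    lemma = solve-∀
    lemma′ : ∀ e a b z → e + (a + z) + b ≡ e + (a + (b + z))
    lemma′ = solve-∀

  j≤n+thetaExp : ∀ n j → j ≤ n + thetaExp n j
  j≤n+thetaExp zero    j       = ℕP.≤-trans (ℕP.m≤n*m j c) (ℕP.m≤n+m (c * j) (b * tri j))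
  j≤n+thetaExp (suc n) zero    = z≤n
  j≤n+thetaExp (suc n) (suc j) = s≤s (j≤n+thetaExp n j)

  n≤thetaExp+j : ∀ n j → n ≤ thetaExp n j + j
  n≤thetaExp+j zero    j       = z≤n
  n≤thetaExp+j (suc n) zero    = ℕP.≤-trans (ℕP.≤-trans (ℕP.m≤n*m (suc n) a) (ℕP.m≤n+m _ _)) (ℕP.m≤m+n _ 0)
  n≤thetaExp+j (suc n) (suc j) = subst (suc n ≤_) (sym (ℕP.+-suc (thetaExp n j) j)) (s≤s (n≤thetaExp+j n j))

  shiftedTerm : ℕ → ℕ → FPS
  shiftedTerm n j = sign (n + j) ⊗ q^ thetaExp n j ⊗ invPoch b b j

  shiftedSum : ℕ → FPS
  shiftedSum n = Σ∞ λ j → q^ n ⊗ shiftedTerm n j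

  shiftedTerm≈[]𝟘 : ∀ n j → shiftedTerm n j ≈[ thetaExp n j ] 𝟘
  shiftedTerm≈[]𝟘 n j = ⊗-zeroˡ[] (invPoch b b j) (⊗q^≈[]𝟘 (thetaExp n j) (sign (n + j)))

  shiftedSum-summable : ∀ n → Summable (λ j → q^ n ⊗ shiftedTerm n j)
  shiftedSum-summable n j = ≈[]-weaken (j≤n+thetaExp n j) (q^⊗≈[+]𝟘 n (shiftedTerm n j) (shiftedTerm≈[]𝟘 n j))

  shiftedTerm-telescopes : ∀ n j → shiftedTerm (suc n) j ⊖ 1-q^ (a + b * n) ⊗ shiftedTerm n j
                                 ≈ shiftedTerm (suc n) j ⊗ 1-q^ (b * j) ⊖ shiftedTerm (suc n) (suc j) ⊗ 1-q^ (b * suc j)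
  shiftedTerm-telescopes n j = begin
    T₁ ⊖ (one ⊖ q^ (a + b * n)) ⊗ T₀
      ≈⟨ regroup T₁ T₀ (q^ (a + b * n)) (q^ (b * j)) ⟩
    (T₁ ⊗ 1-q^ (b * j) ⊖ T₀) ⊕ (T₁ ⊗ q^ (b * j) ⊕ q^ (a + b * n) ⊗ T₀)
      ≈⟨ +-cong (+-cong (≈-refl {T₁ ⊗ 1-q^ (b * j)}) (-‿cong (≈-sym next))) cancels ⟩
    (T₁ ⊗ 1-q^ (b * j) ⊖ shiftedTerm (suc n) (suc j) ⊗ 1-q^ (b * suc j)) ⊕ 𝟘
      ≈⟨ +-identityʳ _ ⟩
    T₁ ⊗ 1-q^ (b * j) ⊖ shiftedTerm (suc n) (suc j) ⊗ 1-q^ (b * suc j) ∎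
    where
    open ≈-Reasoning
    T₀ = shiftedTerm n j
    T₁ = shiftedTerm (suc n) j
    s = sign (n + j)
    I = invPoch b b j
    regroup : ∀ t₁ t₀ x y → t₁ ⊖ (one ⊖ x) ⊗ t₀ ≈ (t₁ ⊗ (one ⊖ y) ⊖ t₀) ⊕ (t₁ ⊗ y ⊕ x ⊗ t₀)
    regroup = solve 4 (λ t₁ t₀ x y → t₁ :- (con 1ℤ :- x) :* t₀ := (t₁ :* (con 1ℤ :- y) :- t₀) :+ (t₁ :* y :+ x :* t₀)) ≈-refl
    next : shiftedTerm (suc n) (suc j) ⊗ 1-q^ (b * suc j) ≈ T₀
    next = begin
      sign (suc n + suc j) ⊗ q^ thetaExp n j ⊗ invPoch b b (suc j) ⊗ 1-q^ (b * suc j)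
        ≈⟨ ⊗-congˡ (sign (suc n + suc j) ⊗ q^ thetaExp n j ⊗ invPoch b b (suc j)) (1-q^-≡ (ℕP.*-suc b j)) ⟩
      sign (suc n + suc j) ⊗ q^ thetaExp n j ⊗ invPoch b b (suc j) ⊗ 1-q^ (b + b * j)
        ≈⟨ regroup′ (sign (suc n + suc j) ⊗ q^ thetaExp n j) (invPoch b b (suc j)) (1-q^ (b + b * j)) ⟩
      sign (suc n + suc j) ⊗ q^ thetaExp n j ⊗ (1-q^ (b + b * j) ⊗ invPoch b b (suc j))
        ≈⟨ *-cong (⊗-congʳ (q^ thetaExp n j) (sign-suc-suc n j)) (invPoch-suc b′ b j) ⟩
      T₀ ∎
      where
      regroup′ : ∀ x i l → x ⊗ i ⊗ l ≈ x ⊗ (l ⊗ i)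
      regroup′ = solve 3 (λ x i l → x :* i :* l := x :* (l :* i)) ≈-refl
    cancels : T₁ ⊗ q^ (b * j) ⊕ q^ (a + b * n) ⊗ T₀ ≈ 𝟘
    cancels = begin
      ⊝ s ⊗ q^ thetaExp (suc n) j ⊗ I ⊗ q^ (b * j) ⊕ q^ (a + b * n) ⊗ (s ⊗ q^ thetaExp n j ⊗ I)
        ≈⟨ regroup″ s (q^ thetaExp (suc n) j) (q^ (b * j)) (q^ (a + b * n)) (q^ thetaExp n j) I ⟩
      ⊝ (s ⊗ (q^ thetaExp (suc n) j ⊗ q^ (b * j)) ⊗ I) ⊕ s ⊗ (q^ thetaExp n j ⊗ q^ (a + b * n)) ⊗ I
        ≈⟨ +-cong (-‿cong (⊗-congʳ I (⊗-congˡ s exponents))) (≈-refl {s ⊗ (q^ thetaExp n j ⊗ q^ (a + b * n)) ⊗ I}) ⟩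
      ⊝ (s ⊗ (q^ thetaExp n j ⊗ q^ (a + b * n)) ⊗ I) ⊕ s ⊗ (q^ thetaExp n j ⊗ q^ (a + b * n)) ⊗ I
        ≈⟨ coeffwise (λ k → ℤP.+-inverseˡ ((s ⊗ (q^ thetaExp n j ⊗ q^ (a + b * n)) ⊗ I) k)) ⟩
      𝟘 ∎
      where
      regroup″ : ∀ s e y x e′ i → ⊝ s ⊗ e ⊗ i ⊗ y ⊕ x ⊗ (s ⊗ e′ ⊗ i) ≈ ⊝ (s ⊗ (e ⊗ y) ⊗ i) ⊕ s ⊗ (e′ ⊗ x) ⊗ i
      regroup″ = solve 6 (λ s e y x e′ i → :- s :* e :* i :* y :+ x :* (s :* e′ :* i) := :- (s :* (e :* y) :* i) :+ s :* (e′ :* x) :* i) ≈-refl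
      exponents : q^ thetaExp (suc n) j ⊗ q^ (b * j) ≈ q^ thetaExp n j ⊗ q^ (a + b * n)
      exponents = ≈-trans (≈-sym (q^-+ (thetaExp (suc n) j) (b * j)))
                          (≈-trans (q^-≡ (thetaExp-step n j)) (q^-+ (thetaExp n j) (a + b * n)))

  shiftedSum-recurrence : ∀ n → shiftedSum (suc n) ≈ q^ 1 ⊗ 1-q^ (a + b * n) ⊗ shiftedSum n
  shiftedSum-recurrence n =
    Σ∞-telescoping₁ Δ (q^ 1 ⊗ 1-q^ (a + b * n)) (shiftedSum-summable n) Δ-summable Δ₀≈𝟘 step
    where
    Δ : ℕ → FPS
    Δ j = q^ (suc n) ⊗ (shiftedTerm (suc n) j ⊗ 1-q^ (b * j))
    Δ-summable : Summable Δ
    Δ-summable j = ≈[]-weaken (j≤n+thetaExp (suc n) j)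
      (q^⊗≈[+]𝟘 (suc n) _ (⊗-zeroˡ[] (1-q^ (b * j)) (shiftedTerm≈[]𝟘 (suc n) j)))
    Δ₀≈𝟘 : Δ 0 ≈ 𝟘
    Δ₀≈𝟘 = ≈-trans (⊗-congˡ (q^ (suc n)) (≈-trans (⊗-congˡ (shiftedTerm (suc n) 0) (≈-trans (1-q^-≡ (ℕP.*-zeroʳ b)) 1-q^-zero))
                                                   (zeroʳ (shiftedTerm (suc n) 0))))
                   (zeroʳ (q^ (suc n)))
    step : ∀ j → q^ (suc n) ⊗ shiftedTerm (suc n) j ⊖ q^ 1 ⊗ 1-q^ (a + b * n) ⊗ (q^ n ⊗ shiftedTerm n j) ≈ Δ j ⊖ Δ (suc j)
    step j = begin
      q^ (suc n) ⊗ T₁ ⊖ q^ 1 ⊗ L ⊗ (q^ n ⊗ T₀)   ≈⟨ regroup (q^ (suc n)) (q^ 1) (q^ n) L T₁ T₀ ⟩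
      q^ (suc n) ⊗ T₁ ⊖ q^ 1 ⊗ q^ n ⊗ (L ⊗ T₀)   ≈⟨ +-cong (≈-refl {q^ (suc n) ⊗ T₁}) (-‿cong (⊗-congʳ (L ⊗ T₀) (q^-suc n))) ⟨
      q^ (suc n) ⊗ T₁ ⊖ q^ (suc n) ⊗ (L ⊗ T₀)    ≈⟨ factor (q^ (suc n)) T₁ (L ⊗ T₀) ⟩
      q^ (suc n) ⊗ (T₁ ⊖ L ⊗ T₀)                 ≈⟨ ⊗-congˡ (q^ (suc n)) (shiftedTerm-telescopes n j) ⟩
      q^ (suc n) ⊗ (T₁ ⊗ 1-q^ (b * j) ⊖ shiftedTerm (suc n) (suc j) ⊗ 1-q^ (b * suc j))
                                                 ≈⟨ factor (q^ (suc n)) (T₁ ⊗ 1-q^ (b * j)) (shiftedTerm (suc n) (suc j) ⊗ 1-q^ (b * suc j)) ⟨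
      Δ j ⊖ Δ (suc j)                            ∎
      where
      open ≈-Reasoning
      L = 1-q^ (a + b * n)
      T₀ = shiftedTerm n j
      T₁ = shiftedTerm (suc n) j
      regroup : ∀ x′ x₁ xₙ l t₁ t₀ → x′ ⊗ t₁ ⊖ x₁ ⊗ l ⊗ (xₙ ⊗ t₀) ≈ x′ ⊗ t₁ ⊖ x₁ ⊗ xₙ ⊗ (l ⊗ t₀)
      regroup = solve 6 (λ x′ x₁ xₙ l t₁ t₀ → x′ :* t₁ :- x₁ :* l :* (xₙ :* t₀) := x′ :* t₁ :- x₁ :* xₙ :* (l :* t₀)) ≈-refl
      factor : ∀ x u v → x ⊗ u ⊖ x ⊗ v ≈ x ⊗ (u ⊖ v)
      factor = solve 3 (λ x u v → x :* u :- x :* v := x :* (u :- v)) ≈-refl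

  shiftedSum-closed : ∀ n → shiftedSum n ≈ q^ n ⊗ (poch a b n ⊗ poch∞ c b)
  shiftedSum-closed zero = begin
    shiftedSum 0        ≈⟨ Σ∞-cong (λ j → ≈-trans (⊗-congʳ (shiftedTerm 0 j) q^-zero) (*-identityˡ (shiftedTerm 0 j))) ⟩
    eulerSum b c        ≈⟨ euler b′ c′ ⟩
    poch∞ c b           ≈⟨ ≈-trans (⊗-congʳ (one ⊗ poch∞ c b) q^-zero) (≈-trans (*-identityˡ _) (*-identityˡ _)) ⟨
    q^ 0 ⊗ (one ⊗ poch∞ c b) ∎
    where open ≈-Reasoning
  shiftedSum-closed (suc n) = begin
    shiftedSum (suc n)                          ≈⟨ shiftedSum-recurrence n ⟩
    q^ 1 ⊗ L ⊗ shiftedSum n                     ≈⟨ ⊗-congˡ (q^ 1 ⊗ L) (shiftedSum-closed n) ⟩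
    q^ 1 ⊗ L ⊗ (q^ n ⊗ (poch a b n ⊗ poch∞ c b)) ≈⟨ regroup (q^ 1) L (q^ n) (poch a b n) (poch∞ c b) ⟩
    q^ 1 ⊗ q^ n ⊗ (poch a b n ⊗ L ⊗ poch∞ c b)   ≈⟨ ⊗-congʳ (poch a b (suc n) ⊗ poch∞ c b) (q^-suc n) ⟨
    q^ (suc n) ⊗ (poch a b (suc n) ⊗ poch∞ c b)  ∎
    where
    open ≈-Reasoning
    L = 1-q^ (a + b * n)
    regroup : ∀ x₁ l xₙ p r → x₁ ⊗ l ⊗ (xₙ ⊗ (p ⊗ r)) ≈ x₁ ⊗ xₙ ⊗ (p ⊗ l ⊗ r)
    regroup = solve 5 (λ x₁ l xₙ p r → x₁ :* l :* (xₙ :* (p :* r)) := x₁ :* xₙ :* (p :* l :* r)) ≈-refl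

  poch∞⊗invPoch≈[]one : ∀ j → poch∞ b b ⊗ invPoch b b j ≈[ b + b * j ] one
  poch∞⊗invPoch≈[]one j =
    ≈[]-trans (⊗-cong[] (Π∞≈[]Π<-from _ (poch-factors-converge b′ b′) j later-factors≈one) (≈[]-refl {a = invPoch b b j}))
              (≈⇒≈[] (poch-inverse b′ b j))
    where
    later-factors≈one : ∀ k → j ≤ k → 1-q^ (b + b * k) ≈[ b + b * j ] one
    later-factors≈one k j≤k = ≈[]-weaken (ℕP.+-monoʳ-≤ b (ℕP.*-monoʳ-≤ b j≤k)) (1-q^≈[]one (b + b * k))

  thetaPartial : ℕ → FPS
  thetaPartial n = Σ∞ λ j → q^ n ⊗ (sign (n + j) ⊗ q^ thetaExp n j)

  thetaPartial-summable : ∀ n → Summable (λ j → q^ n ⊗ (sign (n + j) ⊗ q^ thetaExp n j))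
  thetaPartial-summable n j = ≈[]-weaken (j≤n+thetaExp n j) (q^⊗≈[+]𝟘 n _ (⊗q^≈[]𝟘 (thetaExp n j) (sign (n + j))))

  -- Modulo q^(2K), multiplying by (q^b;q^b)∞ clears all the denominators (q^b;q^b)ⱼ.
  poch∞⊗shiftedSum≈[] : ∀ K → poch∞ b b ⊗ shiftedSum K ≈[ K + K ] thetaPartial K
  poch∞⊗shiftedSum≈[] K = ≈[]-trans (≈⇒≈[] (≈-sym (Σ∞-⊗ (poch∞ b b) (shiftedSum-summable K)))) (Σ∞-cong[] termwise)
    where
    termwise : ∀ j → poch∞ b b ⊗ (q^ K ⊗ shiftedTerm K j) ≈[ K + K ] q^ K ⊗ (sign (K + j) ⊗ q^ thetaExp K j)
    termwise j = ≈[]-trans (≈⇒≈[] (regroup (poch∞ b b) (q^ K) s (q^ thetaExp K j) (invPoch b b j)))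
      (≈[]-weaken (ℕP.+-monoʳ-≤ K K≤exponent) (q^⊗-cong[] K _
        (≈[]-trans (⊗-cong[] (≈[]-refl {a = s}) (q^⊗-cong[] (thetaExp K j) _ (poch∞⊗invPoch≈[]one j)))
                   (≈⇒≈[] (⊗-congˡ s (*-identityʳ (q^ thetaExp K j)))))))
      where
      s = sign (K + j)
      regroup : ∀ p x s e i → p ⊗ (x ⊗ (s ⊗ e ⊗ i)) ≈ x ⊗ (s ⊗ (e ⊗ (p ⊗ i)))
      regroup = solve 5 (λ p x s e i → p :* (x :* (s :* e :* i)) := x :* (s :* (e :* (p :* i)))) ≈-refl
      K≤exponent : K ≤ thetaExp K j + (b + b * j)
      K≤exponent = ℕP.≤-trans (n≤thetaExp+j K j) (ℕP.+-monoʳ-≤ (thetaExp K j) (ℕP.≤-trans (ℕP.m≤n*m j b) (ℕP.m≤n+m _ b)))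

  U : ℕ → FPS
  U t = sign t ⊗ q^ thetaExp t 0

  U-summable : Summable U
  U-summable k = ≈[]-weaken (subst (k ≤_) (ℕP.+-identityʳ (thetaExp k 0)) (n≤thetaExp+j k 0)) (⊗q^≈[]𝟘 (thetaExp k 0) (sign k))

  U₀≈one : U 0 ≈ one
  U₀≈one = ≈-trans (⊗-congˡ one (≈-trans (q^-≡ (cong₂ _+_ (ℕP.*-zeroʳ b) (ℕP.*-zeroʳ c))) q^-zero)) (*-identityʳ one)

  thetaPartial-suc : ∀ n → thetaPartial (suc n) ≈ q^ (suc n) ⊗ U (suc n) ⊕ q^ 1 ⊗ thetaPartial n
  thetaPartial-suc n = ≈-trans (Σ∞-suc _ (thetaPartial-summable (suc n)))
    (+-cong head (≈-trans (Σ∞-cong tail) (Σ∞-⊗ (q^ 1) (thetaPartial-summable n))))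
    where
    head : q^ (suc n) ⊗ (sign (suc n + 0) ⊗ q^ thetaExp (suc n) 0) ≈ q^ (suc n) ⊗ U (suc n)
    head = ≈-reflexive (cong (λ k → q^ (suc n) ⊗ (sign k ⊗ q^ thetaExp (suc n) 0)) (ℕP.+-identityʳ (suc n)))
    tail : ∀ j → q^ (suc n) ⊗ (sign (suc n + suc j) ⊗ q^ thetaExp n j) ≈ q^ 1 ⊗ (q^ n ⊗ (sign (n + j) ⊗ q^ thetaExp n j))
    tail j = ≈-trans (*-cong (q^-suc n) (⊗-congʳ (q^ thetaExp n j) (sign-suc-suc n j)))
                     (*-assoc (q^ 1) (q^ n) (sign (n + j) ⊗ q^ thetaExp n j))

  thetaPartial-closed : ∀ n → thetaPartial n ≈ q^ n ⊗ (thetaPartial 0 ⊖ one ⊕ Σ< (suc n) U)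
  thetaPartial-closed zero = ≈-sym (begin
    q^ 0 ⊗ (thetaPartial 0 ⊖ one ⊕ (𝟘 ⊕ U 0))   ≈⟨ *-cong q^-zero (+-cong (≈-refl {thetaPartial 0 ⊖ one}) (≈-trans (+-identityˡ (U 0)) U₀≈one)) ⟩
    one ⊗ (thetaPartial 0 ⊖ one ⊕ one)         ≈⟨ cancel (thetaPartial 0) ⟩
    thetaPartial 0                             ∎)
    where
    open ≈-Reasoning
    cancel : ∀ v → one ⊗ (v ⊖ one ⊕ one) ≈ v
    cancel = solve 1 (λ v → con 1ℤ :* (v :- con 1ℤ :+ con 1ℤ) := v) ≈-refl
  thetaPartial-closed (suc n) = begin
    thetaPartial (suc n)
      ≈⟨ thetaPartial-suc n ⟩
    q^ (suc n) ⊗ U (suc n) ⊕ q^ 1 ⊗ thetaPartial n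
      ≈⟨ +-cong (⊗-congʳ (U (suc n)) (q^-suc n)) (⊗-congˡ (q^ 1) (thetaPartial-closed n)) ⟩
    q^ 1 ⊗ q^ n ⊗ U (suc n) ⊕ q^ 1 ⊗ (q^ n ⊗ (Z ⊕ Σ< (suc n) U))
      ≈⟨ regroup (q^ 1) (q^ n) (U (suc n)) Z (Σ< (suc n) U) ⟩
    q^ 1 ⊗ q^ n ⊗ (Z ⊕ (Σ< (suc n) U ⊕ U (suc n)))
      ≈⟨ ⊗-congʳ (Z ⊕ Σ< (suc (suc n)) U) (q^-suc n) ⟨
    q^ (suc n) ⊗ (Z ⊕ Σ< (suc (suc n)) U) ∎
    where
    open ≈-Reasoning
    Z = thetaPartial 0 ⊖ one
    regroup : ∀ x₁ xₙ u z f → x₁ ⊗ xₙ ⊗ u ⊕ x₁ ⊗ (xₙ ⊗ (z ⊕ f)) ≈ x₁ ⊗ xₙ ⊗ (z ⊕ (f ⊕ u))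
    regroup = solve 5 (λ x₁ xₙ u z f → x₁ :* xₙ :* u :+ x₁ :* (xₙ :* (z :+ f)) := x₁ :* xₙ :* (z :+ (f :+ u))) ≈-refl

  theta≈thetaPartial : theta a c ≈ thetaPartial 0 ⊖ one ⊕ Σ∞ U
  theta≈thetaPartial = begin
    theta a c
      ≈⟨ Σ∞-cong (λ t → distrib-⊖ (sign t) (q^ ((a + c) * tri t + a * t)) (q^ thetaExp 0 (suc t))) ⟩
    Σ∞ (λ t → sign t ⊗ q^ ((a + c) * tri t + a * t) ⊕ ⊝ (sign t ⊗ q^ thetaExp 0 (suc t)))
      ≈⟨ Σ∞-cong (λ t → +-cong (⊗-congˡ (sign t) (q^-≡ (sym (thetaExp-n0 t)))) (≈-refl {⊝ (sign t ⊗ q^ thetaExp 0 (suc t))})) ⟩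
    Σ∞ (λ t → U t ⊕ ⊝ (sign t ⊗ q^ thetaExp 0 (suc t)))
      ≈⟨ Σ∞-⊕ U (λ t → ⊝ (sign t ⊗ q^ thetaExp 0 (suc t))) ⟩
    Σ∞ U ⊕ N
      ≈⟨ regroup (Σ∞ U) N ⟩
    one ⊕ N ⊖ one ⊕ Σ∞ U
      ≈⟨ +-cong (+-cong thetaPartial₀ (≈-refl {⊝ one})) (≈-refl {Σ∞ U}) ⟨
    thetaPartial 0 ⊖ one ⊕ Σ∞ U ∎
    where
    open ≈-Reasoning
    N = Σ∞ λ t → ⊝ (sign t ⊗ q^ thetaExp 0 (suc t))
    distrib-⊖ : ∀ s x y → s ⊗ (x ⊖ y) ≈ s ⊗ x ⊕ ⊝ (s ⊗ y)
    distrib-⊖ = solve 3 (λ s x y → s :* (x :- y) := s :* x :- s :* y) ≈-refl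
    regroup : ∀ u n → u ⊕ n ≈ one ⊕ n ⊖ one ⊕ u
    regroup = solve 2 (λ u n → u :+ n := con 1ℤ :+ n :- con 1ℤ :+ u) ≈-refl
    thetaPartial₀ : thetaPartial 0 ≈ one ⊕ N
    thetaPartial₀ = ≈-trans (Σ∞-suc _ (thetaPartial-summable 0))
      (+-cong (≈-trans (*-identityˡ′ (U 0)) U₀≈one)
              (Σ∞-cong λ t → ≈-trans (*-identityˡ′ (sign (suc t) ⊗ q^ thetaExp 0 (suc t))) (negate-out (sign t) (q^ thetaExp 0 (suc t)))))
      where
      *-identityˡ′ : ∀ x → q^ 0 ⊗ x ≈ x
      *-identityˡ′ x = ≈-trans (⊗-congʳ x q^-zero) (*-identityˡ x)
      negate-out : ∀ s x → ⊝ s ⊗ x ≈ ⊝ (s ⊗ x)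
      negate-out = solve 2 (λ s x → :- s :* x := :- (s :* x)) ≈-refl

  jacobi-triple-product : theta a c ≈ poch∞ b b ⊗ (poch∞ a b ⊗ poch∞ c b)
  jacobi-triple-product = ≈-sym (≈[]⇒≈ λ K → q^⊗-cancel[] K K (agree K))
    where
    Z = thetaPartial 0 ⊖ one
    regroup : ∀ x p r s → x ⊗ (p ⊗ (r ⊗ s)) ≈ p ⊗ (x ⊗ (r ⊗ s))
    regroup = solve 4 (λ x p r s → x :* (p :* (r :* s)) := p :* (x :* (r :* s))) ≈-refl
    agree : ∀ K → q^ K ⊗ (poch∞ b b ⊗ (poch∞ a b ⊗ poch∞ c b)) ≈[ K + K ] q^ K ⊗ theta a c
    agree K = begin
      q^ K ⊗ (poch∞ b b ⊗ (poch∞ a b ⊗ poch∞ c b))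
        ≈⟨ q^⊗-cong[] K K (⊗-cong[] (≈[]-refl {a = poch∞ b b}) (⊗-cong[] (poch∞≈[]poch a′ b′ K) (≈[]-refl {a = poch∞ c b}))) ⟩
      q^ K ⊗ (poch∞ b b ⊗ (poch a b K ⊗ poch∞ c b))
        ≈⟨ ≈⇒≈[] (regroup (q^ K) (poch∞ b b) (poch a b K) (poch∞ c b)) ⟩
      poch∞ b b ⊗ (q^ K ⊗ (poch a b K ⊗ poch∞ c b))
        ≈⟨ ≈⇒≈[] (⊗-congˡ (poch∞ b b) (shiftedSum-closed K)) ⟨
      poch∞ b b ⊗ shiftedSum K
        ≈⟨ poch∞⊗shiftedSum≈[] K ⟩
      thetaPartial K
        ≈⟨ ≈⇒≈[] (thetaPartial-closed K) ⟩
      q^ K ⊗ (Z ⊕ Σ< (suc K) U)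
        ≈⟨ q^⊗-cong[] K K (⊕-cong[] (≈[]-refl {a = Z}) (≈[]-weaken (ℕP.n≤1+n K) (Σ∞≈[]Σ< U-summable (suc K)))) ⟨
      q^ K ⊗ (Z ⊕ Σ∞ U)
        ≈⟨ ≈⇒≈[] (⊗-congˡ (q^ K) theta≈thetaPartial) ⟨
      q^ K ⊗ theta a c ∎
      where open ≈[]-Reasoning (K + K)

-- The two identities

2*tri : ∀ k → 2 * tri k + k ≡ k * k
2*tri zero    = refl
2*tri (suc k) = begin
  2 * (tri k + k) + suc k        ≡⟨ lemma k (tri k) ⟩
  2 * tri k + k + 2 * k + 1      ≡⟨ cong (λ x → x + 2 * k + 1) (2*tri k) ⟩
  k * k + 2 * k + 1              ≡⟨ lemma′ k ⟩
  suc k * suc k                  ∎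
  where
  open ≡-Reasoning
  lemma : ∀ k t → 2 * (t + k) + suc k ≡ 2 * t + k + 2 * k + 1
  lemma = solve-∀
  lemma′ : ∀ k → k * k + 2 * k + 1 ≡ suc k * suc k
  lemma′ = solve-∀

pentagonal₁ : ∀ i → i * (3 * i ∸ 1) / 2 ≡ i * i + tri i
pentagonal₁ i = trans (cong (_/ 2) (doubled i)) (m*n/n≡m (i * i + tri i) 2)
  where
  doubled : ∀ i → i * (3 * i ∸ 1) ≡ (i * i + tri i) * 2
  doubled zero    = refl
  doubled (suc k) = ℕP.+-cancelʳ-≡ k _ _ (begin
    suc k * (k + (suc k + (suc k + 0))) + k           ≡⟨ lemma k ⟩
    2 * suc k * suc k + 2 * k + k * k                 ≡⟨ cong (2 * suc k * suc k + 2 * k +_) (2*tri k) ⟨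
    2 * suc k * suc k + 2 * k + (2 * tri k + k)       ≡⟨ lemma′ k (tri k) ⟩
    (suc k * suc k + (tri k + k)) * 2 + k             ∎)
    where
    open ≡-Reasoning
    lemma : ∀ k → suc k * (k + (suc k + (suc k + 0))) + k ≡ 2 * suc k * suc k + 2 * k + k * k
    lemma = solve-∀
    lemma′ : ∀ k t → 2 * suc k * suc k + 2 * k + (2 * t + k) ≡ (suc k * suc k + (t + k)) * 2 + k
    lemma′ = solve-∀

pentagonal₂ : ∀ i → i * (3 * i + 1) / 2 ≡ i * i + tri i + i
pentagonal₂ i = trans (cong (_/ 2) doubled) (m*n/n≡m (i * i + tri i + i) 2)
  where
  open ≡-Reasoning
  lemma : ∀ i → i * (3 * i + 1) ≡ 2 * i * i + i * i + i
  lemma = solve-∀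
  lemma′ : ∀ i t → 2 * i * i + (2 * t + i) + i ≡ (i * i + t + i) * 2
  lemma′ = solve-∀
  doubled : i * (3 * i + 1) ≡ (i * i + tri i + i) * 2
  doubled = begin
    i * (3 * i + 1)                   ≡⟨ lemma i ⟩
    2 * i * i + i * i + i             ≡⟨ cong (λ x → 2 * i * i + x + i) (2*tri i) ⟨
    2 * i * i + (2 * tri i + i) + i   ≡⟨ lemma′ i (tri i) ⟩
    (i * i + tri i + i) * 2           ∎

exp₁≡doubleExp : ∀ i j → exp₁ i j ≡ doubleExp 0 i j
exp₁≡doubleExp i j = trans (cong (λ x → x + 4 * i * j + 4 * j * j) (pentagonal₁ i)) (lemma i j (tri i))
  where
  lemma : ∀ i j t → i * i + t + 4 * i * j + 4 * j * j ≡ (i + 2 * j) * (i + 2 * j) + 0 * (i + 2 * j) + t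
  lemma = solve-∀

exp₂≡doubleExp : ∀ i j → exp₂ i j ≡ doubleExp 1 i j
exp₂≡doubleExp i j = trans (cong (λ x → x + 4 * i * j + 4 * j * j + 2 * j) (pentagonal₂ i)) (lemma i j (tri i))
  where
  lemma : ∀ i j t → i * i + t + i + 4 * i * j + 4 * j * j + 2 * j ≡ (i + 2 * j) * (i + 2 * j) + 1 * (i + 2 * j) + t
  lemma = solve-∀

doubleSum≈W : ∀ e m → (∀ i j → e i j ≡ doubleExp m i j) → doubleSum e (invPoch 1 1) (invPoch 2 2) ≈ W m
doubleSum≈W e m e≡ = Σ∞-cong λ i → Σ∞-cong λ j →
  ≈-trans (shift≈q^⊗ (e i j) (invPoch 1 1 i ⊗ invPoch 2 2 j))
          (≈-trans (⊗-congʳ (invPoch 1 1 i ⊗ invPoch 2 2 j) (q^-≡ (e≡ i j)))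
                   (≈-sym (*-assoc (q^ doubleExp m i j) (invPoch 1 1 i) (invPoch 2 2 j))))

rogersCoeff₀ : ∀ t → rogersCoeff 0 t ≈ sign t ⊗ q^ (5 * tri t + 2 * t)
rogersCoeff₀ t = ≈-trans (*-assoc (sign t ⊗ q^ (5 * tri t + 2 * t)) (poch 1 1 t) (invPoch 1 1 t))
                         (≈-trans (⊗-congˡ (sign t ⊗ q^ (5 * tri t + 2 * t)) (poch-inverse 0 1 t)) (*-identityʳ _))

R₀≈theta : R 0 ≈ theta 2 3
R₀≈theta = Σ∞-cong termwise
  where
  termwise : ∀ t → ρ 0 t ≈ thetaTerm 2 3 t
  termwise t = begin
    rogersCoeff 0 t ⊗ ⟦ Eρ ⟧ 0 t 0                   ≈⟨ ⊗-congʳ (⟦ Eρ ⟧ 0 t 0) (rogersCoeff₀ t) ⟩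
    sign t ⊗ q^ (5 * tri t + 2 * t) ⊗ (one ⊖ q^ e)   ≈⟨ distribute (sign t) (q^ (5 * tri t + 2 * t)) (q^ e) ⟩
    sign t ⊗ (q^ (5 * tri t + 2 * t) ⊖ q^ (5 * tri t + 2 * t) ⊗ q^ e)
      ≈⟨ ⊗-congˡ (sign t) (+-cong (≈-refl {q^ (5 * tri t + 2 * t)}) (-‿cong (q^-split (5 * tri t + 2 * t) e (exp-split t (tri t))))) ⟨
    thetaTerm 2 3 t                                  ∎
    where
    open ≈-Reasoning
    e = 3 + 3 * 0 + 6 * t + 0 * 0
    distribute : ∀ s x y → s ⊗ x ⊗ (one ⊖ y) ≈ s ⊗ (x ⊖ x ⊗ y)
    distribute = solve 3 (λ s x y → s :* x :* (con 1ℤ :- y) := s :* (x :- x :* y)) ≈-refl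
    exp-split : ∀ t r → 5 * (r + t) + 3 * suc t ≡ 5 * r + 2 * t + (3 + 3 * 0 + 6 * t + 0 * 0)
    exp-split = solve-∀

-- (1 - q) R 1 telescopes against θ(1, 4), both sides carrying the common factor (-1)ᵗ q^(5 tri t + t).
commonFactor : ℕ → FPS
commonFactor t = sign t ⊗ q^ (5 * tri t + t)

Eτ : Expr
Eτ = 𝕀 ⊟ χ (mono 0 0 3 0) ⊞ χ (mono 1 0 4 0) ⊟ χ (mono 1 0 5 0)

τ : ℕ → FPS
τ t = ⊝ (commonFactor t ⊗ ⟦ Eτ ⟧ 0 t 0)

ρ₁-factored : ∀ t → 1-q^ 1 ⊗ ρ 1 t ≈ commonFactor t ⊗ ⟦ χ (mono 0 0 1 0) ⊠ x↦0 Eρₘ₊₁ ⟧ 0 t 0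
ρ₁-factored t = begin
  1-q^ 1 ⊗ ρ 1 t                                       ≈⟨ ρ-m+1 0 t ⟩
  rogersCoeff 0 t ⊗ ⟦ Eρₘ₊₁ ⟧ 0 t 0                     ≈⟨ ⊗-congʳ (⟦ Eρₘ₊₁ ⟧ 0 t 0) (rogersCoeff₀ t) ⟩
  sign t ⊗ q^ (5 * tri t + 2 * t) ⊗ ⟦ Eρₘ₊₁ ⟧ 0 t 0     ≈⟨ ⊗-congʳ (⟦ Eρₘ₊₁ ⟧ 0 t 0) (⊗-congˡ (sign t) (q^-split (5 * tri t + t) t (exp-split t (tri t)))) ⟩
  sign t ⊗ (q^ (5 * tri t + t) ⊗ q^ t) ⊗ ⟦ Eρₘ₊₁ ⟧ 0 t 0 ≈⟨ regroup (sign t) (q^ (5 * tri t + t)) (q^ t) (⟦ Eρₘ₊₁ ⟧ 0 t 0) ⟩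
  commonFactor t ⊗ (q^ t ⊗ ⟦ Eρₘ₊₁ ⟧ 0 t 0)            ≈⟨ ⊗-congˡ (commonFactor t) (*-cong (q^-≡ (exp₀₀₁₀ t)) (≈-sym (x↦0-sound Eρₘ₊₁ 0 t 0))) ⟩
  commonFactor t ⊗ ⟦ χ (mono 0 0 1 0) ⊠ x↦0 Eρₘ₊₁ ⟧ 0 t 0 ∎
  where
  open ≈-Reasoning
  exp-split : ∀ t r → 5 * r + 2 * t ≡ 5 * r + t + t
  exp-split = solve-∀
  exp₀₀₁₀ : ∀ t → t ≡ 0 + 0 * 0 + 1 * t + 0 * 0
  exp₀₀₁₀ = solve-∀
  regroup : ∀ s x y e → s ⊗ (x ⊗ y) ⊗ e ≈ s ⊗ x ⊗ (y ⊗ e)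
  regroup = solve 4 (λ s x y e → s :* (x :* y) :* e := s :* x :* (y :* e)) ≈-refl

thetaTerm₁₄-factored : ∀ t → thetaTerm 1 4 t ≈ commonFactor t ⊗ ⟦ 𝕀 ⊟ χ (mono 4 0 8 0) ⟧ 0 t 0
thetaTerm₁₄-factored t = begin
  sign t ⊗ (q^ (5 * tri t + 1 * t) ⊖ q^ (5 * tri (suc t) + 4 * suc t))
    ≈⟨ ⊗-congˡ (sign t) (+-cong (q^-≡ (cong (5 * tri t +_) (ℕP.*-identityˡ t)))
                                (-‿cong (q^-split (5 * tri t + t) (4 + 0 * 0 + 8 * t + 0 * 0) (exp-split t (tri t))))) ⟩
  sign t ⊗ (q^ (5 * tri t + t) ⊖ q^ (5 * tri t + t) ⊗ q^ (4 + 0 * 0 + 8 * t + 0 * 0))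
    ≈⟨ factor (sign t) (q^ (5 * tri t + t)) (q^ (4 + 0 * 0 + 8 * t + 0 * 0)) ⟩
  commonFactor t ⊗ ⟦ 𝕀 ⊟ χ (mono 4 0 8 0) ⟧ 0 t 0 ∎
  where
  open ≈-Reasoning
  exp-split : ∀ t r → 5 * (r + t) + 4 * suc t ≡ 5 * r + t + (4 + 0 * 0 + 8 * t + 0 * 0)
  exp-split = solve-∀
  factor : ∀ s x y → s ⊗ (x ⊖ x ⊗ y) ≈ s ⊗ x ⊗ (one ⊖ y)
  factor = solve 3 (λ s x y → s :* (x :- x :* y) := s :* x :* (con 1ℤ :- y)) ≈-refl

τ-suc : ∀ t → τ (suc t) ≈ commonFactor t ⊗ ⟦ χ (mono 1 0 5 0) ⊠ y↦y+1 Eτ ⟧ 0 t 0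
τ-suc t = begin
  ⊝ (⊝ sign t ⊗ q^ (5 * tri (suc t) + suc t) ⊗ ⟦ Eτ ⟧ 0 (suc t) 0)
    ≈⟨ -‿cong (*-cong (⊗-congˡ (⊝ sign t) (q^-split (5 * tri t + t) (1 + 0 * 0 + 5 * t + 0 * 0) (exp-split t (tri t))))
                      (≈-sym (y↦y+1-sound Eτ 0 t 0))) ⟩
  ⊝ (⊝ sign t ⊗ (q^ (5 * tri t + t) ⊗ q^ (1 + 0 * 0 + 5 * t + 0 * 0)) ⊗ ⟦ y↦y+1 Eτ ⟧ 0 t 0)
    ≈⟨ regroup (sign t) (q^ (5 * tri t + t)) (q^ (1 + 0 * 0 + 5 * t + 0 * 0)) (⟦ y↦y+1 Eτ ⟧ 0 t 0) ⟩
  commonFactor t ⊗ ⟦ χ (mono 1 0 5 0) ⊠ y↦y+1 Eτ ⟧ 0 t 0 ∎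
  where
  open ≈-Reasoning
  exp-split : ∀ t r → 5 * (r + t) + suc t ≡ 5 * r + t + (1 + 0 * 0 + 5 * t + 0 * 0)
  exp-split = solve-∀
  regroup : ∀ s x y e → ⊝ (⊝ s ⊗ (x ⊗ y) ⊗ e) ≈ s ⊗ x ⊗ (y ⊗ e)
  regroup = solve 4 (λ s x y e → :- (:- s :* (x :* y) :* e) := s :* x :* (y :* e)) ≈-refl

R₁-telescopes : ∀ t → 1-q^ 1 ⊗ ρ 1 t ⊖ one ⊗ thetaTerm 1 4 t ≈ τ t ⊖ τ (suc t)
R₁-telescopes t = begin
  1-q^ 1 ⊗ ρ 1 t ⊖ one ⊗ thetaTerm 1 4 t
    ≈⟨ +-cong (ρ₁-factored t) (-‿cong (≈-trans (*-identityˡ (thetaTerm 1 4 t)) (thetaTerm₁₄-factored t))) ⟩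
  F ⊗ ⟦ A ⟧ 0 t 0 ⊖ F ⊗ ⟦ B ⟧ 0 t 0
    ≈⟨ factor F (⟦ A ⟧ 0 t 0) (⟦ B ⟧ 0 t 0) ⟩
  F ⊗ ⟦ A ⊟ B ⟧ 0 t 0
    ≈⟨ ⊗-congˡ F (monomial-identity 0 t 0 (A ⊟ B) (⊟ Eτ ⊟ C) refl) ⟩
  F ⊗ ⟦ ⊟ Eτ ⊟ C ⟧ 0 t 0
    ≈⟨ distribute F (⟦ Eτ ⟧ 0 t 0) (⟦ C ⟧ 0 t 0) ⟩
  τ t ⊖ F ⊗ ⟦ C ⟧ 0 t 0
    ≈⟨ +-cong (≈-refl {τ t}) (-‿cong (τ-suc t)) ⟨
  τ t ⊖ τ (suc t) ∎
  where
  open ≈-Reasoning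
  F = commonFactor t
  A = χ (mono 0 0 1 0) ⊠ x↦0 Eρₘ₊₁
  B = 𝕀 ⊟ χ (mono 4 0 8 0)
  C = χ (mono 1 0 5 0) ⊠ y↦y+1 Eτ
  factor : ∀ f a b → f ⊗ a ⊖ f ⊗ b ≈ f ⊗ (a ⊖ b)
  factor = solve 3 (λ f a b → f :* a :- f :* b := f :* (a :- b)) ≈-refl
  distribute : ∀ f a c → f ⊗ (⊝ a ⊖ c) ≈ ⊝ (f ⊗ a) ⊖ f ⊗ c
  distribute = solve 3 (λ f a c → f :* (:- a :- c) := :- (f :* a) :- f :* c) ≈-refl

R₁≈theta : 1-q^ 1 ⊗ R 1 ≈ theta 1 4
R₁≈theta = begin
  1-q^ 1 ⊗ R 1                   ≈⟨ Σ∞-⊗ (1-q^ 1) (ρ-summable 1) ⟨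
  Σ∞ (λ t → 1-q^ 1 ⊗ ρ 1 t)      ≈⟨ Σ∞-telescoping₁ τ one θ-summable τ-summable τ₀≈𝟘 R₁-telescopes ⟩
  one ⊗ theta 1 4                ≈⟨ *-identityˡ (theta 1 4) ⟩
  theta 1 4                      ∎
  where
  open ≈-Reasoning
  commonFactor≈[]𝟘 : ∀ t → commonFactor t ≈[ t ] 𝟘
  commonFactor≈[]𝟘 t = ≈[]-weaken (ℕP.m≤n+m t (5 * tri t)) (⊗q^≈[]𝟘 (5 * tri t + t) (sign t))
  θ-summable : Summable (thetaTerm 1 4)
  θ-summable t = ≈[]-trans (≈⇒≈[] (thetaTerm₁₄-factored t)) (⊗-zeroˡ[] (⟦ 𝕀 ⊟ χ (mono 4 0 8 0) ⟧ 0 t 0) (commonFactor≈[]𝟘 t))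
  τ-summable : Summable τ
  τ-summable t = ≈[]-trans (⊝-cong[] (⊗-zeroˡ[] (⟦ Eτ ⟧ 0 t 0) (commonFactor≈[]𝟘 t))) (≈⇒≈[] (coeffwise λ _ → refl))
  τ₀≈𝟘 : τ 0 ≈ 𝟘
  τ₀≈𝟘 = ≈-trans (-‿cong (⊗-congˡ (commonFactor 0) (≈-trans (cancel one (q^ 0) (q^ 1)) 1-q^-zero)))
                 (≈-trans (-‿cong (zeroʳ (commonFactor 0))) (coeffwise λ _ → refl))
    where
    cancel : ∀ a b c → a ⊖ b ⊕ c ⊖ c ≈ a ⊖ b
    cancel = solve 3 (λ a b c → a :- b :+ c :- c := a :- b) ≈-refl

Π₅ : FPS
Π₅ = Π< 5 λ r → poch∞ (1 + r) 5

Π₅-cancel : ∀ {x y} → Π₅ ⊗ x ≈ Π₅ ⊗ y → x ≈ y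
Π₅-cancel = ⊗-cancelˡ Π₅ I₅ (≈-trans (*-comm I₅ Π₅)
  (≈-trans (Π<-⊗ 5 (λ r → poch∞ (1 + r) 5) (λ r → invPoch∞ (1 + r) 5))
           (≈-trans (Π<-cong 5 λ r → poch∞-inverse r 4) (Π<-one 5))))
  where
  I₅ = Π< 5 λ r → invPoch∞ (1 + r) 5

Π₅⊗I₁I₄ : Π₅ ⊗ (invPoch∞ 1 5 ⊗ invPoch∞ 4 5) ≈ poch∞ 5 5 ⊗ (poch∞ 2 5 ⊗ poch∞ 3 5)
Π₅⊗I₁I₄ = ≈-trans (regroup (poch∞ 1 5) (poch∞ 2 5) (poch∞ 3 5) (poch∞ 4 5) (poch∞ 5 5) (invPoch∞ 1 5) (invPoch∞ 4 5))
  (≈-trans (⊗-congˡ (poch∞ 5 5 ⊗ (poch∞ 2 5 ⊗ poch∞ 3 5)) (*-cong (poch∞-inverse 0 4) (poch∞-inverse 3 4)))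
           (≈-trans (⊗-congˡ (poch∞ 5 5 ⊗ (poch∞ 2 5 ⊗ poch∞ 3 5)) (*-identityˡ one)) (*-identityʳ _)))
  where
  regroup : ∀ p₁ p₂ p₃ p₄ p₅ i₁ i₄ → one ⊗ p₁ ⊗ p₂ ⊗ p₃ ⊗ p₄ ⊗ p₅ ⊗ (i₁ ⊗ i₄) ≈ p₅ ⊗ (p₂ ⊗ p₃) ⊗ (p₁ ⊗ i₁ ⊗ (p₄ ⊗ i₄))
  regroup = solve 7 (λ p₁ p₂ p₃ p₄ p₅ i₁ i₄ → con 1ℤ :* p₁ :* p₂ :* p₃ :* p₄ :* p₅ :* (i₁ :* i₄)
                                              := p₅ :* (p₂ :* p₃) :* (p₁ :* i₁ :* (p₄ :* i₄))) ≈-refl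

Π₅⊗I₂I₃ : Π₅ ⊗ (invPoch∞ 2 5 ⊗ invPoch∞ 3 5) ≈ poch∞ 5 5 ⊗ (poch∞ 1 5 ⊗ poch∞ 4 5)
Π₅⊗I₂I₃ = ≈-trans (regroup (poch∞ 1 5) (poch∞ 2 5) (poch∞ 3 5) (poch∞ 4 5) (poch∞ 5 5) (invPoch∞ 2 5) (invPoch∞ 3 5))
  (≈-trans (⊗-congˡ (poch∞ 5 5 ⊗ (poch∞ 1 5 ⊗ poch∞ 4 5)) (*-cong (poch∞-inverse 1 4) (poch∞-inverse 2 4)))
           (≈-trans (⊗-congˡ (poch∞ 5 5 ⊗ (poch∞ 1 5 ⊗ poch∞ 4 5)) (*-identityˡ one)) (*-identityʳ _)))
  where
  regroup : ∀ p₁ p₂ p₃ p₄ p₅ i₂ i₃ → one ⊗ p₁ ⊗ p₂ ⊗ p₃ ⊗ p₄ ⊗ p₅ ⊗ (i₂ ⊗ i₃) ≈ p₅ ⊗ (p₁ ⊗ p₄) ⊗ (p₂ ⊗ i₂ ⊗ (p₃ ⊗ i₃))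
  regroup = solve 7 (λ p₁ p₂ p₃ p₄ p₅ i₂ i₃ → con 1ℤ :* p₁ :* p₂ :* p₃ :* p₄ :* p₅ :* (i₂ :* i₃)
                                              := p₅ :* (p₁ :* p₄) :* (p₂ :* i₂ :* (p₃ :* i₃))) ≈-refl

theorem3p4 : (∀ (n : ℕ) → doubleSum exp₁ (invPoch 1 1) (invPoch 2 2) n ≡ (invPoch∞ 1 5 ⊛ invPoch∞ 4 5) n)
    × (∀ (n : ℕ) → doubleSum exp₂ (invPoch 1 1) (invPoch 2 2) n ≡ (invPoch∞ 2 5 ⊛ invPoch∞ 3 5) n)
theorem3p4 = coeff first , coeff second
  where
  open ≈-Reasoning
  first : doubleSum exp₁ (invPoch 1 1) (invPoch 2 2) ≈ invPoch∞ 1 5 ⊗ invPoch∞ 4 5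
  first = Π₅-cancel (begin
    Π₅ ⊗ doubleSum exp₁ (invPoch 1 1) (invPoch 2 2)   ≈⟨ ⊗-congˡ Π₅ (doubleSum≈W exp₁ 0 exp₁≡doubleExp) ⟩
    Π₅ ⊗ W 0                                          ≈⟨ ⊗-congʳ (W 0) (poch∞-dissect 0 4) ⟨
    poch∞ 1 1 ⊗ W 0                                   ≈⟨ poch∞⊗W≈R 0 ⟩
    R 0                                               ≈⟨ R₀≈theta ⟩
    theta 2 3                                         ≈⟨ JacobiTripleProduct.jacobi-triple-product 1 2 ⟩
    poch∞ 5 5 ⊗ (poch∞ 2 5 ⊗ poch∞ 3 5)               ≈⟨ Π₅⊗I₁I₄ ⟨
    Π₅ ⊗ (invPoch∞ 1 5 ⊗ invPoch∞ 4 5)                ∎)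
  second : doubleSum exp₂ (invPoch 1 1) (invPoch 2 2) ≈ invPoch∞ 2 5 ⊗ invPoch∞ 3 5
  second = Π₅-cancel (begin
    Π₅ ⊗ doubleSum exp₂ (invPoch 1 1) (invPoch 2 2)   ≈⟨ ⊗-congˡ Π₅ (doubleSum≈W exp₂ 1 exp₂≡doubleExp) ⟩
    Π₅ ⊗ W 1                                          ≈⟨ ⊗-congʳ (W 1) (poch∞-dissect 0 4) ⟨
    poch∞ 1 1 ⊗ W 1                                   ≈⟨ ⊗-congʳ (W 1) (poch∞-shift 0) ⟩
    1-q^ 1 ⊗ poch∞ 2 1 ⊗ W 1                          ≈⟨ *-assoc (1-q^ 1) (poch∞ 2 1) (W 1) ⟩
    1-q^ 1 ⊗ (poch∞ 2 1 ⊗ W 1)                        ≈⟨ ⊗-congˡ (1-q^ 1) (poch∞⊗W≈R 1) ⟩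
    1-q^ 1 ⊗ R 1                                      ≈⟨ R₁≈theta ⟩
    theta 1 4                                         ≈⟨ JacobiTripleProduct.jacobi-triple-product 0 3 ⟩
    poch∞ 5 5 ⊗ (poch∞ 1 5 ⊗ poch∞ 4 5)               ≈⟨ Π₅⊗I₂I₃ ⟨
    Π₅ ⊗ (invPoch∞ 2 5 ⊗ invPoch∞ 3 5)                ∎)
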